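{- Under the Modified CFLS coloring $\varphi$ of $K_n$ ($n=2^{m^2}$), there is no copy of $K_5$ which is a 2-2-2-2-2 coloring in which three color classes are matchings and two are paths.
   Context: Let $m$ be a positive integer and $n=2^{m^2}$. The vertices of $K_n$ are the binary strings $v\in\{0,1\}^{m^2}$, written as $v=(v^{(1)},\dots,v^{(m)})$ with each block $v^{(k)}\in\{0,1\}^m$. Vertices (and blocks) are linearly ordered as binary integers: $x<y$ iff at the first bit where they differ, $x$ has 0 and $y$ has 1. For $x<y$, let $i$ be the first index with $x^{(i)}\ne y^{(i)}$; for $k\in[m]$ let $i_k$ be the first position at which the bits of $x^{(k)}$ and $y^{(k)}$ differ ($i_k=0$ if $x^{(k)}=y^{(k)}$), and let $\delta_k=+1$ if $x^{(k)}\le y^{(k)}$ and $\delta_k=-1$ if $x^{(k)}>y^{(k)}$. The Modified CFLS coloring assigns to edge $xy$ the color $\varphi(xy)=((i,\{x^{(i)},y^{(i)}\}),i_1,\dots,i_m,\delta_1,\dots,\delta_m)$. A copy of $K_5$ is a 2-2-2-2-2 coloring if its ten edges receive exactly five colors, each on exactly two edges; each color class is then either a matching (two disjoint edges) or a path of length 2 (two edges sharing a vertex). -}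

module Defs where

open import Data.Nat using (ℕ; zero; suc; _*_)
open import Data.Bool using (Bool; true; false; not; if_then_else_)
import Data.Bool as B
open import Data.Fin using (Fin; zero; suc)
open import Data.Vec using (Vec; []; _∷_; concat; zipWith)
open import Data.Vec.Properties using (≡-dec)
open import Data.Maybe using (Maybe; just; nothing; maybe′)
open import Data.Product using (_×_; _,_; proj₁; Σ; ∃)
open import Data.Sum using (_⊎_)
open import Data.Sign using (Sign; +; -)
open import Relation.Nullary using (¬_; yes; no)
open import Relation.Binary.PropositionalEquality using (_≡_)
open import Relation.Binary.Definitions using (DecidableEquality)

firstDiff : ∀ {A : Set} {k : ℕ} → DecidableEquality A →
            Vec A k → Vec A k → Maybe (ℕ × A × A)
firstDiff _≟_ [] [] = nothing
firstDiff _≟_ (a ∷ as) (b ∷ bs) with a ≟ b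
... | no _  = just (1 , a , b)
... | yes _ with firstDiff _≟_ as bs
...   | nothing = nothing
...   | just (p , c , d) = just (suc p , c , d)

ltBits : ∀ {k} → Vec Bool k → Vec Bool k → Bool
ltBits x y = maybe′ (λ { (_ , a , _) → not a }) false (firstDiff B._≟_ x y)

-- Blocks are bit strings of length m; a vertex is a sequence of m blocks,
-- i.e. a binary string of length m² (the concatenation of its blocks).
Block : ℕ → Set
Block m = Vec Bool m

Vertex : ℕ → Set
Vertex m = Vec (Block m) m

ltV : ∀ {m} → Vertex m → Vertex m → Bool
ltV x y = ltBits (concat x) (concat y)

-- i_k : first bit position (1..m) where the blocks differ, 0 if equal.
idxBits : ∀ {m} → Block m → Block m → ℕ
idxBits a b = maybe′ proj₁ 0 (firstDiff B._≟_ a b)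

δBits : ∀ {m} → Block m → Block m → Sign
δBits a b = if ltBits b a then - else +

-- An unordered pair {a , b} of blocks, represented canonically as
-- (min , max) in the binary order.
UPair : ℕ → Set
UPair m = Block m × Block m

upair : ∀ {m} → Block m → Block m → UPair m
upair a b = if ltBits b a then (b , a) else (a , b)

-- Colors: ((i , {x^(i), y^(i)}) , (i_1..i_m) , (δ_1..δ_m)).
-- The first component is 'nothing' only when x = y (never for an edge).
Color : ℕ → Set
Color m = Maybe (ℕ × UPair m) × Vec ℕ m × Vec Sign m

-- φ(xy) for x < y.
φ : ∀ {m} → Vertex m → Vertex m → Color m
φ x y =
  ( maybe′ (λ { (i , a , b) → just (i , upair a b) }) nothing
           (firstDiff (≡-dec B._≟_) x y)
  , zipWith idxBits x y
  , zipWith δBits x y )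

edgeColor : ∀ {m} → Vertex m → Vertex m → Color m
edgeColor x y = if ltV x y then φ x y else φ y x

K5edge : Fin 10 → Fin 5 × Fin 5
K5edge zero = (zero , suc zero)
K5edge (suc zero) = (zero , suc (suc zero))
K5edge (suc (suc zero)) = (zero , suc (suc (suc zero)))
K5edge (suc (suc (suc zero))) = (zero , suc (suc (suc (suc zero))))
K5edge (suc (suc (suc (suc zero)))) = (suc zero , suc (suc zero))
K5edge (suc (suc (suc (suc (suc zero))))) = (suc zero , suc (suc (suc zero)))
K5edge (suc (suc (suc (suc (suc (suc zero)))))) = (suc zero , suc (suc (suc (suc zero))))
K5edge (suc (suc (suc (suc (suc (suc (suc zero))))))) = (suc (suc zero) , suc (suc (suc zero)))
K5edge (suc (suc (suc (suc (suc (suc (suc (suc zero)))))))) = (suc (suc zero) , suc (suc (suc (suc zero))))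
K5edge (suc (suc (suc (suc (suc (suc (suc (suc (suc zero))))))))) = (suc (suc (suc zero)) , suc (suc (suc (suc zero))))

_∈E_ : Fin 5 → Fin 10 → Set
v ∈E e = let (a , b) = K5edge e in (v ≡ a) ⊎ (v ≡ b)

ShareVertex : Fin 10 → Fin 10 → Set
ShareVertex e e′ = ∃ λ v → (v ∈E e) × (v ∈E e′)

record ExactlyTwo {C : Set} (col : Fin 10 → C) (c : C) : Set where
  field
    e₁ e₂  : Fin 10
    e₁≢e₂  : ¬ (e₁ ≡ e₂)
    col₁   : col e₁ ≡ c
    col₂   : col e₂ ≡ c
    only   : ∀ e → col e ≡ c → (e ≡ e₁) ⊎ (e ≡ e₂)

IsMatching : ∀ {C} {col : Fin 10 → C} {c : C} → ExactlyTwo col c → Set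
IsMatching t = ¬ ShareVertex (ExactlyTwo.e₁ t) (ExactlyTwo.e₂ t)

IsPath : ∀ {C} {col : Fin 10 → C} {c : C} → ExactlyTwo col c → Set
IsPath t = ShareVertex (ExactlyTwo.e₁ t) (ExactlyTwo.e₂ t)

record Is22222-3M2P {C : Set} (col : Fin 10 → C) : Set where
  field
    cs       : Fin 5 → C
    cs-inj   : ∀ j j′ → cs j ≡ cs j′ → j ≡ j′
    covers   : ∀ e → ∃ λ j → col e ≡ cs j
    classes  : ∀ j → ExactlyTwo col (cs j)
    match₀   : IsMatching (classes zero)
    match₁   : IsMatching (classes (suc zero))
    match₂   : IsMatching (classes (suc (suc zero)))
    path₃    : IsPath (classes (suc (suc (suc zero))))
    path₄    : IsPath (classes (suc (suc (suc (suc zero)))))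

copyColoring : ∀ {m} → (Fin 5 → Vertex m) → Fin 10 → Color m
copyColoring f e = let (a , b) = K5edge e in edgeColor (f a) (f b)

module Submission where

-- The colour of an edge xy is determined, position by position, by where the bit strings of its
-- endpoints first differ: within each block this gives (i_k , δ_k), and over the sequence of
-- blocks it gives (i , {x^(i) , y^(i)}). Hence a finite amount of information decides whether two
-- edges of a K₅ can have the same colour: at each position it suffices to know which of the five
-- strings agree there (32 bit patterns, or 52 equality patterns of blocks), and an equality of
-- colours either is decided at the first position where one of the edges splits or passes to
-- the remaining positions. Checkers built on this are sound for strings of every length.
-- A computer-found certificate then runs through all ways of pairing the ten edges into five
-- colour classes: each pairing either does not have three matching and two path classes, or,
-- after case splits on the orientations of some edges, forces two edges of different classes
-- to get equal colours, or forces a triangle to be oriented cyclically.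

open import Defs
open import Data.Nat using (ℕ; zero; suc; _*_; _≤_)
open import Data.Bool using (Bool; true; false; not; T; _∧_; _∨_; _xor_; if_then_else_)
import Data.Bool as B
open import Data.Bool.Properties using (T-≡; T-not-≡; T-∧; T-∨; not-involutive; not-¬)
open import Data.Unit using (tt)
open import Data.Fin using (Fin; zero; suc)
open import Data.Fin.Patterns
open import Data.Fin.Properties using (_≟_)
open import Data.Vec using (Vec; []; _∷_; _++_; concat; head; tail; lookup; tabulate; zipWith)
open import Data.Vec.Properties using (≡-dec; ++-injectiveˡ; ++-injectiveʳ; lookup∘tabulate)
open import Data.List using (List; []; _∷_; filterᵇ; map; allFin)
open import Data.Bool.ListAction using (all; any)
import Data.List as List
open import Data.List.Membership.Propositional using (_∈_; find)
open import Data.List.Membership.Propositional.Properties using (∈-filter⁻; ∈-++⁺ˡ; ∈-++⁺ʳ; ∈-map⁺; ∈-allFin)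
open import Data.List.Membership.DecPropositional {A = Vec Bool 10} (≡-dec B._≟_) using (_∈?_)
open import Data.List.Relation.Unary.Any using (Any; here; there)
import Data.List.Relation.Unary.All as All
open import Data.List.Relation.Unary.All.Properties using (all⁺; all⁻)
open import Data.List.Relation.Unary.Any.Properties using (any⁻)
open import Data.Maybe using (Maybe; just; nothing; maybe′)
import Data.Maybe as Maybe
open import Data.Maybe.Properties using (just-injective)
open import Data.Product using (_×_; _,_; proj₁; proj₂; ∃)
open import Data.Sum using (_⊎_; inj₁; inj₂; [_,_]′)
open import Data.Sign using (Sign; +; -)
open import Data.Empty using (⊥; ⊥-elim)
open import Function using (_∘_)
open import Function.Bundles using (Equivalence)
open import Function.Definitions using (Injective)
open import Relation.Nullary using (¬_; yes; no; contradiction)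
open import Relation.Nullary.Decidable using (T?; ⌊_⌋; toWitness; fromWitness; fromWitnessFalse)
open import Relation.Binary.PropositionalEquality
open import Relation.Binary.Definitions using (DecidableEquality)

variable
  n ℓ : ℕ

∧⁻ : ∀ {a b} → T (a ∧ b) → T a × T b
∧⁻ = Equivalence.to T-∧

∧⁺ : ∀ {a b} → T a → T b → T (a ∧ b)
∧⁺ p q = Equivalence.from T-∧ (p , q)

∨⁻ : ∀ {a b} → T (a ∨ b) → T a ⊎ T b
∨⁻ = Equivalence.to T-∨

∨⁺ˡ : ∀ {a b} → T a → T (a ∨ b)
∨⁺ˡ {true} _ = tt

∨⁺ʳ : ∀ a {b} → T b → T (a ∨ b)
∨⁺ʳ true  _ = tt
∨⁺ʳ false t = t

all-elim : {A : Set} (p : A → Bool) (xs : List A) → T (all p xs) → ∀ {x} → x ∈ xs → T (p x)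
all-elim p xs h x∈xs = All.lookup (all⁺ p xs h) x∈xs

all-elim-≡ : {A : Set} (p : A → Bool) (xs : List A) → all p xs ≡ true → ∀ {x} → x ∈ xs → T (p x)
all-elim-≡ p xs h = all-elim p xs (Equivalence.from T-≡ h)

all-allFin : ∀ {k} (p : Fin k → Bool) → T (all p (allFin k)) → ∀ i → T (p i)
all-allFin {k} p h i = all-elim p (allFin k) h (∈-allFin i)

any-allFin : ∀ {k} (p : Fin k → Bool) → T (any p (allFin k)) → ∃ λ i → T (p i)
any-allFin {k} p h = let i , _ , pi = find (any⁻ p (allFin k) h) in i , pi

T-not⇒¬T : ∀ {a} → T (not a) → ¬ T a
T-not⇒¬T {false} _ ()

T-xor⇒≢ : ∀ {a b} → T (a xor b) → a ≢ b
T-xor⇒≢ {true}  {true}  ()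
T-xor⇒≢ {false} {false} ()
T-xor⇒≢ {true}  {false} _ ()
T-xor⇒≢ {false} {true}  _ ()

T-not-xor⇒≡ : ∀ {a b} → T (not (a xor b)) → a ≡ b
T-not-xor⇒≡ {true}  {true}  _ = refl
T-not-xor⇒≡ {false} {false} _ = refl

all-universal : {A : Set} (p : A → Bool) (xs : List A) → (∀ x → T (p x)) → T (all p xs)
all-universal p xs h = all⁻ p (All.universal h xs)

allBitVecs : ∀ n → List (Vec Bool n)
allBitVecs zero    = [] ∷ []
allBitVecs (suc n) = map (true ∷_) (allBitVecs n) List.++ map (false ∷_) (allBitVecs n)

∈-allBitVecs : (v : Vec Bool n) → v ∈ allBitVecs n
∈-allBitVecs []       = here refl
∈-allBitVecs (true  ∷ v) = ∈-++⁺ˡ (∈-map⁺ (true ∷_) (∈-allBitVecs v))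
∈-allBitVecs {suc n} (false ∷ v) = ∈-++⁺ʳ (map (true ∷_) (allBitVecs n)) (∈-map⁺ (false ∷_) (∈-allBitVecs v))

concat-injective : {A : Set} (xs ys : Vec (Vec A ℓ) n) → concat xs ≡ concat ys → xs ≡ ys
concat-injective []       []       _  = refl
concat-injective (x ∷ xs) (y ∷ ys) eq =
  cong₂ _∷_ (++-injectiveˡ x y eq) (concat-injective xs ys (++-injectiveʳ x y eq))

concat-head-tail : {A : Set} (xs : Vec (Vec A ℓ) (suc n)) → concat xs ≡ head xs ++ concat (tail xs)
concat-head-tail (x ∷ xs) = refl

-- Lexicographic order on bit strings

lexLt : Vec Bool n → Vec Bool n → Bool
lexLt []          []          = false
lexLt (false ∷ u) (false ∷ v) = lexLt u v
lexLt (true  ∷ u) (true  ∷ v) = lexLt u v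
lexLt (false ∷ u) (true  ∷ v) = true
lexLt (true  ∷ u) (false ∷ v) = false

lexLt-cons : ∀ a (u v : Vec Bool n) → lexLt (a ∷ u) (a ∷ v) ≡ lexLt u v
lexLt-cons false u v = refl
lexLt-cons true  u v = refl

ltBits≡lexLt : (u v : Vec Bool n) → ltBits u v ≡ lexLt u v
ltBits≡lexLt []          []          = refl
ltBits≡lexLt (false ∷ u) (true  ∷ v) = refl
ltBits≡lexLt (true  ∷ u) (false ∷ v) = refl
ltBits≡lexLt (false ∷ u) (false ∷ v) with firstDiff B._≟_ u v | ltBits≡lexLt u v
... | nothing | ih = ih
... | just _  | ih = ih
ltBits≡lexLt (true ∷ u) (true ∷ v) with firstDiff B._≟_ u v | ltBits≡lexLt u v
... | nothing | ih = ih
... | just _  | ih = ih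

lexLt-trans : (u v w : Vec Bool n) → lexLt u v ≡ true → lexLt v w ≡ true → lexLt u w ≡ true
lexLt-trans []          []          []          () q
lexLt-trans (false ∷ u) (false ∷ v) (false ∷ w) p q = lexLt-trans u v w p q
lexLt-trans (true  ∷ u) (true  ∷ v) (true  ∷ w) p q = lexLt-trans u v w p q
lexLt-trans (false ∷ u) (false ∷ v) (true  ∷ w) p q = refl
lexLt-trans (false ∷ u) (true  ∷ v) (true  ∷ w) p q = refl
lexLt-trans (false ∷ u) (true  ∷ v) (false ∷ w) p ()
lexLt-trans (true  ∷ u) (true  ∷ v) (false ∷ w) p ()
lexLt-trans (true  ∷ u) (false ∷ v) w           () q

lexLt-flip : (u v : Vec Bool n) → u ≢ v → lexLt v u ≡ not (lexLt u v)
lexLt-flip []          []          u≢v = contradiction refl u≢v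
lexLt-flip (false ∷ u) (true  ∷ v) u≢v = refl
lexLt-flip (true  ∷ u) (false ∷ v) u≢v = refl
lexLt-flip (false ∷ u) (false ∷ v) u≢v = lexLt-flip u v (λ u≡v → u≢v (cong (false ∷_) u≡v))
lexLt-flip (true  ∷ u) (true  ∷ v) u≢v = lexLt-flip u v (λ u≡v → u≢v (cong (true ∷_) u≡v))

lexLt-irrefl : (u : Vec Bool n) → lexLt u u ≡ false
lexLt-irrefl []          = refl
lexLt-irrefl (false ∷ u) = lexLt-irrefl u
lexLt-irrefl (true  ∷ u) = lexLt-irrefl u

lexLt-++-common : (w : Vec Bool n) (u v : Vec Bool ℓ) → lexLt (w ++ u) (w ++ v) ≡ lexLt u v
lexLt-++-common []      u v = refl
lexLt-++-common (a ∷ w) u v = trans (lexLt-cons a (w ++ u) (w ++ v)) (lexLt-++-common w u v)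

lexLt-++-differ : (w w′ : Vec Bool n) (u v : Vec Bool ℓ) → w ≢ w′ → lexLt (w ++ u) (w′ ++ v) ≡ lexLt w w′
lexLt-++-differ []          []           u v w≢w′ = contradiction refl w≢w′
lexLt-++-differ (false ∷ w) (true  ∷ w′) u v w≢w′ = refl
lexLt-++-differ (true  ∷ w) (false ∷ w′) u v w≢w′ = refl
lexLt-++-differ (false ∷ w) (false ∷ w′) u v w≢w′ = lexLt-++-differ w w′ u v (λ w≡w′ → w≢w′ (cong (false ∷_) w≡w′))
lexLt-++-differ (true  ∷ w) (true  ∷ w′) u v w≢w′ = lexLt-++-differ w w′ u v (λ w≡w′ → w≢w′ (cong (true ∷_) w≡w′))

ltBits-flip : (u v : Vec Bool n) → u ≢ v → ltBits v u ≡ not (ltBits u v)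
ltBits-flip u v u≢v = begin
  ltBits v u        ≡⟨ ltBits≡lexLt v u ⟩
  lexLt v u         ≡⟨ lexLt-flip u v u≢v ⟩
  not (lexLt u v)   ≡⟨ cong not (ltBits≡lexLt u v) ⟨
  not (ltBits u v)  ∎
  where open ≡-Reasoning

ltV≡lexLt : ∀ {m} (x y : Vertex m) → ltV x y ≡ lexLt (concat x) (concat y)
ltV≡lexLt x y = ltBits≡lexLt (concat x) (concat y)

ltV⇒lexLt : ∀ {m} (x y : Vertex m) {b} → ltV x y ≡ b → lexLt (concat x) (concat y) ≡ b
ltV⇒lexLt x y eq = trans (sym (ltV≡lexLt x y)) eq

ltV-false⇒flipped : ∀ {m} (x y : Vertex m) → x ≢ y → ltV x y ≡ false → lexLt (concat y) (concat x) ≡ true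
ltV-false⇒flipped x y x≢y xy =
  trans (lexLt-flip _ _ (λ eq → x≢y (concat-injective x y eq))) (cong not (ltV⇒lexLt x y xy))

no-cyclic-triangle : ∀ {m} (x y z : Vertex m) → x ≢ y → y ≢ z → ∀ t →
                     ltV x y ≡ t → ltV y z ≡ t → ltV x z ≡ not t → ⊥
no-cyclic-triangle x y z _ _ true xy yz xz
  with () ← trans (sym (lexLt-trans (concat x) (concat y) (concat z) (ltV⇒lexLt x y xy) (ltV⇒lexLt y z yz))) (ltV⇒lexLt x z xz)
no-cyclic-triangle x y z x≢y y≢z false xy yz xz
  with () ← trans (sym (lexLt-irrefl (concat x)))
                  (lexLt-trans (concat x) (concat z) (concat x) (ltV⇒lexLt x z xz)
                    (lexLt-trans (concat z) (concat y) (concat x) (ltV-false⇒flipped y z y≢z yz) (ltV-false⇒flipped x y x≢y xy)))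

firstDiff-position-suc : {A : Set} (_≟_ : DecidableEquality A) (u v : Vec A n) {p : ℕ} {a b : A} →
                         firstDiff _≟_ u v ≡ just (p , a , b) → ∃ λ j → p ≡ suc j
firstDiff-position-suc _≟_ []      []      ()
firstDiff-position-suc _≟_ (x ∷ u) (y ∷ v) eq with x ≟ y
... | no _ = 0 , cong proj₁ (just-injective (sym eq))
... | yes _ with firstDiff _≟_ u v
...   | just (q , _) = q , cong proj₁ (just-injective (sym eq))
...   | nothing with () ← eq

bitColour : Vec Bool n → Vec Bool n → ℕ × Sign
bitColour u v = idxBits u v , δBits u v

signOf : Bool → Sign
signOf true  = -
signOf false = +

shiftPos : ℕ → ℕ
shiftPos zero    = zero
shiftPos (suc k) = suc (suc k)

shiftColour : ℕ × Sign → ℕ × Sign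
shiftColour (i , s) = shiftPos i , s

shiftColour-injective : ∀ {c c′} → shiftColour c ≡ shiftColour c′ → c ≡ c′
shiftColour-injective {zero  , s} {zero  , s′} refl = refl
shiftColour-injective {suc i , s} {suc i′ , s′} refl = refl

signOf-injective : ∀ {a b} → signOf a ≡ signOf b → a ≡ b
signOf-injective {true}  {true}  _ = refl
signOf-injective {false} {false} _ = refl

shiftColour≢1 : ∀ c s → shiftColour c ≢ (1 , s)
shiftColour≢1 (zero  , _) s ()
shiftColour≢1 (suc i , _) s ()

bitColour-[] : (u v : Vec Bool 0) → bitColour u v ≡ (0 , +)
bitColour-[] [] [] = refl

idxBits-cons : ∀ a (u v : Vec Bool n) → idxBits (a ∷ u) (a ∷ v) ≡ shiftPos (idxBits u v)
idxBits-cons a u v with a B.≟ a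
... | no a≢a = contradiction refl a≢a
... | yes _ with firstDiff B._≟_ u v in eq
...   | nothing = refl
...   | just _ with firstDiff-position-suc B._≟_ u v eq
...     | _ , refl = refl

bitColour-differ : (u v : Vec Bool (suc n)) → head u ≢ head v → bitColour u v ≡ (1 , signOf (head u))
bitColour-differ (false ∷ u) (true  ∷ v) _   = refl
bitColour-differ (true  ∷ u) (false ∷ v) _   = refl
bitColour-differ (false ∷ u) (false ∷ v) a≢b = contradiction refl a≢b
bitColour-differ (true  ∷ u) (true  ∷ v) a≢b = contradiction refl a≢b

bitColour-agree : (u v : Vec Bool (suc n)) → head u ≡ head v →
                  bitColour u v ≡ shiftColour (bitColour (tail u) (tail v))
bitColour-agree (a ∷ u) (.a ∷ v) refl = cong₂ _,_ (idxBits-cons a u v) (cong (λ b → if b then - else +) ltBits-cons)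
  where
  ltBits-cons : ltBits (a ∷ v) (a ∷ u) ≡ ltBits v u
  ltBits-cons = begin
    ltBits (a ∷ v) (a ∷ u) ≡⟨ ltBits≡lexLt (a ∷ v) (a ∷ u) ⟩
    lexLt (a ∷ v) (a ∷ u)  ≡⟨ lexLt-cons a v u ⟩
    lexLt v u              ≡⟨ ltBits≡lexLt v u ⟨
    ltBits v u             ∎
    where open ≡-Reasoning

upair-comm : (a b : Vec Bool ℓ) → a ≢ b → upair a b ≡ upair b a
upair-comm a b a≢b with ltBits b a in ba | ltBits a b in ab | ltBits-flip a b a≢b
... | true  | false | _ = refl
... | false | true  | _ = refl
... | true  | true  | ()
... | false | false | ()

upair-inv : (a b c d : Vec Bool ℓ) → upair a b ≡ upair c d → (a ≡ c × b ≡ d) ⊎ (a ≡ d × b ≡ c)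
upair-inv a b c d eq with ltBits b a | ltBits d c
... | true  | true  = inj₁ (cong proj₂ eq , cong proj₁ eq)
... | true  | false = inj₂ (cong proj₂ eq , cong proj₁ eq)
... | false | true  = inj₂ (cong proj₁ eq , cong proj₂ eq)
... | false | false = inj₁ (cong proj₁ eq , cong proj₂ eq)

FirstBlock : ℕ → Set
FirstBlock ℓ = Maybe (ℕ × UPair ℓ)

firstBlock : Vec (Vec Bool ℓ) n → Vec (Vec Bool ℓ) n → FirstBlock ℓ
firstBlock x y with firstDiff (≡-dec B._≟_) x y
... | nothing          = nothing
... | just (i , a , b) = just (i , upair a b)

proj₁-φ : ∀ {m} (x y : Vertex m) → proj₁ (φ x y) ≡ firstBlock x y
proj₁-φ x y with firstDiff (≡-dec B._≟_) x y
... | nothing = refl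
... | just _  = refl

shiftFirst : FirstBlock ℓ → FirstBlock ℓ
shiftFirst nothing        = nothing
shiftFirst (just (i , c)) = just (suc i , c)

shiftFirst-injective : {c c′ : FirstBlock ℓ} → shiftFirst c ≡ shiftFirst c′ → c ≡ c′
shiftFirst-injective {c = nothing}      {nothing}       _    = refl
shiftFirst-injective {c = just (i , c)} {just (i′ , c′)} refl = refl

firstBlock-[] : (x y : Vec (Vec Bool ℓ) 0) → firstBlock x y ≡ nothing
firstBlock-[] [] [] = refl

firstBlock-differ : (u v : Vec (Vec Bool ℓ) (suc n)) → head u ≢ head v →
                    firstBlock u v ≡ just (1 , upair (head u) (head v))
firstBlock-differ (a ∷ u) (b ∷ v) a≢b with ≡-dec B._≟_ a b
... | yes a≡b = contradiction a≡b a≢b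
... | no _    = refl

firstBlock-agree : (u v : Vec (Vec Bool ℓ) (suc n)) → head u ≡ head v →
                   firstBlock u v ≡ shiftFirst (firstBlock (tail u) (tail v))
firstBlock-agree (a ∷ u) (.a ∷ v) refl with ≡-dec B._≟_ a a
... | no a≢a = contradiction refl a≢a
... | yes _ with firstDiff (≡-dec B._≟_) u v
...   | nothing = refl
...   | just _  = refl

shiftFirst-firstBlock≢1 : (u v : Vec (Vec Bool ℓ) n) (c : UPair ℓ) → shiftFirst (firstBlock u v) ≢ just (1 , c)
shiftFirst-firstBlock≢1 u v c with firstDiff (≡-dec B._≟_) u v in eq
... | just _ with firstDiff-position-suc (≡-dec B._≟_) u v eq
...   | _ , refl = λ ()
shiftFirst-firstBlock≢1 u v c | nothing = λ ()

blockColours : Vec (Vec Bool ℓ) n → Vec (Vec Bool ℓ) n → Vec ℕ n × Vec Sign n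
blockColours x y = zipWith idxBits x y , zipWith δBits x y

consColour : ℕ × Sign → Vec ℕ n × Vec Sign n → Vec ℕ (suc n) × Vec Sign (suc n)
consColour (i , s) (is , ss) = i ∷ is , s ∷ ss

consColour-injective : ∀ {c d} {cs ds : Vec ℕ n × Vec Sign n} → consColour c cs ≡ consColour d ds → c ≡ d × cs ≡ ds
consColour-injective {c = _ , _} {_ , _} {_ , _} {_ , _} refl = refl , refl

blockColours-[] : (x y : Vec (Vec Bool ℓ) 0) → blockColours x y ≡ ([] , [])
blockColours-[] [] [] = refl

blockColours-head-tail : (x y : Vec (Vec Bool ℓ) (suc n)) →
                         blockColours x y ≡ consColour (bitColour (head x) (head y)) (blockColours (tail x) (tail y))
blockColours-head-tail (a ∷ x) (b ∷ y) = refl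

Edge : Set
Edge = Fin 10

end₁ end₂ : Edge → Fin 5
end₁ = proj₁ ∘ K5edge
end₂ = proj₂ ∘ K5edge

EdgePair : Set
EdgePair = Edge × Edge

EqualOn : {X : Set} → (Edge → X) → List EdgePair → Set
EqualOn col C = ∀ {p} → p ∈ C → col (proj₁ p) ≡ col (proj₂ p)

bothAgree : (Edge → Bool) → EdgePair → Bool
bothAgree splits p = not (splits (proj₁ p)) ∧ not (splits (proj₂ p))

end₁≢end₂ : ∀ e → end₁ e ≢ end₂ e
end₁≢end₂ 0F ()
end₁≢end₂ 1F ()
end₁≢end₂ 2F ()
end₁≢end₂ 3F ()
end₁≢end₂ 4F ()
end₁≢end₂ 5F ()
end₁≢end₂ 6F ()
end₁≢end₂ 7F ()
end₁≢end₂ 8F ()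
end₁≢end₂ 9F ()

-- The edge joining p and q; the diagonal entries are junk.
pairIndex : Fin 5 → Fin 5 → Edge
pairIndex p q = lookup (lookup table p) q
  where
  table : Vec (Vec Edge 5) 5
  table = (0F ∷ 0F ∷ 1F ∷ 2F ∷ 3F ∷ [])
        ∷ (0F ∷ 0F ∷ 4F ∷ 5F ∷ 6F ∷ [])
        ∷ (1F ∷ 4F ∷ 0F ∷ 7F ∷ 8F ∷ [])
        ∷ (2F ∷ 5F ∷ 7F ∷ 0F ∷ 9F ∷ [])
        ∷ (3F ∷ 6F ∷ 8F ∷ 9F ∷ 0F ∷ [])
        ∷ []

pairIndex-ends : ∀ p q → p ≢ q → K5edge (pairIndex p q) ≡ (p , q) ⊎ K5edge (pairIndex p q) ≡ (q , p)
pairIndex-ends 0F 0F p≢q = contradiction refl p≢q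
pairIndex-ends 0F 1F p≢q = inj₁ refl
pairIndex-ends 0F 2F p≢q = inj₁ refl
pairIndex-ends 0F 3F p≢q = inj₁ refl
pairIndex-ends 0F 4F p≢q = inj₁ refl
pairIndex-ends 1F 0F p≢q = inj₂ refl
pairIndex-ends 1F 1F p≢q = contradiction refl p≢q
pairIndex-ends 1F 2F p≢q = inj₁ refl
pairIndex-ends 1F 3F p≢q = inj₁ refl
pairIndex-ends 1F 4F p≢q = inj₁ refl
pairIndex-ends 2F 0F p≢q = inj₂ refl
pairIndex-ends 2F 1F p≢q = inj₂ refl
pairIndex-ends 2F 2F p≢q = contradiction refl p≢q
pairIndex-ends 2F 3F p≢q = inj₁ refl
pairIndex-ends 2F 4F p≢q = inj₁ refl
pairIndex-ends 3F 0F p≢q = inj₂ refl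
pairIndex-ends 3F 1F p≢q = inj₂ refl
pairIndex-ends 3F 2F p≢q = inj₂ refl
pairIndex-ends 3F 3F p≢q = contradiction refl p≢q
pairIndex-ends 3F 4F p≢q = inj₁ refl
pairIndex-ends 4F 0F p≢q = inj₂ refl
pairIndex-ends 4F 1F p≢q = inj₂ refl
pairIndex-ends 4F 2F p≢q = inj₂ refl
pairIndex-ends 4F 3F p≢q = inj₂ refl
pairIndex-ends 4F 4F p≢q = contradiction refl p≢q

module Descent {X : Set} (shift : X → X) (shift-injective : ∀ {x y} → shift x ≡ shift y → x ≡ y)
               (splits : Edge → Bool) (col col′ : Edge → X)
               (col-agree : ∀ e → T (not (splits e)) → col e ≡ shift (col′ e))
               (col-split : ∀ e e′ → T (splits e) → col e ≢ shift (col′ e′)) where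

  descend : ∀ p → T (bothAgree splits p) → col (proj₁ p) ≡ col (proj₂ p) → col′ (proj₁ p) ≡ col′ (proj₂ p)
  descend (e , e′) agree eq =
    let a , a′ = ∧⁻ agree in shift-injective (trans (sym (col-agree e a)) (trans eq (col-agree e′ a′)))

  ascend : ∀ p → T (bothAgree splits p) → col′ (proj₁ p) ≡ col′ (proj₂ p) → col (proj₁ p) ≡ col (proj₂ p)
  ascend (e , e′) agree eq =
    let a , a′ = ∧⁻ agree in trans (col-agree e a) (trans (cong shift eq) (sym (col-agree e′ a′)))

  split-≢-agree : ∀ {e e′} → T (splits e) → T (not (splits e′)) → col e ≢ col e′
  split-≢-agree {e} {e′} s a eq = col-split e e′ s (trans eq (col-agree e′ a))

  one-splits-≢ : ∀ {e e′} → T (splits e xor splits e′) → col e ≢ col e′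
  one-splits-≢ {e} {e′} one with splits e in se | splits e′ in se′
  ... | true  | false = split-≢-agree (Equivalence.from T-≡ se) (Equivalence.from T-not-≡ se′)
  ... | false | true  = λ eq → split-≢-agree (Equivalence.from T-≡ se′) (Equivalence.from T-not-≡ se) (sym eq)

  EqualOn-all : ∀ {C} → T (all (bothAgree splits) C) → EqualOn col C → EqualOn col′ C
  EqualOn-all agree eqs {p} p∈C = descend p (All.lookup (all⁺ _ _ agree) p∈C) (eqs p∈C)

  EqualOn-filter : ∀ {C} → EqualOn col C → EqualOn col′ (filterᵇ (bothAgree splits) C)
  EqualOn-filter eqs {p} p∈ = let p∈C , agree = ∈-filter⁻ (T? ∘ bothAgree splits) p∈ in descend p agree (eqs p∈C)

PartialOrientation : Set
PartialOrientation = Edge → Maybe Bool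

-- up e says that end₁ e is the smaller endpoint of e.
module _ (up : Edge → Bool) where

  lower upper : Edge → Fin 5
  lower e = if up e then end₁ e else end₂ e
  upper e = if up e then end₂ e else end₁ e

  Extends : PartialOrientation → Set
  Extends po = ∀ e c → po e ≡ just c → up e ≡ c

  endpoints-≢ : {A : Set} (g : Fin 5 → A) (e : Edge) → g (end₁ e) ≢ g (end₂ e) → g (lower e) ≢ g (upper e)
  endpoints-≢ g e ne with up e
  ... | true  = ne
  ... | false = λ eq → ne (sym eq)

  endpoints-≡ : {A : Set} (g : Fin 5 → A) (e : Edge) → g (end₁ e) ≡ g (end₂ e) → g (lower e) ≡ g (upper e)
  endpoints-≡ g e eq with up e
  ... | true  = eq
  ... | false = sym eq

heads : {A : Set} → (Fin 5 → Vec A (suc n)) → Vec A 5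
heads xs = tabulate (head ∘ xs)

tails : {A : Set} → (Fin 5 → Vec A (suc n)) → Fin 5 → Vec A n
tails xs = tail ∘ xs

lookup-heads : {A : Set} (xs : Fin 5 → Vec A (suc n)) (p : Fin 5) → lookup (heads xs) p ≡ head (xs p)
lookup-heads xs = lookup∘tabulate (head ∘ xs)

knownDiffer knownEqual : Maybe Bool → Maybe Bool → Bool
knownDiffer (just x) (just y) = x xor y
knownDiffer _        _        = false
knownEqual  (just x) (just y) = not (x xor y)
knownEqual  _        _        = false

knownDiffer-elim : ∀ mx my → T (knownDiffer mx my) → ∃ λ x → ∃ λ y → mx ≡ just x × my ≡ just y × x ≢ y
knownDiffer-elim (just x) (just y) d = x , y , refl , refl , T-xor⇒≢ d

knownEqual-elim : ∀ mx my → T (knownEqual mx my) → ∃ λ x → mx ≡ just x × my ≡ just x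
knownEqual-elim (just x) (just y) d with T-not-xor⇒≡ {x} d
... | refl = x , refl , refl

-- Symbolic check of the components (i_k , δ_k)

splitsAt : Vec Bool 5 → Edge → Bool
splitsAt b e = lookup b (end₁ e) xor lookup b (end₂ e)

lowerBit : PartialOrientation → Vec Bool 5 → Edge → Maybe Bool
lowerBit po b e = Maybe.map (λ c → lookup b (if c then end₁ e else end₂ e)) (po e)

bitClash : PartialOrientation → Vec Bool 5 → EdgePair → Bool
bitClash po b (e , e′) = (splitsAt b e xor splitsAt b e′) ∨
  (splitsAt b e ∧ splitsAt b e′ ∧ knownDiffer (lowerBit po b e) (lowerBit po b e′))

bitSettled : PartialOrientation → Vec Bool 5 → EdgePair → Bool
bitSettled po b (e , e′) = splitsAt b e ∧ splitsAt b e′ ∧ knownEqual (lowerBit po b e) (lowerBit po b e′)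

-- bitCheck fuel po C q: for every choice of the current bit of the five strings, either some
-- pair of C is contradicted, or q is settled, or q and the relevant part of C pass to the
-- remaining bits (at most fuel times with a smaller C).
mutual
  bitCheck : ℕ → PartialOrientation → List EdgePair → EdgePair → Bool
  bitCheck fuel po C q = all (bitCheckAt fuel po C q) (allBitVecs 5)

  bitCheckAt : ℕ → PartialOrientation → List EdgePair → EdgePair → Vec Bool 5 → Bool
  bitCheckAt fuel po C q b = any (bitClash po b) C ∨ bitSettled po b q ∨
    (bothAgree (splitsAt b) q ∧ (all (bothAgree (splitsAt b)) C ∨ bitRefine fuel po C q b))

  bitRefine : ℕ → PartialOrientation → List EdgePair → EdgePair → Vec Bool 5 → Bool
  bitRefine zero    po C q b = false
  bitRefine (suc k) po C q b = bitCheck k po (filterᵇ (bothAgree (splitsAt b)) C) q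

module BitCheckSound (up : Edge → Bool) (po : PartialOrientation) (ext : Extends up po) where

  colourOf : ∀ {m} → (Fin 5 → Vec Bool m) → Edge → ℕ × Sign
  colourOf bl e = bitColour (bl (lower up e)) (bl (upper up e))

  module AtHeads {m} (bl : Fin 5 → Vec Bool (suc m)) where

    lowerBit-sound : ∀ e {c} → lowerBit po (heads bl) e ≡ just c → head (bl (lower up e)) ≡ c
    lowerBit-sound e eq with po e in poe
    ... | just d with ext e d poe
    ...   | refl = trans (sym (lookup-heads bl (lower up e))) (just-injective eq)

    colour-split : ∀ e → T (splitsAt (heads bl) e) → colourOf bl e ≡ (1 , signOf (head (bl (lower up e))))
    colour-split e s = bitColour-differ (bl (lower up e)) (bl (upper up e))
      (endpoints-≢ up (head ∘ bl) e (λ eq → T-xor⇒≢ s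
        (trans (lookup-heads bl (end₁ e)) (trans eq (sym (lookup-heads bl (end₂ e)))))))

    colour-agree : ∀ e → T (not (splitsAt (heads bl) e)) → colourOf bl e ≡ shiftColour (colourOf (tails bl) e)
    colour-agree e a = bitColour-agree (bl (lower up e)) (bl (upper up e))
      (endpoints-≡ up (head ∘ bl) e
        (trans (sym (lookup-heads bl (end₁ e))) (trans (T-not-xor⇒≡ a) (lookup-heads bl (end₂ e)))))

    colour-split≢shift : ∀ e e′ → T (splitsAt (heads bl) e) → colourOf bl e ≢ shiftColour (colourOf (tails bl) e′)
    colour-split≢shift e e′ s eq = shiftColour≢1 _ _ (trans (sym eq) (colour-split e s))

    open Descent shiftColour shiftColour-injective (splitsAt (heads bl)) (colourOf bl) (colourOf (tails bl))
      colour-agree colour-split≢shift public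

    clash-≢ : ∀ p → T (bitClash po (heads bl) p) → colourOf bl (proj₁ p) ≢ colourOf bl (proj₂ p)
    clash-≢ (e , e′) clash with ∨⁻ clash
    ... | inj₁ one = one-splits-≢ one
    ... | inj₂ both with ∧⁻ both
    ...   | s , rest with ∧⁻ rest
    ...     | s′ , d with knownDiffer-elim _ _ d
    ...       | x , y , lx , ly , x≢y = λ eq → x≢y (begin
      x                          ≡⟨ lowerBit-sound e lx ⟨
      head (bl (lower up e))     ≡⟨ signOf-injective (cong proj₂ (trans (sym (colour-split e s)) (trans eq (colour-split e′ s′)))) ⟩
      head (bl (lower up e′))    ≡⟨ lowerBit-sound e′ ly ⟩
      y                          ∎)
      where open ≡-Reasoning

    settled-≡ : ∀ q → T (bitSettled po (heads bl) q) → colourOf bl (proj₁ q) ≡ colourOf bl (proj₂ q)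
    settled-≡ (e , e′) settled with ∧⁻ settled
    ... | s , rest with ∧⁻ rest
    ...   | s′ , k with knownEqual-elim _ _ k
    ...     | x , lx , lx′ = begin
      colourOf bl e                            ≡⟨ colour-split e s ⟩
      (1 , signOf (head (bl (lower up e))))    ≡⟨ cong (λ c → 1 , signOf c) (trans (lowerBit-sound e lx) (sym (lowerBit-sound e′ lx′))) ⟩
      (1 , signOf (head (bl (lower up e′))))   ≡⟨ colour-split e′ s′ ⟨
      colourOf bl e′                           ∎
      where open ≡-Reasoning

  bitCheck-sound : ∀ fuel C q {m} (bl : Fin 5 → Vec Bool m) → T (bitCheck fuel po C q) →
                   EqualOn (colourOf bl) C → colourOf bl (proj₁ q) ≡ colourOf bl (proj₂ q)
  bitCheck-sound fuel C (e , e′) {zero} bl _ _ =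
    trans (bitColour-[] (bl (lower up e)) (bl (upper up e))) (sym (bitColour-[] (bl (lower up e′)) (bl (upper up e′))))
  bitCheck-sound fuel C q {suc m} bl ok eqs = atPattern (all-elim (bitCheckAt fuel po C q) (allBitVecs 5) ok (∈-allBitVecs (heads bl)))
    where
    open AtHeads bl

    refine-sound : ∀ fuel → T (bitRefine fuel po C q (heads bl)) →
                   colourOf (tails bl) (proj₁ q) ≡ colourOf (tails bl) (proj₂ q)
    refine-sound (suc k) r = bitCheck-sound k (filterᵇ (bothAgree (splitsAt (heads bl))) C) q (tails bl) r (EqualOn-filter eqs)

    atPattern : T (bitCheckAt fuel po C q (heads bl)) → colourOf bl (proj₁ q) ≡ colourOf bl (proj₂ q)
    atPattern h with ∨⁻ h
    ... | inj₁ clash = let p , p∈C , c = find (any⁻ _ C clash) in ⊥-elim (clash-≢ p c (eqs p∈C))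
    ... | inj₂ h with ∨⁻ h
    ...   | inj₁ settled = settled-≡ q settled
    ...   | inj₂ h with ∧⁻ h
    ...     | agree , rest with ∨⁻ rest
    ...       | inj₁ allAgree = ascend q agree (bitCheck-sound fuel C q (tails bl) ok (EqualOn-all allAgree eqs))
    ...       | inj₂ refined  = ascend q agree (refine-sound fuel refined)

module BlockColoursSound (up : Edge → Bool) (po : PartialOrientation) (ext : Extends up po) where
  open BitCheckSound up po ext using (colourOf; bitCheck-sound)

  coloursOf : (Fin 5 → Vec (Vec Bool ℓ) n) → Edge → Vec ℕ n × Vec Sign n
  coloursOf xs e = blockColours (xs (lower up e)) (xs (upper up e))

  blockColours-sound : ∀ fuel C q (xs : Fin 5 → Vec (Vec Bool ℓ) n) → T (bitCheck fuel po C q) →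
                       EqualOn (coloursOf xs) C → coloursOf xs (proj₁ q) ≡ coloursOf xs (proj₂ q)
  blockColours-sound {n = zero} fuel C (e , e′) xs _ _ =
    trans (blockColours-[] (xs (lower up e)) (xs (upper up e))) (sym (blockColours-[] (xs (lower up e′)) (xs (upper up e′))))
  blockColours-sound {n = suc n} fuel C (e , e′) xs ok eqs = begin
    coloursOf xs e                                                 ≡⟨ split e ⟩
    consColour (colourOf (head ∘ xs) e) (coloursOf (tails xs) e)    ≡⟨ cong₂ consColour heads-≡ tails-≡ ⟩
    consColour (colourOf (head ∘ xs) e′) (coloursOf (tails xs) e′)  ≡⟨ split e′ ⟨
    coloursOf xs e′                                                ∎
    where
    open ≡-Reasoning
    split : ∀ e → coloursOf xs e ≡ consColour (colourOf (head ∘ xs) e) (coloursOf (tails xs) e)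
    split e = blockColours-head-tail (xs (lower up e)) (xs (upper up e))
    parts : ∀ {p} → p ∈ C → colourOf (head ∘ xs) (proj₁ p) ≡ colourOf (head ∘ xs) (proj₂ p)
                          × coloursOf (tails xs) (proj₁ p) ≡ coloursOf (tails xs) (proj₂ p)
    parts {d , d′} p∈C = consColour-injective (trans (sym (split d)) (trans (eqs p∈C) (split d′)))
    heads-≡ : colourOf (head ∘ xs) e ≡ colourOf (head ∘ xs) e′
    heads-≡ = bitCheck-sound fuel C (e , e′) (head ∘ xs) ok (proj₁ ∘ parts)
    tails-≡ : coloursOf (tails xs) e ≡ coloursOf (tails xs) e′
    tails-≡ = blockColours-sound fuel C (e , e′) (tails xs) ok (proj₂ ∘ parts)

-- Symbolic check of the component (i , {x^(i) , y^(i)})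

-- An equality pattern of five blocks records, for each edge of K₅, whether its two endpoints
-- carry equal blocks.
sameHead : Vec Bool 10 → Fin 5 → Fin 5 → Bool
sameHead v p q = ⌊ p ≟ q ⌋ ∨ lookup v (pairIndex p q)

transitive : Vec Bool 10 → Bool
transitive v = all (λ p → all (λ q → all (transitiveAt v p q) (allFin 5)) (allFin 5)) (allFin 5)
  where
  transitiveAt : Vec Bool 10 → Fin 5 → Fin 5 → Fin 5 → Bool
  transitiveAt v p q r = not (sameHead v p q ∧ sameHead v q r) ∨ sameHead v p r

-- The 52 equivalence relations on five points.
equalityPatterns : List (Vec Bool 10)
equalityPatterns =
  (true ∷ true ∷ true ∷ true ∷ true ∷ true ∷ true ∷ true ∷ true ∷ true ∷ []) ∷
  (true ∷ true ∷ true ∷ false ∷ true ∷ true ∷ false ∷ true ∷ false ∷ false ∷ []) ∷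
  (true ∷ true ∷ false ∷ true ∷ true ∷ false ∷ true ∷ false ∷ true ∷ false ∷ []) ∷
  (true ∷ true ∷ false ∷ false ∷ true ∷ false ∷ false ∷ false ∷ false ∷ true ∷ []) ∷
  (true ∷ true ∷ false ∷ false ∷ true ∷ false ∷ false ∷ false ∷ false ∷ false ∷ []) ∷
  (true ∷ false ∷ true ∷ true ∷ false ∷ true ∷ true ∷ false ∷ false ∷ true ∷ []) ∷
  (true ∷ false ∷ true ∷ false ∷ false ∷ true ∷ false ∷ false ∷ true ∷ false ∷ []) ∷
  (true ∷ false ∷ true ∷ false ∷ false ∷ true ∷ false ∷ false ∷ false ∷ false ∷ []) ∷
  (true ∷ false ∷ false ∷ true ∷ false ∷ false ∷ true ∷ true ∷ false ∷ false ∷ []) ∷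
  (true ∷ false ∷ false ∷ false ∷ false ∷ false ∷ false ∷ true ∷ true ∷ true ∷ []) ∷
  (true ∷ false ∷ false ∷ false ∷ false ∷ false ∷ false ∷ true ∷ false ∷ false ∷ []) ∷
  (true ∷ false ∷ false ∷ true ∷ false ∷ false ∷ true ∷ false ∷ false ∷ false ∷ []) ∷
  (true ∷ false ∷ false ∷ false ∷ false ∷ false ∷ false ∷ false ∷ true ∷ false ∷ []) ∷
  (true ∷ false ∷ false ∷ false ∷ false ∷ false ∷ false ∷ false ∷ false ∷ true ∷ []) ∷
  (true ∷ false ∷ false ∷ false ∷ false ∷ false ∷ false ∷ false ∷ false ∷ false ∷ []) ∷
  (false ∷ true ∷ true ∷ true ∷ false ∷ false ∷ false ∷ true ∷ true ∷ true ∷ []) ∷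
  (false ∷ true ∷ true ∷ false ∷ false ∷ false ∷ true ∷ true ∷ false ∷ false ∷ []) ∷
  (false ∷ true ∷ true ∷ false ∷ false ∷ false ∷ false ∷ true ∷ false ∷ false ∷ []) ∷
  (false ∷ true ∷ false ∷ true ∷ false ∷ true ∷ false ∷ false ∷ true ∷ false ∷ []) ∷
  (false ∷ true ∷ false ∷ false ∷ false ∷ true ∷ true ∷ false ∷ false ∷ true ∷ []) ∷
  (false ∷ true ∷ false ∷ false ∷ false ∷ true ∷ false ∷ false ∷ false ∷ false ∷ []) ∷
  (false ∷ true ∷ false ∷ true ∷ false ∷ false ∷ false ∷ false ∷ true ∷ false ∷ []) ∷
  (false ∷ true ∷ false ∷ false ∷ false ∷ false ∷ true ∷ false ∷ false ∷ false ∷ []) ∷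
  (false ∷ true ∷ false ∷ false ∷ false ∷ false ∷ false ∷ false ∷ false ∷ true ∷ []) ∷
  (false ∷ true ∷ false ∷ false ∷ false ∷ false ∷ false ∷ false ∷ false ∷ false ∷ []) ∷
  (false ∷ false ∷ true ∷ true ∷ true ∷ false ∷ false ∷ false ∷ false ∷ true ∷ []) ∷
  (false ∷ false ∷ true ∷ false ∷ true ∷ false ∷ true ∷ false ∷ true ∷ false ∷ []) ∷
  (false ∷ false ∷ true ∷ false ∷ true ∷ false ∷ false ∷ false ∷ false ∷ false ∷ []) ∷
  (false ∷ false ∷ false ∷ true ∷ true ∷ true ∷ false ∷ true ∷ false ∷ false ∷ []) ∷
  (false ∷ false ∷ false ∷ false ∷ true ∷ true ∷ true ∷ true ∷ true ∷ true ∷ []) ∷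
  (false ∷ false ∷ false ∷ false ∷ true ∷ true ∷ false ∷ true ∷ false ∷ false ∷ []) ∷
  (false ∷ false ∷ false ∷ true ∷ true ∷ false ∷ false ∷ false ∷ false ∷ false ∷ []) ∷
  (false ∷ false ∷ false ∷ false ∷ true ∷ false ∷ true ∷ false ∷ true ∷ false ∷ []) ∷
  (false ∷ false ∷ false ∷ false ∷ true ∷ false ∷ false ∷ false ∷ false ∷ true ∷ []) ∷
  (false ∷ false ∷ false ∷ false ∷ true ∷ false ∷ false ∷ false ∷ false ∷ false ∷ []) ∷
  (false ∷ false ∷ true ∷ true ∷ false ∷ false ∷ false ∷ false ∷ false ∷ true ∷ []) ∷
  (false ∷ false ∷ true ∷ false ∷ false ∷ false ∷ true ∷ false ∷ false ∷ false ∷ []) ∷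
  (false ∷ false ∷ true ∷ false ∷ false ∷ false ∷ false ∷ false ∷ true ∷ false ∷ []) ∷
  (false ∷ false ∷ true ∷ false ∷ false ∷ false ∷ false ∷ false ∷ false ∷ false ∷ []) ∷
  (false ∷ false ∷ false ∷ true ∷ false ∷ true ∷ false ∷ false ∷ false ∷ false ∷ []) ∷
  (false ∷ false ∷ false ∷ false ∷ false ∷ true ∷ true ∷ false ∷ false ∷ true ∷ []) ∷
  (false ∷ false ∷ false ∷ false ∷ false ∷ true ∷ false ∷ false ∷ true ∷ false ∷ []) ∷
  (false ∷ false ∷ false ∷ false ∷ false ∷ true ∷ false ∷ false ∷ false ∷ false ∷ []) ∷
  (false ∷ false ∷ false ∷ true ∷ false ∷ false ∷ false ∷ true ∷ false ∷ false ∷ []) ∷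
  (false ∷ false ∷ false ∷ false ∷ false ∷ false ∷ true ∷ true ∷ false ∷ false ∷ []) ∷
  (false ∷ false ∷ false ∷ false ∷ false ∷ false ∷ false ∷ true ∷ true ∷ true ∷ []) ∷
  (false ∷ false ∷ false ∷ false ∷ false ∷ false ∷ false ∷ true ∷ false ∷ false ∷ []) ∷
  (false ∷ false ∷ false ∷ true ∷ false ∷ false ∷ false ∷ false ∷ false ∷ false ∷ []) ∷
  (false ∷ false ∷ false ∷ false ∷ false ∷ false ∷ true ∷ false ∷ false ∷ false ∷ []) ∷
  (false ∷ false ∷ false ∷ false ∷ false ∷ false ∷ false ∷ false ∷ true ∷ false ∷ []) ∷
  (false ∷ false ∷ false ∷ false ∷ false ∷ false ∷ false ∷ false ∷ false ∷ true ∷ []) ∷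
  (false ∷ false ∷ false ∷ false ∷ false ∷ false ∷ false ∷ false ∷ false ∷ false ∷ []) ∷ []

covered : Vec Bool 10 → Bool
covered v = not (transitive v) ∨ ⌊ v ∈? equalityPatterns ⌋

equalityPatterns-complete : all covered (allBitVecs 10) ≡ true
equalityPatterns-complete = refl

transitive⇒∈equalityPatterns : ∀ v → T (transitive v) → v ∈ equalityPatterns
transitive⇒∈equalityPatterns v t =
  [ (λ intransitive → contradiction t (T-not⇒¬T intransitive)) , toWitness {a? = v ∈? equalityPatterns} ]′
  (∨⁻ {not (transitive v)} (all-elim-≡ covered (allBitVecs 10) equalityPatterns-complete (∈-allBitVecs v)))

module _ {A : Set} (_≟ᴬ_ : DecidableEquality A) (H : Fin 5 → A) where

  equalityPattern : Vec Bool 10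
  equalityPattern = tabulate (λ e → ⌊ H (end₁ e) ≟ᴬ H (end₂ e) ⌋)

  lookup-equalityPattern : ∀ e → lookup equalityPattern e ≡ ⌊ H (end₁ e) ≟ᴬ H (end₂ e) ⌋
  lookup-equalityPattern = lookup∘tabulate (λ e → ⌊ H (end₁ e) ≟ᴬ H (end₂ e) ⌋)

  equalityPattern-sound : ∀ e → T (lookup equalityPattern e) → H (end₁ e) ≡ H (end₂ e)
  equalityPattern-sound e t = toWitness {a? = H (end₁ e) ≟ᴬ H (end₂ e)} (subst T (lookup-equalityPattern e) t)

  equalityPattern-complete : ∀ e → H (end₁ e) ≡ H (end₂ e) → T (lookup equalityPattern e)
  equalityPattern-complete e eq =
    subst T (sym (lookup-equalityPattern e)) (fromWitness {a? = H (end₁ e) ≟ᴬ H (end₂ e)} eq)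

  sameHead-sound : ∀ p q → T (sameHead equalityPattern p q) → H p ≡ H q
  sameHead-sound p q s with p ≟ q
  ... | yes refl = refl
  ... | no p≢q   = [ via-edge , sym ∘ via-edge ]′ (pairIndex-ends p q p≢q)
    where
    via-edge : ∀ {a b} → K5edge (pairIndex p q) ≡ (a , b) → H a ≡ H b
    via-edge ends = subst₂ (λ a b → H a ≡ H b) (cong proj₁ ends) (cong proj₂ ends) (equalityPattern-sound (pairIndex p q) s)

  sameHead-complete : ∀ p q → H p ≡ H q → T (sameHead equalityPattern p q)
  sameHead-complete p q Hp≡Hq with p ≟ q
  ... | yes _  = tt
  ... | no p≢q = [ via-edge Hp≡Hq , via-edge (sym Hp≡Hq) ]′ (pairIndex-ends p q p≢q)
    where
    via-edge : ∀ {a b} → H a ≡ H b → K5edge (pairIndex p q) ≡ (a , b) → T (lookup equalityPattern (pairIndex p q))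
    via-edge Ha≡Hb ends = equalityPattern-complete (pairIndex p q)
      (subst₂ (λ a b → H a ≡ H b) (sym (cong proj₁ ends)) (sym (cong proj₂ ends)) Ha≡Hb)

  equalityPattern-transitive : T (transitive equalityPattern)
  equalityPattern-transitive =
    all-universal _ (allFin 5) λ p → all-universal _ (allFin 5) λ q → all-universal _ (allFin 5) λ r → triangle p q r
    where
    triangle : ∀ p q r → T (not (sameHead equalityPattern p q ∧ sameHead equalityPattern q r) ∨ sameHead equalityPattern p r)
    triangle p q r with sameHead equalityPattern p q ∧ sameHead equalityPattern q r in pqr
    ... | false = tt
    ... | true  = let pq , qr = ∧⁻ (Equivalence.from T-≡ pqr) in
                  sameHead-complete p r (trans (sameHead-sound p q pq) (sameHead-sound q r qr))

  equalityPattern∈ : equalityPattern ∈ equalityPatterns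
  equalityPattern∈ = transitive⇒∈equalityPatterns equalityPattern equalityPattern-transitive

blockSplits : Vec Bool 10 → Edge → Bool
blockSplits v e = not (lookup v e)

parallel crossed samePair : Vec Bool 10 → Edge → Edge → Bool
parallel v e e′ = sameHead v (end₁ e) (end₁ e′) ∧ sameHead v (end₂ e) (end₂ e′)
crossed  v e e′ = sameHead v (end₁ e) (end₂ e′) ∧ sameHead v (end₂ e) (end₁ e′)
samePair v e e′ = parallel v e e′ ∨ crossed v e e′

blockClash : Vec Bool 10 → EdgePair → Bool
blockClash v (e , e′) = (blockSplits v e xor blockSplits v e′) ∨
  (blockSplits v e ∧ blockSplits v e′ ∧ not (samePair v e e′))

blockSettled : Vec Bool 10 → EdgePair → Bool
blockSettled v (e , e′) = blockSplits v e ∧ blockSplits v e′ ∧ samePair v e e′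

-- S marks the edges whose endpoints agree on all blocks so far; the current block decides
-- the orientation of those among them that split here.
orientationClashAt : PartialOrientation → Vec Bool 10 → (Edge → Bool) → Edge → Edge → Bool
orientationClashAt po v S e e′ = S e ∧ S e′ ∧ blockSplits v e ∧ blockSplits v e′ ∧
  ((parallel v e e′ ∧ knownDiffer (po e) (po e′)) ∨ (crossed v e e′ ∧ knownEqual (po e) (po e′)))

orientationClash : PartialOrientation → Vec Bool 10 → (Edge → Bool) → Bool
orientationClash po v S = any (λ e → any (orientationClashAt po v S e) (allFin 10)) (allFin 10)

stillTied : Vec Bool 10 → (Edge → Bool) → Edge → Bool
stillTied v S e = S e ∧ not (blockSplits v e)

noTiedSplits : Vec Bool 10 → (Edge → Bool) → Bool
noTiedSplits v S = all (λ e → not (S e) ∨ not (blockSplits v e)) (allFin 10)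

mutual
  blockCheck : ℕ → PartialOrientation → List EdgePair → EdgePair → (Edge → Bool) → Bool
  blockCheck fuel po C q S = all (blockCheckAt fuel po C q S) equalityPatterns

  blockCheckAt : ℕ → PartialOrientation → List EdgePair → EdgePair → (Edge → Bool) → Vec Bool 10 → Bool
  blockCheckAt fuel po C q S v = any (blockClash v) C ∨ orientationClash po v S ∨ blockSettled v q ∨
    (bothAgree (blockSplits v) q ∧
      ((all (bothAgree (blockSplits v)) C ∧ noTiedSplits v S) ∨ blockRefine fuel po C q S v))

  blockRefine : ℕ → PartialOrientation → List EdgePair → EdgePair → (Edge → Bool) → Vec Bool 10 → Bool
  blockRefine zero    po C q S v = false
  blockRefine (suc k) po C q S v = blockCheck k po (filterᵇ (bothAgree (blockSplits v)) C) q (stillTied v S)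

-- Unfolding blockRefine at its use site would make the type checker normalise blockCheck over
-- all equality patterns; with abstract arguments it is immediate.
blockRefine-suc : ∀ {k po C q S v} → T (blockRefine (suc k) po C q S v) →
                  T (blockCheck k po (filterᵇ (bothAgree (blockSplits v)) C) q (stillTied v S))
blockRefine-suc r = r

module BlockCheckSound (up : Edge → Bool) (po : PartialOrientation) (ext : Extends up po) where

  firstOf : (Fin 5 → Vec (Vec Bool ℓ) n) → Edge → FirstBlock ℓ
  firstOf xs e = firstBlock (xs (lower up e)) (xs (upper up e))

  Tied : (Fin 5 → Vec (Vec Bool ℓ) n) → (Edge → Bool) → Set
  Tied xs S = ∀ e → T (S e) → up e ≡ lexLt (concat (xs (end₁ e))) (concat (xs (end₂ e)))

  module AtHeads (xs : Fin 5 → Vec (Vec Bool ℓ) (suc n)) where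

    H : Fin 5 → Vec Bool ℓ
    H = head ∘ xs

    v : Vec Bool 10
    v = equalityPattern (≡-dec B._≟_) H

    heads-differ : ∀ e → T (blockSplits v e) → H (end₁ e) ≢ H (end₂ e)
    heads-differ e s eq = T-not⇒¬T s (equalityPattern-complete (≡-dec B._≟_) H e eq)

    heads-agree : ∀ e → T (not (blockSplits v e)) → H (end₁ e) ≡ H (end₂ e)
    heads-agree e a = equalityPattern-sound (≡-dec B._≟_) H e (subst T (not-involutive (lookup v e)) a)

    first-split : ∀ e → T (blockSplits v e) → firstOf xs e ≡ just (1 , upair (H (end₁ e)) (H (end₂ e)))
    first-split e s with up e
    ... | true  = firstBlock-differ (xs (end₁ e)) (xs (end₂ e)) (heads-differ e s)
    ... | false = trans (firstBlock-differ (xs (end₂ e)) (xs (end₁ e)) (λ eq → heads-differ e s (sym eq)))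
                        (cong (λ c → just (1 , c)) (upair-comm (H (end₂ e)) (H (end₁ e)) (λ eq → heads-differ e s (sym eq))))

    first-agree : ∀ e → T (not (blockSplits v e)) → firstOf xs e ≡ shiftFirst (firstOf (tails xs) e)
    first-agree e a = firstBlock-agree (xs (lower up e)) (xs (upper up e)) (endpoints-≡ up H e (heads-agree e a))

    first-split≢shift : ∀ e e′ → T (blockSplits v e) → firstOf xs e ≢ shiftFirst (firstOf (tails xs) e′)
    first-split≢shift e e′ s eq =
      shiftFirst-firstBlock≢1 (tails xs (lower up e′)) (tails xs (upper up e′)) _ (trans (sym eq) (first-split e s))

    open Descent shiftFirst shiftFirst-injective (blockSplits v) (firstOf xs) (firstOf (tails xs))
      first-agree first-split≢shift public

    samePair-sound : ∀ e e′ → T (blockSplits v e′) → T (samePair v e e′) →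
                     upair (H (end₁ e)) (H (end₂ e)) ≡ upair (H (end₁ e′)) (H (end₂ e′))
    samePair-sound e e′ s′ same with ∨⁻ same
    ... | inj₁ par = let a , b = ∧⁻ par in
      cong₂ upair (sameHead-sound (≡-dec B._≟_) H _ _ a) (sameHead-sound (≡-dec B._≟_) H _ _ b)
    ... | inj₂ cr  = let a , b = ∧⁻ cr in
      trans (cong₂ upair (sameHead-sound (≡-dec B._≟_) H _ _ a) (sameHead-sound (≡-dec B._≟_) H _ _ b))
            (upair-comm (H (end₂ e′)) (H (end₁ e′)) (λ eq → heads-differ e′ s′ (sym eq)))

    samePair-complete : ∀ e e′ → upair (H (end₁ e)) (H (end₂ e)) ≡ upair (H (end₁ e′)) (H (end₂ e′)) →
                        T (samePair v e e′)
    samePair-complete e e′ eq with upair-inv _ _ _ _ eq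
    ... | inj₁ (a , b) = ∨⁺ˡ (∧⁺ (sameHead-complete (≡-dec B._≟_) H _ _ a) (sameHead-complete (≡-dec B._≟_) H _ _ b))
    ... | inj₂ (a , b) = ∨⁺ʳ (parallel v e e′)
                           (∧⁺ (sameHead-complete (≡-dec B._≟_) H _ _ a) (sameHead-complete (≡-dec B._≟_) H _ _ b))

    clash-≢ : ∀ p → T (blockClash v p) → firstOf xs (proj₁ p) ≢ firstOf xs (proj₂ p)
    clash-≢ (e , e′) clash with ∨⁻ clash
    ... | inj₁ one = one-splits-≢ one
    ... | inj₂ both with ∧⁻ both
    ...   | s , rest with ∧⁻ rest
    ...     | s′ , different = λ eq → T-not⇒¬T different (samePair-complete e e′
              (cong proj₂ (just-injective (trans (sym (first-split e s)) (trans eq (first-split e′ s′))))))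

    settled-≡ : ∀ q → T (blockSettled v q) → firstOf xs (proj₁ q) ≡ firstOf xs (proj₂ q)
    settled-≡ (e , e′) settled with ∧⁻ settled
    ... | s , rest with ∧⁻ rest
    ...   | s′ , same = trans (first-split e s)
                          (trans (cong (λ c → just (1 , c)) (samePair-sound e e′ s′ same)) (sym (first-split e′ s′)))

    rest : Fin 5 → Vec Bool (n * ℓ)
    rest p = concat (tails xs p)

    tied-heads : ∀ {S} → Tied xs S → ∀ e → T (S e) →
                 up e ≡ lexLt (H (end₁ e) ++ rest (end₁ e)) (H (end₂ e) ++ rest (end₂ e))
    tied-heads tied e se = trans (tied e se) (cong₂ lexLt (concat-head-tail (xs (end₁ e))) (concat-head-tail (xs (end₂ e))))

    tied-split : ∀ {S} → Tied xs S → ∀ e → T (S e) → T (blockSplits v e) → up e ≡ lexLt (H (end₁ e)) (H (end₂ e))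
    tied-split tied e se s = trans (tied-heads tied e se) (lexLt-++-differ _ _ _ _ (heads-differ e s))

    tied-agree : ∀ {S} → Tied xs S → ∀ e → T (S e) → T (not (blockSplits v e)) → up e ≡ lexLt (rest (end₁ e)) (rest (end₂ e))
    tied-agree tied e se a = begin
      up e                                                                ≡⟨ tied-heads tied e se ⟩
      lexLt (H (end₁ e) ++ rest (end₁ e)) (H (end₂ e) ++ rest (end₂ e))  ≡⟨ cong (λ w → lexLt (H (end₁ e) ++ rest (end₁ e)) (w ++ rest (end₂ e)))
                                                                              (heads-agree e a) ⟨
      lexLt (H (end₁ e) ++ rest (end₁ e)) (H (end₁ e) ++ rest (end₂ e))  ≡⟨ lexLt-++-common (H (end₁ e)) _ _ ⟩
      lexLt (rest (end₁ e)) (rest (end₂ e))                              ∎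
      where open ≡-Reasoning

    Tied-still : ∀ {S} → Tied xs S → Tied (tails xs) (stillTied v S)
    Tied-still tied e st = let se , a = ∧⁻ st in tied-agree tied e se a

    Tied-same : ∀ {S} → Tied xs S → T (noTiedSplits v S) → Tied (tails xs) S
    Tied-same {S} tied none e se
      with ∨⁻ {not (S e)} (all-allFin {10} (λ e → not (S e) ∨ not (blockSplits v e)) none e)
    ... | inj₁ untied = contradiction se (T-not⇒¬T untied)
    ... | inj₂ a      = tied-agree tied e se a

    no-orientation-clash-at : ∀ {S} → Tied xs S → ∀ e e′ → ¬ T (orientationClashAt po v S e e′)
    no-orientation-clash-at {S} tied e e′ c with ∧⁻ c
    ... | se , c with ∧⁻ c
    ...   | se′ , c with ∧⁻ c
    ...     | s , c with ∧⁻ c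
    ...       | s′ , c with ∨⁻ c
    ...         | inj₁ par-differ = let par , kd = ∧⁻ par-differ ; a , b = ∧⁻ par
                                        x , y , px , py , x≢y = knownDiffer-elim (po e) (po e′) kd in
      x≢y (begin
        x                                   ≡⟨ ext e x px ⟨
        up e                                ≡⟨ tied-split tied e se s ⟩
        lexLt (H (end₁ e)) (H (end₂ e))     ≡⟨ cong₂ lexLt (sameHead-sound (≡-dec B._≟_) H _ _ a) (sameHead-sound (≡-dec B._≟_) H _ _ b) ⟩
        lexLt (H (end₁ e′)) (H (end₂ e′))   ≡⟨ tied-split tied e′ se′ s′ ⟨
        up e′                               ≡⟨ ext e′ y py ⟩
        y                                   ∎)
      where open ≡-Reasoning
    ...         | inj₂ cr-equal = let cr , ke = ∧⁻ cr-equal ; a , b = ∧⁻ cr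
                                      x , px , px′ = knownEqual-elim (po e) (po e′) ke in
      not-¬ refl (begin
        lexLt (H (end₁ e)) (H (end₂ e))         ≡⟨ tied-split tied e se s ⟨
        up e                                    ≡⟨ trans (ext e x px) (sym (ext e′ x px′)) ⟩
        up e′                                   ≡⟨ tied-split tied e′ se′ s′ ⟩
        lexLt (H (end₁ e′)) (H (end₂ e′))       ≡⟨ cong₂ lexLt (sameHead-sound (≡-dec B._≟_) H _ _ b) (sameHead-sound (≡-dec B._≟_) H _ _ a) ⟨
        lexLt (H (end₂ e)) (H (end₁ e))         ≡⟨ lexLt-flip _ _ (heads-differ e s) ⟩
        not (lexLt (H (end₁ e)) (H (end₂ e)))   ∎)
      where open ≡-Reasoning

    no-orientation-clash : ∀ {S} → Tied xs S → ¬ T (orientationClash po v S)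
    no-orientation-clash {S} tied clash =
      let e , clash′ = any-allFin {10} (λ e → any (orientationClashAt po v S e) (allFin 10)) clash
          e′ , c     = any-allFin {10} (orientationClashAt po v S e) clash′
      in no-orientation-clash-at tied e e′ c

  blockCheck-sound : ∀ fuel C q S (xs : Fin 5 → Vec (Vec Bool ℓ) n) → T (blockCheck fuel po C q S) → Tied xs S →
                     EqualOn (firstOf xs) C → firstOf xs (proj₁ q) ≡ firstOf xs (proj₂ q)
  blockCheck-sound {n = zero} fuel C (e , e′) S xs _ _ _ =
    trans (firstBlock-[] (xs (lower up e)) (xs (upper up e))) (sym (firstBlock-[] (xs (lower up e′)) (xs (upper up e′))))
  blockCheck-sound {n = suc n} fuel C q S xs ok tied eqs =
    atPattern (all-elim (blockCheckAt fuel po C q S) equalityPatterns ok (equalityPattern∈ (≡-dec B._≟_) (head ∘ xs)))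
    where
    open AtHeads xs

    refine-sound : ∀ fuel → T (blockRefine fuel po C q S v) → firstOf (tails xs) (proj₁ q) ≡ firstOf (tails xs) (proj₂ q)
    refine-sound (suc k) r =
      blockCheck-sound k (filterᵇ (bothAgree (blockSplits v)) C) q (stillTied v S) (tails xs) (blockRefine-suc {k} {po} {C} {q} {S} {v} r)
        (Tied-still tied) (EqualOn-filter eqs)

    atPattern : T (blockCheckAt fuel po C q S v) → firstOf xs (proj₁ q) ≡ firstOf xs (proj₂ q)
    atPattern h with ∨⁻ h
    ... | inj₁ clash = let p , p∈C , c = find (any⁻ _ C clash) in ⊥-elim (clash-≢ p c (eqs p∈C))
    ... | inj₂ h with ∨⁻ h
    ...   | inj₁ oclash = ⊥-elim (no-orientation-clash tied oclash)
    ...   | inj₂ h with ∨⁻ h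
    ...     | inj₁ settled = settled-≡ q settled
    ...     | inj₂ h with ∧⁻ h
    ...       | agree , rest with ∨⁻ rest
    ...         | inj₁ same    = let allAgree , none = ∧⁻ same in
      ascend q agree (blockCheck-sound fuel C q S (tails xs) ok (Tied-same tied none) (EqualOn-all allAgree eqs))
    ...         | inj₂ refined = ascend q agree (refine-sound fuel refined)

colourCheck : ℕ → PartialOrientation → List EdgePair → EdgePair → Bool
colourCheck fuel po C q = bitCheck fuel po C q ∧ blockCheck fuel po C q (λ _ → true)

orientedColour : ∀ {m} → (Edge → Bool) → (Fin 5 → Vertex m) → Edge → Color m
orientedColour up f e = φ (f (lower up e)) (f (upper up e))

module ColourCheckSound (up : Edge → Bool) (po : PartialOrientation) (ext : Extends up po) where
  open BlockColoursSound up po ext using (blockColours-sound)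
  open BlockCheckSound up po ext using (Tied; firstOf; blockCheck-sound)

  colourOf : ∀ {m} → (Fin 5 → Vertex m) → Edge → Color m
  colourOf = orientedColour up

  colourCheck-sound : ∀ fuel C q {m} (f : Fin 5 → Vertex m) → T (colourCheck fuel po C q) → Tied f (λ _ → true) →
                      EqualOn (colourOf f) C → colourOf f (proj₁ q) ≡ colourOf f (proj₂ q)
  colourCheck-sound fuel C (e , e′) f ok tied eqs =
    cong₂ _,_ first (blockColours-sound fuel C (e , e′) f (proj₁ (∧⁻ {bitCheck fuel po C (e , e′)} ok)) (cong proj₂ ∘ eqs))
    where
    first-φ : ∀ d → proj₁ (colourOf f d) ≡ firstOf f d
    first-φ d = proj₁-φ (f (lower up d)) (f (upper up d))
    first : proj₁ (colourOf f e) ≡ proj₁ (colourOf f e′)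
    first = trans (first-φ e)
      (trans (blockCheck-sound fuel C (e , e′) (λ _ → true) f (proj₂ (∧⁻ {bitCheck fuel po C (e , e′)} ok)) tied
               (λ {p} p∈C → trans (sym (first-φ (proj₁ p))) (trans (cong proj₁ (eqs p∈C)) (first-φ (proj₂ p)))))
             (sym (first-φ e′)))

-- Partner pairings

_==_ : Edge → Edge → Bool
e == e′ = ⌊ e ≟ e′ ⌋

-- A partial partner assignment: (e , e′) ∈ K records that e′ is the other edge of the colour
-- class of e.
Pairing : Set
Pairing = List EdgePair

partnerIn : Pairing → Edge → Maybe Edge
partnerIn []              e = nothing
partnerIn ((a , w) ∷ K) e = if a == e then just w else partnerIn K e

assigned : Pairing → Edge → Bool
assigned K e = Maybe.is-just (partnerIn K e)

isPartner : Pairing → Edge → Bool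
isPartner K e = any (λ p → proj₂ p == e) K

partnerOr : Pairing → Edge → Edge
partnerOr K e = Maybe.fromMaybe e (partnerIn K e)

knownNonPartner : Pairing → Edge → Edge → Bool
knownNonPartner K e e′ = maybe′ (λ w → not (w == e′)) false (partnerIn K e)

sharesVertex : Edge → Edge → Bool
sharesVertex e e′ = ⌊ end₁ e ≟ end₁ e′ ⌋ ∨ ⌊ end₁ e ≟ end₂ e′ ⌋ ∨ ⌊ end₂ e ≟ end₁ e′ ⌋ ∨ ⌊ end₂ e ≟ end₂ e′ ⌋

separateClasses : Pairing → Edge → Edge → Bool
separateClasses K e e′ = not (e == e′) ∧ not (partnerOr K e == e′)

isMatchingClass : Pairing → Edge → Bool
isMatchingClass K e = not (sharesVertex e (partnerOr K e))

isPathClass : Pairing → Edge → Bool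
isPathClass K e = sharesVertex e (partnerOr K e)

noFamily : ℕ → (Edge → Bool) → (Edge → Edge → Bool) → List Edge → Bool
noFamily zero    P sep chosen = false
noFamily (suc n) P sep chosen = all (λ a → not (P a ∧ all (λ c → sep c a) chosen) ∨ noFamily n P sep (a ∷ chosen)) (allFin 10)

data Family (P : Edge → Bool) (sep : Edge → Edge → Bool) : List Edge → ℕ → Set where
  []  : ∀ {chosen} → Family P sep chosen 0
  add : ∀ {chosen n} a → T (P a ∧ all (λ c → sep c a) chosen) → Family P sep (a ∷ chosen) n → Family P sep chosen (suc n)

noFamily-sound : ∀ {P sep chosen n} → Family P sep chosen n → ¬ T (noFamily n P sep chosen)
noFamily-sound {P} {sep} {chosen} (add {n = n} a ok family) none
  with ∨⁻ {not (P a ∧ all (λ c → sep c a) chosen)}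
          (all-allFin {10} (λ a → not (P a ∧ all (λ c → sep c a) chosen) ∨ noFamily n P sep (a ∷ chosen)) none a)
... | inj₁ excluded = T-not⇒¬T excluded ok
... | inj₂ rest     = noFamily-sound family rest

complete : Pairing → Bool
complete K = all (assigned K) (allFin 10)

assume : PartialOrientation → Edge → Bool → PartialOrientation
assume po e c e′ = if e == e′ then just c else po e′

isTriangle : Edge → Edge → Edge → Bool
isTriangle e₁ e₂ e₃ = ⌊ end₂ e₁ ≟ end₁ e₂ ⌋ ∧ ⌊ end₁ e₁ ≟ end₁ e₃ ⌋ ∧ ⌊ end₂ e₂ ≟ end₂ e₃ ⌋

data OrientationTree : Set where
  forcedEqual : Edge → Edge → OrientationTree
  cyclic      : Edge → Edge → Edge → Bool → OrientationTree
  splitOn     : Edge → OrientationTree → OrientationTree → OrientationTree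

refutes : Pairing → PartialOrientation → OrientationTree → Bool
refutes K po (forcedEqual q q′)    = not (q == q′) ∧ knownNonPartner K q q′ ∧ colourCheck 3 po K (q , q′)
refutes K po (cyclic e₁ e₂ e₃ t)   = isTriangle e₁ e₂ e₃ ∧
  knownEqual (po e₁) (just t) ∧ knownEqual (po e₂) (just t) ∧ knownEqual (po e₃) (just (not t))
refutes K po (splitOn e left right) = refutes K (assume po e true) left ∧ refutes K (assume po e false) right

data PairingTree : Set where
  miscounted : PairingTree
  refuted    : OrientationTree → PairingTree
  choose     : Edge → List (Edge × PairingTree) → PairingTree

mutual
  excludes : Pairing → PairingTree → Bool
  excludes K miscounted   = complete K ∧
    (noFamily 3 (isMatchingClass K) (separateClasses K) [] ∨ noFamily 2 (isPathClass K) (separateClasses K) [])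
  excludes K (refuted t)  = complete K ∧ refutes K (λ _ → nothing) t
  excludes K (choose e ch) = not (isPartner K e) ∧
    all (λ w → any (λ c → proj₁ c == w) ch ∨ w == e ∨ assigned K w) (allFin 10) ∧ excludesAll K e ch

  excludesAll : Pairing → Edge → List (Edge × PairingTree) → Bool
  excludesAll K e []             = true
  excludesAll K e ((w , t) ∷ ch) = excludes ((e , w) ∷ (w , e) ∷ K) t ∧ excludesAll K e ch

sharesVertex-sound : ∀ e e′ → T (sharesVertex e e′) → ShareVertex e e′
sharesVertex-sound e e′ s with ∨⁻ {⌊ end₁ e ≟ end₁ e′ ⌋} s
... | inj₁ eq = end₁ e , inj₁ refl , inj₁ (toWitness {a? = end₁ e ≟ end₁ e′} eq)
... | inj₂ s with ∨⁻ {⌊ end₁ e ≟ end₂ e′ ⌋} s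
...   | inj₁ eq = end₁ e , inj₁ refl , inj₂ (toWitness {a? = end₁ e ≟ end₂ e′} eq)
...   | inj₂ s with ∨⁻ {⌊ end₂ e ≟ end₁ e′ ⌋} s
...     | inj₁ eq = end₂ e , inj₂ refl , inj₁ (toWitness {a? = end₂ e ≟ end₁ e′} eq)
...     | inj₂ eq = end₂ e , inj₂ refl , inj₂ (toWitness {a? = end₂ e ≟ end₂ e′} eq)

sharesVertex-complete : ∀ e e′ → ShareVertex e e′ → T (sharesVertex e e′)
sharesVertex-complete e e′ (_ , inj₁ refl , inj₁ eq) = ∨⁺ˡ (fromWitness {a? = end₁ e ≟ end₁ e′} eq)
sharesVertex-complete e e′ (_ , inj₁ refl , inj₂ eq) =
  ∨⁺ʳ ⌊ end₁ e ≟ end₁ e′ ⌋ (∨⁺ˡ (fromWitness {a? = end₁ e ≟ end₂ e′} eq))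
sharesVertex-complete e e′ (_ , inj₂ refl , inj₁ eq) =
  ∨⁺ʳ ⌊ end₁ e ≟ end₁ e′ ⌋ (∨⁺ʳ ⌊ end₁ e ≟ end₂ e′ ⌋ (∨⁺ˡ (fromWitness {a? = end₂ e ≟ end₁ e′} eq)))
sharesVertex-complete e e′ (_ , inj₂ refl , inj₂ eq) =
  ∨⁺ʳ ⌊ end₁ e ≟ end₁ e′ ⌋ (∨⁺ʳ ⌊ end₁ e ≟ end₂ e′ ⌋ (∨⁺ʳ ⌊ end₂ e ≟ end₁ e′ ⌋ (fromWitness {a? = end₂ e ≟ end₂ e′} eq)))

module Refutation {m} (f : Fin 5 → Vertex m) (f-injective : Injective _≡_ _≡_ f)
                  (R : Is22222-3M2P (copyColoring f)) where
  open Is22222-3M2P R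

  colour : Edge → Color m
  colour = copyColoring f

  up : Edge → Bool
  up e = ltV (f (end₁ e)) (f (end₂ e))

  colour≡oriented : ∀ e → colour e ≡ orientedColour up f e
  colour≡oriented e with ltV (f (end₁ e)) (f (end₂ e))
  ... | true  = refl
  ... | false = refl

  classOf : Edge → Fin 5
  classOf e = proj₁ (covers e)

  colour-classOf : ∀ e → colour e ≡ cs (classOf e)
  colour-classOf e = proj₂ (covers e)

  first second : Fin 5 → Edge
  first  j = ExactlyTwo.e₁ (classes j)
  second j = ExactlyTwo.e₂ (classes j)

  partner : Edge → Edge
  partner e = if e == first (classOf e) then second (classOf e) else first (classOf e)

  colour-partner : ∀ e → colour (partner e) ≡ colour e
  colour-partner e with e ≟ first (classOf e)
  ... | yes _ = trans (ExactlyTwo.col₂ (classes (classOf e))) (sym (colour-classOf e))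
  ... | no _  = trans (ExactlyTwo.col₁ (classes (classOf e))) (sym (colour-classOf e))

  partner≢ : ∀ e → partner e ≢ e
  partner≢ e with e ≟ first (classOf e)
  ... | yes e≡first = λ eq → ExactlyTwo.e₁≢e₂ (classes (classOf e)) (trans (sym e≡first) (sym eq))
  ... | no e≢first  = λ eq → e≢first (sym eq)

  same-colour : ∀ e e′ → colour e′ ≡ colour e → e′ ≡ e ⊎ e′ ≡ partner e
  same-colour e e′ eq with e ≟ first (classOf e) | ExactlyTwo.only (classes (classOf e)) e′ (trans eq (colour-classOf e))
  ... | yes e≡first | inj₁ e′≡first  = inj₁ (trans e′≡first (sym e≡first))
  ... | yes _       | inj₂ e′≡second = inj₂ e′≡second
  ... | no _        | inj₁ e′≡first  = inj₂ e′≡first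
  ... | no e≢first  | inj₂ e′≡second with ExactlyTwo.only (classes (classOf e)) e (colour-classOf e)
  ...   | inj₁ e≡first  = contradiction e≡first e≢first
  ...   | inj₂ e≡second = inj₁ (trans e′≡second (sym e≡second))

  partner-involutive : ∀ e → partner (partner e) ≡ e
  partner-involutive e with same-colour (partner e) e (sym (colour-partner e))
  ... | inj₁ e≡pe = contradiction (sym e≡pe) (partner≢ e)
  ... | inj₂ eq   = sym eq

  partner-first : ∀ j → partner (first j) ≡ second j
  partner-first j with same-colour (first j) (second j) (trans (ExactlyTwo.col₂ (classes j)) (sym (ExactlyTwo.col₁ (classes j))))
  ... | inj₁ eq = contradiction (sym eq) (ExactlyTwo.e₁≢e₂ (classes j))
  ... | inj₂ eq = sym eq

  Consistent : Pairing → Set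
  Consistent K = ∀ {p} → p ∈ K → partner (proj₁ p) ≡ proj₂ p

  partnerIn-sound : ∀ K {e w} → Consistent K → partnerIn K e ≡ just w → partner e ≡ w
  partnerIn-sound ((a , _) ∷ K) {e} cons eq with a ≟ e
  ... | yes refl = trans (cons (here refl)) (just-injective eq)
  ... | no _     = partnerIn-sound K (cons ∘ there) eq

  partnerIn-isPartner : ∀ K {e w} → partnerIn K e ≡ just w → T (isPartner K w)
  partnerIn-isPartner ((a , w′) ∷ K) {e} {w} eq with a ≟ e
  ... | yes _ = ∨⁺ˡ (fromWitness {a? = w′ ≟ w} (just-injective eq))
  ... | no _  = ∨⁺ʳ (w′ == w) (partnerIn-isPartner K eq)

  partnerOr-sound : ∀ K {e} → Consistent K → T (assigned K e) → partnerOr K e ≡ partner e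
  partnerOr-sound K {e} cons a with partnerIn K e in eq
  ... | just w = sym (partnerIn-sound K cons eq)

  assigned⇒isPartner : ∀ K {e} → Consistent K → T (assigned K e) → T (isPartner K (partner e))
  assigned⇒isPartner K {e} cons a with partnerIn K e in eq
  ... | just w = subst (T ∘ isPartner K) (sym (partnerIn-sound K cons eq)) (partnerIn-isPartner K eq)

  Extends-none : Extends up (λ _ → nothing)
  Extends-none _ _ ()

  Extends-assume : ∀ {po} e c → Extends up po → up e ≡ c → Extends up (assume po e c)
  Extends-assume e c ext ue e′ c′ eq with e ≟ e′
  ... | yes refl = trans ue (just-injective eq)
  ... | no _     = ext e′ c′ eq

  forcedEqual-colours : ∀ K po → Consistent K → Extends up po → ∀ q q′ → T (colourCheck 3 po K (q , q′)) →
                        colour q ≡ colour q′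
  forcedEqual-colours K po cons ext q q′ check = begin
    colour q                ≡⟨ colour≡oriented q ⟩
    orientedColour up f q   ≡⟨ colourCheck-sound 3 K (q , q′) f check (λ e _ → ltV≡lexLt (f (end₁ e)) (f (end₂ e))) pairs-≡ ⟩
    orientedColour up f q′  ≡⟨ colour≡oriented q′ ⟨
    colour q′               ∎
    where
    open ≡-Reasoning
    open ColourCheckSound up po ext using (colourCheck-sound)
    pairs-≡ : EqualOn (orientedColour up f) K
    pairs-≡ {a , w} a∈K = begin
      orientedColour up f a  ≡⟨ colour≡oriented a ⟨
      colour a               ≡⟨ colour-partner a ⟨
      colour (partner a)     ≡⟨ cong colour (cons a∈K) ⟩
      colour w               ≡⟨ colour≡oriented w ⟩
      orientedColour up f w  ∎

  non-partners-differ : ∀ K → Consistent K → ∀ q q′ → T (not (q == q′)) → T (knownNonPartner K q q′) →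
                        colour q ≢ colour q′
  non-partners-differ K cons q q′ q≢q′ nonPartner eq with partnerIn K q in pq | same-colour q q′ (sym eq)
  ... | just w | inj₁ q′≡q  = T-not⇒¬T q≢q′ (fromWitness {a? = q ≟ q′} (sym q′≡q))
  ... | just w | inj₂ q′≡pq = T-not⇒¬T nonPartner (fromWitness {a? = w ≟ q′} (trans (sym (partnerIn-sound K cons pq)) (sym q′≡pq)))

  known-orientation : ∀ {po} → Extends up po → ∀ e c → T (knownEqual (po e) (just c)) → up e ≡ c
  known-orientation {po} ext e c k with knownEqual-elim (po e) (just c) k
  ... | x , pe , refl = ext e x pe

  refutes-sound : ∀ t K po → Consistent K → Extends up po → ¬ T (refutes K po t)
  refutes-sound (forcedEqual q q′) K po cons ext ok =
    let q≢q′ , rest = ∧⁻ ok ; nonPartner , check = ∧⁻ rest in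
    non-partners-differ K cons q q′ q≢q′ nonPartner (forcedEqual-colours K po cons ext q q′ check)
  refutes-sound (cyclic e₁ e₂ e₃ t) K po cons ext ok with ∧⁻ ok
  ... | triangle , known with ∧⁻ triangle | ∧⁻ known
  ...   | b₁≡a₂ , rest | k₁ , known′ with ∧⁻ rest | ∧⁻ known′
  ...     | a₁≡a₃ , b₂≡b₃ | k₂ , k₃ =
    no-cyclic-triangle (f (end₁ e₁)) (f (end₂ e₁)) (f (end₂ e₂)) (λ eq → end₁≢end₂ e₁ (f-injective eq))
      (λ eq → end₁≢end₂ e₂ (trans a₂≡b₁ (f-injective eq))) t
      (known-orientation ext e₁ t k₁)
      (subst (λ a → ltV (f a) (f (end₂ e₂)) ≡ t) a₂≡b₁ (known-orientation ext e₂ t k₂))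
      (subst₂ (λ a b → ltV (f a) (f b) ≡ not t) a₃≡a₁ b₃≡b₂ (known-orientation ext e₃ (not t) k₃))
    where
    a₂≡b₁ : end₁ e₂ ≡ end₂ e₁
    a₂≡b₁ = sym (toWitness {a? = end₂ e₁ ≟ end₁ e₂} b₁≡a₂)
    a₃≡a₁ : end₁ e₃ ≡ end₁ e₁
    a₃≡a₁ = sym (toWitness {a? = end₁ e₁ ≟ end₁ e₃} a₁≡a₃)
    b₃≡b₂ : end₂ e₃ ≡ end₂ e₂
    b₃≡b₂ = sym (toWitness {a? = end₂ e₂ ≟ end₂ e₃} b₂≡b₃)
  refutes-sound (splitOn e left right) K po cons ext ok with up e in ue
  ... | true  = refutes-sound left  K _ cons (Extends-assume e true  ext ue) (proj₁ (∧⁻ ok))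
  ... | false = refutes-sound right K _ cons (Extends-assume e false ext ue) (proj₂ (∧⁻ ok))

  module Counting (K : Pairing) (cons : Consistent K) (comp : T (complete K)) where

    partnerOr-first : ∀ j → partnerOr K (first j) ≡ second j
    partnerOr-first j =
      trans (partnerOr-sound K cons (all-allFin {10} (assigned K) comp (first j))) (partner-first j)

    classes-distinct : ∀ {j j′} → j ≢ j′ → ∀ {e e′} → colour e ≡ cs j → colour e′ ≡ cs j′ → e ≢ e′
    classes-distinct {j} {j′} j≢j′ ce ce′ refl = j≢j′ (cs-inj j j′ (trans (sym ce) ce′))

    separate : ∀ {j j′} → j ≢ j′ → T (separateClasses K (first j) (first j′))
    separate {j} {j′} j≢j′ = ∧⁺
      (fromWitnessFalse (classes-distinct j≢j′ (ExactlyTwo.col₁ (classes j)) (ExactlyTwo.col₁ (classes j′))))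
      (subst (λ w → T (not (w == first j′))) (sym (partnerOr-first j))
        (fromWitnessFalse (classes-distinct j≢j′ (ExactlyTwo.col₂ (classes j)) (ExactlyTwo.col₁ (classes j′)))))

    matching : ∀ j → IsMatching (classes j) → T (isMatchingClass K (first j))
    matching j disjoint rewrite partnerOr-first j with sharesVertex (first j) (second j) in shares
    ... | true  = disjoint (sharesVertex-sound (first j) (second j) (Equivalence.from T-≡ shares))
    ... | false = tt

    path : ∀ j → IsPath (classes j) → T (isPathClass K (first j))
    path j shared rewrite partnerOr-first j = sharesVertex-complete (first j) (second j) shared

    three-matchings : Family (isMatchingClass K) (separateClasses K) [] 3
    three-matchings =
      add (first 0F) (∧⁺ (matching 0F match₀) tt) (
      add (first 1F) (∧⁺ (matching 1F match₁) (∧⁺ (separate {0F} (λ ())) tt)) (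
      add (first 2F) (∧⁺ (matching 2F match₂) (∧⁺ (separate {1F} (λ ())) (∧⁺ (separate {0F} (λ ())) tt)))
      []))

    two-paths : Family (isPathClass K) (separateClasses K) [] 2
    two-paths =
      add (first 3F) (∧⁺ (path 3F path₃) tt) (
      add (first 4F) (∧⁺ (path 4F path₄) (∧⁺ (separate {3F} (λ ())) tt))
      [])

    well-counted : ¬ T (noFamily 3 (isMatchingClass K) (separateClasses K) [] ∨ noFamily 2 (isPathClass K) (separateClasses K) [])
    well-counted counts = [ noFamily-sound three-matchings , noFamily-sound two-paths ]′ (∨⁻ counts)

  mutual
    excludes-sound : ∀ t K → Consistent K → ¬ T (excludes K t)
    excludes-sound miscounted K cons ok = Counting.well-counted K cons (proj₁ (∧⁻ ok)) (proj₂ (∧⁻ ok))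
    excludes-sound (refuted t) K cons ok = refutes-sound t K _ cons Extends-none (proj₂ (∧⁻ ok))
    excludes-sound (choose e ch) K cons ok =
      let notPartner , rest = ∧⁻ ok ; offered , children = ∧⁻ rest in
      partner-offered e ch K cons notPartner children
        (all-allFin {10} (λ w → any (λ c → proj₁ c == w) ch ∨ w == e ∨ assigned K w) offered (partner e))

    partner-offered : ∀ e ch K → Consistent K → T (not (isPartner K e)) → T (excludesAll K e ch) →
                      T (any (λ c → proj₁ c == partner e) ch ∨ partner e == e ∨ assigned K (partner e)) → ⊥
    partner-offered e ch K cons notPartner children offered with ∨⁻ offered
    ... | inj₁ chosen = excludesAll-sound ch K e cons children (any⁻ (λ c → proj₁ c == partner e) ch chosen)
    ... | inj₂ rest with ∨⁻ rest
    ...   | inj₁ pe≡e    = partner≢ e (toWitness {a? = partner e ≟ e} pe≡e)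
    ...   | inj₂ assigned′ = T-not⇒¬T notPartner
              (subst (T ∘ isPartner K) (partner-involutive e) (assigned⇒isPartner K cons assigned′))

    excludesAll-sound : ∀ ch K e → Consistent K → T (excludesAll K e ch) →
                        Any (λ c → T (proj₁ c == partner e)) ch → ⊥
    excludesAll-sound ((w , t) ∷ ch) K e cons ok (here w≡pe) = excludes-sound t _ extended (proj₁ (∧⁻ ok))
      where
      w≡partner : w ≡ partner e
      w≡partner = toWitness {a? = w ≟ partner e} w≡pe
      extended : Consistent ((e , w) ∷ (w , e) ∷ K)
      extended (here refl)         = sym w≡partner
      extended (there (here refl)) = trans (cong partner w≡partner) (partner-involutive e)
      extended (there (there p∈K)) = cons p∈K
    excludesAll-sound ((w , t) ∷ ch) K e cons ok (there chosen) =
      excludesAll-sound ch K e cons (proj₂ (∧⁻ {excludes ((e , w) ∷ (w , e) ∷ K) t} ok)) chosen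

  -- The certificate is verified as excludes [] certificate ≡ true by refl: type checking a proof
  -- of T (excludes [] certificate) directly is many times slower.
  certified-impossible : ∀ t → excludes [] t ≡ true → ⊥
  certified-impossible t ok = excludes-sound t [] (λ ()) (Equivalence.from T-≡ ok)

certificate : PairingTree
certificate =
  (choose 0F
    ( (1F , (choose 2F
        ( (3F , (choose 4F ((5F , (choose 6F ((7F , (choose 8F ((9F , miscounted) ∷ []))) ∷ (8F , (choose 7F ((9F , miscounted) ∷ []))) ∷ (9F , (choose 7F ((8F , miscounted) ∷ []))) ∷ []))) ∷ (6F , (choose 5F ((7F , (choose 8F ((9F , miscounted) ∷ []))) ∷ (8F , (choose 7F ((9F , miscounted) ∷ []))) ∷ (9F , (choose 7F ((8F , miscounted) ∷ []))) ∷ []))) ∷ (7F , (choose 5F ((6F , (choose 8F ((9F , miscounted) ∷ []))) ∷ (8F , (choose 6F ((9F , miscounted) ∷ []))) ∷ (9F , (choose 6F ((8F , miscounted) ∷ []))) ∷ []))) ∷ (8F , (choose 5F ((6F , (choose 7F ((9F , miscounted) ∷ []))) ∷ (7F , (choose 6F ((9F , miscounted) ∷ []))) ∷ (9F , (choose 6F ((7F , miscounted) ∷ []))) ∷ []))) ∷ (9F , (choose 5F ((6F , (choose 7F ((8F , miscounted) ∷ []))) ∷ (7F , (choose 6F ((8F , miscounted) ∷ []))) ∷ (8F , (choose 6F ((7F , (refuted (splitOn 4F (splitOn 5F (splitOn 6F (splitOn 7F (splitOn 8F (forcedEqual 5F 6F) (forcedEqual 4F 5F)) (splitOn 9F (forcedEqual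 4F 6F) (forcedEqual 4F 5F))) (splitOn 7F (splitOn 9F (cyclic 5F 9F 6F true) (forcedEqual 4F 5F)) (splitOn 8F (cyclic 4F 8F 6F true) (forcedEqual 4F 5F)))) (splitOn 6F (splitOn 7F (cyclic 4F 7F 5F true) (splitOn 9F (forcedEqual 4F 6F) (cyclic 5F 9F 6F false))) (splitOn 7F (cyclic 4F 7F 5F true) (splitOn 8F (cyclic 4F 8F 6F true) (forcedEqual 5F 6F))))) (splitOn 5F (splitOn 6F (splitOn 7F (splitOn 8F (forcedEqual 5F 6F) (cyclic 4F 8F 6F false)) (cyclic 4F 7F 5F false)) (splitOn 7F (splitOn 9F (cyclic 5F 9F 6F true) (forcedEqual 4F 6F)) (cyclic 4F 7F 5F false))) (splitOn 6F (splitOn 7F (splitOn 8F (forcedEqual 4F 5F) (cyclic 4F 8F 6F false)) (splitOn 9F (forcedEqual 4F 5F) (cyclic 5F 9F 6F false))) (splitOn 7F (splitOn 9F (forcedEqual 4F 5F) (forcedEqual 4F 6F)) (splitOn 8F (forcedEqual 4F 5F) (forcedEqual 5F 6F)))))))) ∷ []))) ∷ []))) ∷ [])))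
        ∷ (4F , (choose 3F ((5F , (choose 6F ((7F , (choose 8F ((9F , (refuted (forcedEqual 0F 2F))) ∷ []))) ∷ (8F , (choose 7F ((9F , miscounted) ∷ []))) ∷ (9F , (choose 7F ((8F , miscounted) ∷ []))) ∷ []))) ∷ (6F , (choose 5F ((7F , (choose 8F ((9F , miscounted) ∷ []))) ∷ (8F , (choose 7F ((9F , miscounted) ∷ []))) ∷ (9F , (choose 7F ((8F , miscounted) ∷ []))) ∷ []))) ∷ (7F , (choose 5F ((6F , (choose 8F ((9F , miscounted) ∷ []))) ∷ (8F , (choose 6F ((9F , (refuted (forcedEqual 0F 2F))) ∷ []))) ∷ (9F , (choose 6F ((8F , miscounted) ∷ []))) ∷ []))) ∷ (8F , (choose 5F ((6F , (choose 7F ((9F , miscounted) ∷ []))) ∷ (7F , (choose 6F ((9F , miscounted) ∷ []))) ∷ (9F , (choose 6F ((7F , miscounted) ∷ []))) ∷ []))) ∷ (9F , (choose 5F ((6F , (choose 7F ((8F , miscounted) ∷ []))) ∷ (7F , (choose 6F ((8F , miscounted) ∷ []))) ∷ (8F , (choose 6F ((7F , (refuted (splitOn 0F (splitOn 5F (splitOn 6F (forcedEqual 5F 6F) (forcedEqual 0F 6F)) (forcedEqual 0F 5F)) (splitOn 5F (forcedEqual 0F 5F) (splitOn 6F (forcedEqual 0F 6F) (forcedEqual 5F 6F)))))) ∷ []))) ∷ []))) ∷ [])))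
        ∷ (5F , (choose 3F ((4F , (choose 6F ((7F , (choose 8F ((9F , miscounted) ∷ []))) ∷ (8F , (choose 7F ((9F , miscounted) ∷ []))) ∷ (9F , (choose 7F ((8F , miscounted) ∷ []))) ∷ []))) ∷ (6F , (choose 4F ((7F , (choose 8F ((9F , miscounted) ∷ []))) ∷ (8F , (choose 7F ((9F , miscounted) ∷ []))) ∷ (9F , (choose 7F ((8F , miscounted) ∷ []))) ∷ []))) ∷ (7F , (choose 4F ((6F , (choose 8F ((9F , miscounted) ∷ []))) ∷ (8F , (choose 6F ((9F , miscounted) ∷ []))) ∷ (9F , (choose 6F ((8F , miscounted) ∷ []))) ∷ []))) ∷ (8F , (choose 4F ((6F , (choose 7F ((9F , miscounted) ∷ []))) ∷ (7F , (choose 6F ((9F , miscounted) ∷ []))) ∷ (9F , (choose 6F ((7F , miscounted) ∷ []))) ∷ []))) ∷ (9F , (choose 4F ((6F , (choose 7F ((8F , miscounted) ∷ []))) ∷ (7F , (choose 6F ((8F , miscounted) ∷ []))) ∷ (8F , (choose 6F ((7F , miscounted) ∷ []))) ∷ []))) ∷ [])))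
        ∷ (6F , (choose 3F ((4F , (choose 5F ((7F , (choose 8F ((9F , miscounted) ∷ []))) ∷ (8F , (choose 7F ((9F , (refuted (forcedEqual 0F 2F))) ∷ []))) ∷ (9F , (choose 7F ((8F , miscounted) ∷ []))) ∷ []))) ∷ (5F , (choose 4F ((7F , (choose 8F ((9F , miscounted) ∷ []))) ∷ (8F , (choose 7F ((9F , miscounted) ∷ []))) ∷ (9F , (choose 7F ((8F , (refuted (splitOn 2F (splitOn 3F (forcedEqual 2F 3F) (splitOn 7F (forcedEqual 2F 7F) (forcedEqual 3F 7F))) (splitOn 3F (splitOn 7F (forcedEqual 3F 7F) (forcedEqual 2F 7F)) (forcedEqual 2F 3F))))) ∷ []))) ∷ []))) ∷ (7F , (choose 4F ((5F , (choose 8F ((9F , miscounted) ∷ []))) ∷ (8F , (choose 5F ((9F , miscounted) ∷ []))) ∷ (9F , (choose 5F ((8F , miscounted) ∷ []))) ∷ []))) ∷ (8F , (choose 4F ((5F , (choose 7F ((9F , miscounted) ∷ []))) ∷ (7F , (choose 5F ((9F , miscounted) ∷ []))) ∷ (9F , (choose 5F ((7F , miscounted) ∷ []))) ∷ []))) ∷ (9F , (choose 4F ((5F , (choose 7F ((8F , miscounted) ∷ []))) ∷ (7F , (choose 5F ((8F , miscounted) ∷ []))) ∷ (8F , (choose 5F ((7F , miscounted) ∷ []))) ∷ []))) ∷ [])))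
        ∷ (7F , (choose 3F ((4F , (choose 5F ((6F , (choose 8F ((9F , miscounted) ∷ []))) ∷ (8F , (choose 6F ((9F , miscounted) ∷ []))) ∷ (9F , (choose 6F ((8F , miscounted) ∷ []))) ∷ []))) ∷ (5F , (choose 4F ((6F , (choose 8F ((9F , miscounted) ∷ []))) ∷ (8F , (choose 6F ((9F , miscounted) ∷ []))) ∷ (9F , (choose 6F ((8F , miscounted) ∷ []))) ∷ []))) ∷ (6F , (choose 4F ((5F , (choose 8F ((9F , miscounted) ∷ []))) ∷ (8F , (choose 5F ((9F , miscounted) ∷ []))) ∷ (9F , (choose 5F ((8F , miscounted) ∷ []))) ∷ []))) ∷ (8F , (choose 4F ((5F , (choose 6F ((9F , miscounted) ∷ []))) ∷ (6F , (choose 5F ((9F , miscounted) ∷ []))) ∷ (9F , (choose 5F ((6F , miscounted) ∷ []))) ∷ []))) ∷ (9F , (choose 4F ((5F , (choose 6F ((8F , miscounted) ∷ []))) ∷ (6F , (choose 5F ((8F , miscounted) ∷ []))) ∷ (8F , (choose 5F ((6F , miscounted) ∷ []))) ∷ []))) ∷ [])))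
        ∷ (8F , (choose 3F ((4F , (choose 5F ((6F , (choose 7F ((9F , miscounted) ∷ []))) ∷ (7F , (choose 6F ((9F , miscounted) ∷ []))) ∷ (9F , (choose 6F ((7F , (refuted (forcedEqual 0F 2F))) ∷ []))) ∷ []))) ∷ (5F , (choose 4F ((6F , (choose 7F ((9F , miscounted) ∷ []))) ∷ (7F , (choose 6F ((9F , miscounted) ∷ []))) ∷ (9F , (choose 6F ((7F , miscounted) ∷ []))) ∷ []))) ∷ (6F , (choose 4F ((5F , (choose 7F ((9F , miscounted) ∷ []))) ∷ (7F , (choose 5F ((9F , miscounted) ∷ []))) ∷ (9F , (choose 5F ((7F , miscounted) ∷ []))) ∷ []))) ∷ (7F , (choose 4F ((5F , (choose 6F ((9F , miscounted) ∷ []))) ∷ (6F , (choose 5F ((9F , miscounted) ∷ []))) ∷ (9F , (choose 5F ((6F , (refuted (splitOn 2F (splitOn 3F (forcedEqual 2F 3F) (splitOn 5F (forcedEqual 2F 5F) (forcedEqual 3F 5F))) (splitOn 3F (splitOn 5F (forcedEqual 3F 5F) (forcedEqual 2F 5F)) (forcedEqual 2F 3F))))) ∷ []))) ∷ []))) ∷ (9F , (choose 4F ((5F , (choose 6F ((7F , miscounted) ∷ []))) ∷ (6F , (choose 5F ((7F , miscounted) ∷ []))) ∷ (7F , (choose 5F ((6F , miscounted) ∷ []))) ∷ []))) ∷ [])))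
        ∷ (9F , (choose 3F ((4F , (choose 5F ((6F , (choose 7F ((8F , miscounted) ∷ []))) ∷ (7F , (choose 6F ((8F , miscounted) ∷ []))) ∷ (8F , (choose 6F ((7F , (refuted (splitOn 0F (splitOn 5F (splitOn 6F (forcedEqual 5F 6F) (forcedEqual 0F 6F)) (forcedEqual 0F 5F)) (splitOn 5F (forcedEqual 0F 5F) (splitOn 6F (forcedEqual 0F 6F) (forcedEqual 5F 6F)))))) ∷ []))) ∷ []))) ∷ (5F , (choose 4F ((6F , (choose 7F ((8F , miscounted) ∷ []))) ∷ (7F , (choose 6F ((8F , miscounted) ∷ []))) ∷ (8F , (choose 6F ((7F , miscounted) ∷ []))) ∷ []))) ∷ (6F , (choose 4F ((5F , (choose 7F ((8F , miscounted) ∷ []))) ∷ (7F , (choose 5F ((8F , miscounted) ∷ []))) ∷ (8F , (choose 5F ((7F , miscounted) ∷ []))) ∷ []))) ∷ (7F , (choose 4F ((5F , (choose 6F ((8F , miscounted) ∷ []))) ∷ (6F , (choose 5F ((8F , miscounted) ∷ []))) ∷ (8F , (choose 5F ((6F , miscounted) ∷ []))) ∷ []))) ∷ (8F , (choose 4F ((5F , (choose 6F ((7F , miscounted) ∷ []))) ∷ (6F , (choose 5F ((7F , miscounted) ∷ []))) ∷ (7F , (choose 5F ((6F , miscounted) ∷ []))) ∷ []))) ∷ [])))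
        ∷ [])))
    ∷ (2F , (choose 1F
        ( (3F , (choose 4F ((5F , (choose 6F ((7F , (choose 8F ((9F , miscounted) ∷ []))) ∷ (8F , (choose 7F ((9F , miscounted) ∷ []))) ∷ (9F , (choose 7F ((8F , miscounted) ∷ []))) ∷ []))) ∷ (6F , (choose 5F ((7F , (choose 8F ((9F , miscounted) ∷ []))) ∷ (8F , (choose 7F ((9F , miscounted) ∷ []))) ∷ (9F , (choose 7F ((8F , miscounted) ∷ []))) ∷ []))) ∷ (7F , (choose 5F ((6F , (choose 8F ((9F , miscounted) ∷ []))) ∷ (8F , (choose 6F ((9F , miscounted) ∷ []))) ∷ (9F , (choose 6F ((8F , miscounted) ∷ []))) ∷ []))) ∷ (8F , (choose 5F ((6F , (choose 7F ((9F , miscounted) ∷ []))) ∷ (7F , (choose 6F ((9F , miscounted) ∷ []))) ∷ (9F , (choose 6F ((7F , miscounted) ∷ []))) ∷ []))) ∷ (9F , (choose 5F ((6F , (choose 7F ((8F , miscounted) ∷ []))) ∷ (7F , (choose 6F ((8F , miscounted) ∷ []))) ∷ (8F , (choose 6F ((7F , (refuted (splitOn 4F (splitOn 5F (splitOn 6F (splitOn 7F (splitOn 8F (forcedEqual 5F 6F) (forcedEqual 4F 5F)) (splitOn 9F (forcedEqual 4F 6F) (forcedEqual 4F 5F))) (splitOn 7F (splitOn 9F (cyclic 5F 9F 6F true) (forcedEqual 4F 5F)) (splitOn 8F (cyclic 4F 8F 6F true) (forcedEqual 4F 5F)))) (splitOn 6F (splitOn 7F (cyclic 4F 7F 5F true)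 (splitOn 9F (forcedEqual 4F 6F) (cyclic 5F 9F 6F false))) (splitOn 7F (cyclic 4F 7F 5F true) (splitOn 8F (cyclic 4F 8F 6F true) (forcedEqual 5F 6F))))) (splitOn 5F (splitOn 6F (splitOn 7F (splitOn 8F (forcedEqual 5F 6F) (cyclic 4F 8F 6F false)) (cyclic 4F 7F 5F false)) (splitOn 7F (splitOn 9F (cyclic 5F 9F 6F true) (forcedEqual 4F 6F)) (cyclic 4F 7F 5F false))) (splitOn 6F (splitOn 7F (splitOn 8F (forcedEqual 4F 5F) (cyclic 4F 8F 6F false)) (splitOn 9F (forcedEqual 4F 5F) (cyclic 5F 9F 6F false))) (splitOn 7F (splitOn 9F (forcedEqual 4F 5F) (forcedEqual 4F 6F)) (splitOn 8F (forcedEqual 4F 5F) (forcedEqual 5F 6F)))))))) ∷ []))) ∷ []))) ∷ [])))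
        ∷ (4F , (choose 3F ((5F , (choose 6F ((7F , (choose 8F ((9F , miscounted) ∷ []))) ∷ (8F , (choose 7F ((9F , miscounted) ∷ []))) ∷ (9F , (choose 7F ((8F , miscounted) ∷ []))) ∷ []))) ∷ (6F , (choose 5F ((7F , (choose 8F ((9F , miscounted) ∷ []))) ∷ (8F , (choose 7F ((9F , miscounted) ∷ []))) ∷ (9F , (choose 7F ((8F , miscounted) ∷ []))) ∷ []))) ∷ (7F , (choose 5F ((6F , (choose 8F ((9F , miscounted) ∷ []))) ∷ (8F , (choose 6F ((9F , miscounted) ∷ []))) ∷ (9F , (choose 6F ((8F , miscounted) ∷ []))) ∷ []))) ∷ (8F , (choose 5F ((6F , (choose 7F ((9F , miscounted) ∷ []))) ∷ (7F , (choose 6F ((9F , miscounted) ∷ []))) ∷ (9F , (choose 6F ((7F , miscounted) ∷ []))) ∷ []))) ∷ (9F , (choose 5F ((6F , (choose 7F ((8F , miscounted) ∷ []))) ∷ (7F , (choose 6F ((8F , miscounted) ∷ []))) ∷ (8F , (choose 6F ((7F , miscounted) ∷ []))) ∷ []))) ∷ [])))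
        ∷ (5F , (choose 3F ((4F , (choose 6F ((7F , (choose 8F ((9F , (refuted (forcedEqual 0F 1F))) ∷ []))) ∷ (8F , (choose 7F ((9F , miscounted) ∷ []))) ∷ (9F , (choose 7F ((8F , miscounted) ∷ []))) ∷ []))) ∷ (6F , (choose 4F ((7F , (choose 8F ((9F , miscounted) ∷ []))) ∷ (8F , (choose 7F ((9F , miscounted) ∷ []))) ∷ (9F , (choose 7F ((8F , miscounted) ∷ []))) ∷ []))) ∷ (7F , (choose 4F ((6F , (choose 8F ((9F , miscounted) ∷ []))) ∷ (8F , (choose 6F ((9F , miscounted) ∷ []))) ∷ (9F , (choose 6F ((8F , (refuted (forcedEqual 0F 1F))) ∷ []))) ∷ []))) ∷ (8F , (choose 4F ((6F , (choose 7F ((9F , miscounted) ∷ []))) ∷ (7F , (choose 6F ((9F , miscounted) ∷ []))) ∷ (9F , (choose 6F ((7F , (refuted (splitOn 0F (splitOn 4F (splitOn 6F (forcedEqual 4F 6F) (forcedEqual 0F 6F)) (forcedEqual 0F 4F)) (splitOn 4F (forcedEqual 0F 4F) (splitOn 6F (forcedEqual 0F 6F) (forcedEqual 4F 6F)))))) ∷ []))) ∷ []))) ∷ (9F , (choose 4F ((6F , (choose 7F ((8F , miscounted) ∷ []))) ∷ (7F , (choose 6F ((8F , miscounted) ∷ []))) ∷ (8F , (choose 6F ((7F , miscounted) ∷ []))) ∷ []))) ∷ [])))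
        ∷ (6F , (choose 3F ((4F , (choose 5F ((7F , (choose 8F ((9F , miscounted) ∷ []))) ∷ (8F , (choose 7F ((9F , (refuted (splitOn 1F (splitOn 3F (forcedEqual 1F 3F) (splitOn 7F (forcedEqual 3F 7F) (forcedEqual 1F 7F))) (splitOn 3F (splitOn 7F (forcedEqual 1F 7F) (forcedEqual 3F 7F)) (forcedEqual 1F 3F))))) ∷ []))) ∷ (9F , (choose 7F ((8F , miscounted) ∷ []))) ∷ []))) ∷ (5F , (choose 4F ((7F , (choose 8F ((9F , miscounted) ∷ []))) ∷ (8F , (choose 7F ((9F , miscounted) ∷ []))) ∷ (9F , (choose 7F ((8F , (refuted (forcedEqual 0F 1F))) ∷ []))) ∷ []))) ∷ (7F , (choose 4F ((5F , (choose 8F ((9F , miscounted) ∷ []))) ∷ (8F , (choose 5F ((9F , miscounted) ∷ []))) ∷ (9F , (choose 5F ((8F , miscounted) ∷ []))) ∷ []))) ∷ (8F , (choose 4F ((5F , (choose 7F ((9F , miscounted) ∷ []))) ∷ (7F , (choose 5F ((9F , miscounted) ∷ []))) ∷ (9F , (choose 5F ((7F , miscounted) ∷ []))) ∷ []))) ∷ (9F , (choose 4F ((5F , (choose 7F ((8F , miscounted) ∷ []))) ∷ (7F , (choose 5F ((8F , miscounted) ∷ []))) ∷ (8F , (choose 5F ((7F , miscounted) ∷ []))) ∷ []))) ∷ [])))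
        ∷ (7F , (choose 3F ((4F , (choose 5F ((6F , (choose 8F ((9F , miscounted) ∷ []))) ∷ (8F , (choose 6F ((9F , miscounted) ∷ []))) ∷ (9F , (choose 6F ((8F , miscounted) ∷ []))) ∷ []))) ∷ (5F , (choose 4F ((6F , (choose 8F ((9F , miscounted) ∷ []))) ∷ (8F , (choose 6F ((9F , miscounted) ∷ []))) ∷ (9F , (choose 6F ((8F , miscounted) ∷ []))) ∷ []))) ∷ (6F , (choose 4F ((5F , (choose 8F ((9F , miscounted) ∷ []))) ∷ (8F , (choose 5F ((9F , miscounted) ∷ []))) ∷ (9F , (choose 5F ((8F , miscounted) ∷ []))) ∷ []))) ∷ (8F , (choose 4F ((5F , (choose 6F ((9F , miscounted) ∷ []))) ∷ (6F , (choose 5F ((9F , miscounted) ∷ []))) ∷ (9F , (choose 5F ((6F , miscounted) ∷ []))) ∷ []))) ∷ (9F , (choose 4F ((5F , (choose 6F ((8F , miscounted) ∷ []))) ∷ (6F , (choose 5F ((8F , miscounted) ∷ []))) ∷ (8F , (choose 5F ((6F , miscounted) ∷ []))) ∷ []))) ∷ [])))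
        ∷ (8F , (choose 3F ((4F , (choose 5F ((6F , (choose 7F ((9F , miscounted) ∷ []))) ∷ (7F , (choose 6F ((9F , miscounted) ∷ []))) ∷ (9F , (choose 6F ((7F , miscounted) ∷ []))) ∷ []))) ∷ (5F , (choose 4F ((6F , (choose 7F ((9F , miscounted) ∷ []))) ∷ (7F , (choose 6F ((9F , miscounted) ∷ []))) ∷ (9F , (choose 6F ((7F , (refuted (splitOn 0F (splitOn 4F (splitOn 6F (forcedEqual 4F 6F) (forcedEqual 0F 6F)) (forcedEqual 0F 4F)) (splitOn 4F (forcedEqual 0F 4F) (splitOn 6F (forcedEqual 0F 6F) (forcedEqual 4F 6F)))))) ∷ []))) ∷ []))) ∷ (6F , (choose 4F ((5F , (choose 7F ((9F , miscounted) ∷ []))) ∷ (7F , (choose 5F ((9F , miscounted) ∷ []))) ∷ (9F , (choose 5F ((7F , miscounted) ∷ []))) ∷ []))) ∷ (7F , (choose 4F ((5F , (choose 6F ((9F , miscounted) ∷ []))) ∷ (6F , (choose 5F ((9F , miscounted) ∷ []))) ∷ (9F , (choose 5F ((6F , miscounted) ∷ []))) ∷ []))) ∷ (9F , (choose 4F ((5F , (choose 6F ((7F , miscounted) ∷ []))) ∷ (6F , (choose 5F ((7F , miscounted) ∷ []))) ∷ (7F , (choose 5F ((6F , miscounted) ∷ []))) ∷ []))) ∷ [])))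
        ∷ (9F , (choose 3F ((4F , (choose 5F ((6F , (choose 7F ((8F , miscounted) ∷ []))) ∷ (7F , (choose 6F ((8F , miscounted) ∷ []))) ∷ (8F , (choose 6F ((7F , miscounted) ∷ []))) ∷ []))) ∷ (5F , (choose 4F ((6F , (choose 7F ((8F , miscounted) ∷ []))) ∷ (7F , (choose 6F ((8F , miscounted) ∷ []))) ∷ (8F , (choose 6F ((7F , (refuted (forcedEqual 0F 1F))) ∷ []))) ∷ []))) ∷ (6F , (choose 4F ((5F , (choose 7F ((8F , miscounted) ∷ []))) ∷ (7F , (choose 5F ((8F , miscounted) ∷ []))) ∷ (8F , (choose 5F ((7F , miscounted) ∷ []))) ∷ []))) ∷ (7F , (choose 4F ((5F , (choose 6F ((8F , miscounted) ∷ []))) ∷ (6F , (choose 5F ((8F , (refuted (splitOn 1F (splitOn 3F (forcedEqual 1F 3F) (splitOn 4F (forcedEqual 1F 4F) (forcedEqual 3F 4F))) (splitOn 3F (splitOn 4F (forcedEqual 3F 4F) (forcedEqual 1F 4F)) (forcedEqual 1F 3F))))) ∷ []))) ∷ (8F , (choose 5F ((6F , miscounted) ∷ []))) ∷ []))) ∷ (8F , (choose 4F ((5F , (choose 6F ((7F , miscounted) ∷ []))) ∷ (6F , (choose 5F ((7F , miscounted) ∷ []))) ∷ (7F , (choose 5F ((6F , miscounted) ∷ []))) ∷ []))) ∷ [])))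
        ∷ [])))
    ∷ (3F , (choose 1F
        ( (2F , (choose 4F ((5F , (choose 6F ((7F , (choose 8F ((9F , miscounted) ∷ []))) ∷ (8F , (choose 7F ((9F , miscounted) ∷ []))) ∷ (9F , (choose 7F ((8F , miscounted) ∷ []))) ∷ []))) ∷ (6F , (choose 5F ((7F , (choose 8F ((9F , miscounted) ∷ []))) ∷ (8F , (choose 7F ((9F , miscounted) ∷ []))) ∷ (9F , (choose 7F ((8F , miscounted) ∷ []))) ∷ []))) ∷ (7F , (choose 5F ((6F , (choose 8F ((9F , miscounted) ∷ []))) ∷ (8F , (choose 6F ((9F , miscounted) ∷ []))) ∷ (9F , (choose 6F ((8F , miscounted) ∷ []))) ∷ []))) ∷ (8F , (choose 5F ((6F , (choose 7F ((9F , miscounted) ∷ []))) ∷ (7F , (choose 6F ((9F , miscounted) ∷ []))) ∷ (9F , (choose 6F ((7F , miscounted) ∷ []))) ∷ []))) ∷ (9F , (choose 5F ((6F , (choose 7F ((8F , miscounted) ∷ []))) ∷ (7F , (choose 6F ((8F , miscounted) ∷ []))) ∷ (8F , (choose 6F ((7F , (refuted (splitOn 4F (splitOn 5F (splitOn 6F (splitOn 7F (splitOn 8F (forcedEqual 5F 6F) (forcedEqual 4F 5F)) (splitOn 9F (forcedEqual 4F 6F) (forcedEqual 4F 5F))) (splitOn 7F (splitOn 9F (cyclic 5F 9F 6F true) (forcedEqual 4F 5F)) (splitOn 8F (cyclic 4F 8F 6F true) (forcedEqual 4F 5F)))) (splitOn 6F (splitOn 7F (cyclic 4F 7F 5F true)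 (splitOn 9F (forcedEqual 4F 6F) (cyclic 5F 9F 6F false))) (splitOn 7F (cyclic 4F 7F 5F true) (splitOn 8F (cyclic 4F 8F 6F true) (forcedEqual 5F 6F))))) (splitOn 5F (splitOn 6F (splitOn 7F (splitOn 8F (forcedEqual 5F 6F) (cyclic 4F 8F 6F false)) (cyclic 4F 7F 5F false)) (splitOn 7F (splitOn 9F (cyclic 5F 9F 6F true) (forcedEqual 4F 6F)) (cyclic 4F 7F 5F false))) (splitOn 6F (splitOn 7F (splitOn 8F (forcedEqual 4F 5F) (cyclic 4F 8F 6F false)) (splitOn 9F (forcedEqual 4F 5F) (cyclic 5F 9F 6F false))) (splitOn 7F (splitOn 9F (forcedEqual 4F 5F) (forcedEqual 4F 6F)) (splitOn 8F (forcedEqual 4F 5F) (forcedEqual 5F 6F)))))))) ∷ []))) ∷ []))) ∷ [])))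
        ∷ (4F , (choose 2F ((5F , (choose 6F ((7F , (choose 8F ((9F , miscounted) ∷ []))) ∷ (8F , (choose 7F ((9F , miscounted) ∷ []))) ∷ (9F , (choose 7F ((8F , miscounted) ∷ []))) ∷ []))) ∷ (6F , (choose 5F ((7F , (choose 8F ((9F , miscounted) ∷ []))) ∷ (8F , (choose 7F ((9F , miscounted) ∷ []))) ∷ (9F , (choose 7F ((8F , miscounted) ∷ []))) ∷ []))) ∷ (7F , (choose 5F ((6F , (choose 8F ((9F , miscounted) ∷ []))) ∷ (8F , (choose 6F ((9F , miscounted) ∷ []))) ∷ (9F , (choose 6F ((8F , miscounted) ∷ []))) ∷ []))) ∷ (8F , (choose 5F ((6F , (choose 7F ((9F , miscounted) ∷ []))) ∷ (7F , (choose 6F ((9F , miscounted) ∷ []))) ∷ (9F , (choose 6F ((7F , miscounted) ∷ []))) ∷ []))) ∷ (9F , (choose 5F ((6F , (choose 7F ((8F , miscounted) ∷ []))) ∷ (7F , (choose 6F ((8F , miscounted) ∷ []))) ∷ (8F , (choose 6F ((7F , miscounted) ∷ []))) ∷ []))) ∷ [])))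
        ∷ (5F , (choose 2F ((4F , (choose 6F ((7F , (choose 8F ((9F , (refuted (splitOn 1F (splitOn 2F (forcedEqual 1F 2F) (splitOn 8F (forcedEqual 2F 8F) (forcedEqual 1F 8F))) (splitOn 2F (splitOn 8F (forcedEqual 1F 8F) (forcedEqual 2F 8F)) (forcedEqual 1F 2F))))) ∷ []))) ∷ (8F , (choose 7F ((9F , miscounted) ∷ []))) ∷ (9F , (choose 7F ((8F , miscounted) ∷ []))) ∷ []))) ∷ (6F , (choose 4F ((7F , (choose 8F ((9F , miscounted) ∷ []))) ∷ (8F , (choose 7F ((9F , miscounted) ∷ []))) ∷ (9F , (choose 7F ((8F , (refuted (forcedEqual 0F 1F))) ∷ []))) ∷ []))) ∷ (7F , (choose 4F ((6F , (choose 8F ((9F , miscounted) ∷ []))) ∷ (8F , (choose 6F ((9F , miscounted) ∷ []))) ∷ (9F , (choose 6F ((8F , miscounted) ∷ []))) ∷ []))) ∷ (8F , (choose 4F ((6F , (choose 7F ((9F , miscounted) ∷ []))) ∷ (7F , (choose 6F ((9F , miscounted) ∷ []))) ∷ (9F , (choose 6F ((7F , miscounted) ∷ []))) ∷ []))) ∷ (9F , (choose 4F ((6F , (choose 7F ((8F , miscounted) ∷ []))) ∷ (7F , (choose 6F ((8F , miscounted) ∷ []))) ∷ (8F , (choose 6F ((7F , miscounted) ∷ []))) ∷ []))) ∷ [])))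
        ∷ (6F , (choose 2F ((4F , (choose 5F ((7F , (choose 8F ((9F , miscounted) ∷ []))) ∷ (8F , (choose 7F ((9F , (refuted (forcedEqual 0F 1F))) ∷ []))) ∷ (9F , (choose 7F ((8F , miscounted) ∷ []))) ∷ []))) ∷ (5F , (choose 4F ((7F , (choose 8F ((9F , miscounted) ∷ []))) ∷ (8F , (choose 7F ((9F , miscounted) ∷ []))) ∷ (9F , (choose 7F ((8F , miscounted) ∷ []))) ∷ []))) ∷ (7F , (choose 4F ((5F , (choose 8F ((9F , miscounted) ∷ []))) ∷ (8F , (choose 5F ((9F , miscounted) ∷ []))) ∷ (9F , (choose 5F ((8F , (refuted (splitOn 0F (splitOn 4F (splitOn 5F (forcedEqual 4F 5F) (forcedEqual 0F 5F)) (forcedEqual 0F 4F)) (splitOn 4F (forcedEqual 0F 4F) (splitOn 5F (forcedEqual 0F 5F) (forcedEqual 4F 5F)))))) ∷ []))) ∷ []))) ∷ (8F , (choose 4F ((5F , (choose 7F ((9F , miscounted) ∷ []))) ∷ (7F , (choose 5F ((9F , miscounted) ∷ []))) ∷ (9F , (choose 5F ((7F , (refuted (forcedEqual 0F 1F))) ∷ []))) ∷ []))) ∷ (9F , (choose 4F ((5F , (choose 7F ((8F , miscounted) ∷ []))) ∷ (7F , (choose 5F ((8F , miscounted) ∷ []))) ∷ (8F , (choose 5F ((7F , miscounted) ∷ []))) ∷ []))) ∷ [])))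
        ∷ (7F , (choose 2F ((4F , (choose 5F ((6F , (choose 8F ((9F , miscounted) ∷ []))) ∷ (8F , (choose 6F ((9F , miscounted) ∷ []))) ∷ (9F , (choose 6F ((8F , miscounted) ∷ []))) ∷ []))) ∷ (5F , (choose 4F ((6F , (choose 8F ((9F , miscounted) ∷ []))) ∷ (8F , (choose 6F ((9F , miscounted) ∷ []))) ∷ (9F , (choose 6F ((8F , miscounted) ∷ []))) ∷ []))) ∷ (6F , (choose 4F ((5F , (choose 8F ((9F , miscounted) ∷ []))) ∷ (8F , (choose 5F ((9F , miscounted) ∷ []))) ∷ (9F , (choose 5F ((8F , (refuted (splitOn 0F (splitOn 4F (splitOn 5F (forcedEqual 4F 5F) (forcedEqual 0F 5F)) (forcedEqual 0F 4F)) (splitOn 4F (forcedEqual 0F 4F) (splitOn 5F (forcedEqual 0F 5F) (forcedEqual 4F 5F)))))) ∷ []))) ∷ []))) ∷ (8F , (choose 4F ((5F , (choose 6F ((9F , miscounted) ∷ []))) ∷ (6F , (choose 5F ((9F , miscounted) ∷ []))) ∷ (9F , (choose 5F ((6F , miscounted) ∷ []))) ∷ []))) ∷ (9F , (choose 4F ((5F , (choose 6F ((8F , miscounted) ∷ []))) ∷ (6F , (choose 5F ((8F , miscounted) ∷ []))) ∷ (8F , (choose 5F ((6F , miscounted) ∷ []))) ∷ []))) ∷ [])))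
        ∷ (8F , (choose 2F ((4F , (choose 5F ((6F , (choose 7F ((9F , miscounted) ∷ []))) ∷ (7F , (choose 6F ((9F , miscounted) ∷ []))) ∷ (9F , (choose 6F ((7F , miscounted) ∷ []))) ∷ []))) ∷ (5F , (choose 4F ((6F , (choose 7F ((9F , miscounted) ∷ []))) ∷ (7F , (choose 6F ((9F , miscounted) ∷ []))) ∷ (9F , (choose 6F ((7F , miscounted) ∷ []))) ∷ []))) ∷ (6F , (choose 4F ((5F , (choose 7F ((9F , miscounted) ∷ []))) ∷ (7F , (choose 5F ((9F , miscounted) ∷ []))) ∷ (9F , (choose 5F ((7F , miscounted) ∷ []))) ∷ []))) ∷ (7F , (choose 4F ((5F , (choose 6F ((9F , miscounted) ∷ []))) ∷ (6F , (choose 5F ((9F , miscounted) ∷ []))) ∷ (9F , (choose 5F ((6F , miscounted) ∷ []))) ∷ []))) ∷ (9F , (choose 4F ((5F , (choose 6F ((7F , miscounted) ∷ []))) ∷ (6F , (choose 5F ((7F , miscounted) ∷ []))) ∷ (7F , (choose 5F ((6F , miscounted) ∷ []))) ∷ []))) ∷ [])))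
        ∷ (9F , (choose 2F ((4F , (choose 5F ((6F , (choose 7F ((8F , miscounted) ∷ []))) ∷ (7F , (choose 6F ((8F , miscounted) ∷ []))) ∷ (8F , (choose 6F ((7F , miscounted) ∷ []))) ∷ []))) ∷ (5F , (choose 4F ((6F , (choose 7F ((8F , miscounted) ∷ []))) ∷ (7F , (choose 6F ((8F , miscounted) ∷ []))) ∷ (8F , (choose 6F ((7F , miscounted) ∷ []))) ∷ []))) ∷ (6F , (choose 4F ((5F , (choose 7F ((8F , miscounted) ∷ []))) ∷ (7F , (choose 5F ((8F , (refuted (forcedEqual 0F 1F))) ∷ []))) ∷ (8F , (choose 5F ((7F , miscounted) ∷ []))) ∷ []))) ∷ (7F , (choose 4F ((5F , (choose 6F ((8F , miscounted) ∷ []))) ∷ (6F , (choose 5F ((8F , miscounted) ∷ []))) ∷ (8F , (choose 5F ((6F , miscounted) ∷ []))) ∷ []))) ∷ (8F , (choose 4F ((5F , (choose 6F ((7F , (refuted (splitOn 1F (splitOn 2F (forcedEqual 1F 2F) (splitOn 4F (forcedEqual 1F 4F) (forcedEqual 2F 4F))) (splitOn 2F (splitOn 4F (forcedEqual 2F 4F) (forcedEqual 1F 4F)) (forcedEqual 1F 2F))))) ∷ []))) ∷ (6F , (choose 5F ((7F , miscounted) ∷ []))) ∷ (7F , (choose 5F ((6F , miscounted) ∷ []))) ∷ []))) ∷ [])))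
        ∷ [])))
    ∷ (4F , (choose 1F
        ( (2F , (choose 3F ((5F , (choose 6F ((7F , (choose 8F ((9F , miscounted) ∷ []))) ∷ (8F , (choose 7F ((9F , miscounted) ∷ []))) ∷ (9F , (choose 7F ((8F , miscounted) ∷ []))) ∷ []))) ∷ (6F , (choose 5F ((7F , (choose 8F ((9F , miscounted) ∷ []))) ∷ (8F , (choose 7F ((9F , miscounted) ∷ []))) ∷ (9F , (choose 7F ((8F , miscounted) ∷ []))) ∷ []))) ∷ (7F , (choose 5F ((6F , (choose 8F ((9F , miscounted) ∷ []))) ∷ (8F , (choose 6F ((9F , miscounted) ∷ []))) ∷ (9F , (choose 6F ((8F , miscounted) ∷ []))) ∷ []))) ∷ (8F , (choose 5F ((6F , (choose 7F ((9F , miscounted) ∷ []))) ∷ (7F , (choose 6F ((9F , miscounted) ∷ []))) ∷ (9F , (choose 6F ((7F , miscounted) ∷ []))) ∷ []))) ∷ (9F , (choose 5F ((6F , (choose 7F ((8F , miscounted) ∷ []))) ∷ (7F , (choose 6F ((8F , miscounted) ∷ []))) ∷ (8F , (choose 6F ((7F , miscounted) ∷ []))) ∷ []))) ∷ [])))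
        ∷ (3F , (choose 2F ((5F , (choose 6F ((7F , (choose 8F ((9F , miscounted) ∷ []))) ∷ (8F , (choose 7F ((9F , miscounted) ∷ []))) ∷ (9F , (choose 7F ((8F , miscounted) ∷ []))) ∷ []))) ∷ (6F , (choose 5F ((7F , (choose 8F ((9F , miscounted) ∷ []))) ∷ (8F , (choose 7F ((9F , miscounted) ∷ []))) ∷ (9F , (choose 7F ((8F , miscounted) ∷ []))) ∷ []))) ∷ (7F , (choose 5F ((6F , (choose 8F ((9F , miscounted) ∷ []))) ∷ (8F , (choose 6F ((9F , miscounted) ∷ []))) ∷ (9F , (choose 6F ((8F , miscounted) ∷ []))) ∷ []))) ∷ (8F , (choose 5F ((6F , (choose 7F ((9F , miscounted) ∷ []))) ∷ (7F , (choose 6F ((9F , miscounted) ∷ []))) ∷ (9F , (choose 6F ((7F , miscounted) ∷ []))) ∷ []))) ∷ (9F , (choose 5F ((6F , (choose 7F ((8F , miscounted) ∷ []))) ∷ (7F , (choose 6F ((8F , miscounted) ∷ []))) ∷ (8F , (choose 6F ((7F , miscounted) ∷ []))) ∷ []))) ∷ [])))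
        ∷ (5F , (choose 2F ((3F , (choose 6F ((7F , (choose 8F ((9F , miscounted) ∷ []))) ∷ (8F , (choose 7F ((9F , miscounted) ∷ []))) ∷ (9F , (choose 7F ((8F , miscounted) ∷ []))) ∷ []))) ∷ (6F , (choose 3F ((7F , (choose 8F ((9F , (refuted (forcedEqual 0F 1F))) ∷ []))) ∷ (8F , (choose 7F ((9F , miscounted) ∷ []))) ∷ (9F , (choose 7F ((8F , miscounted) ∷ []))) ∷ []))) ∷ (7F , (choose 3F ((6F , (choose 8F ((9F , miscounted) ∷ []))) ∷ (8F , (choose 6F ((9F , miscounted) ∷ []))) ∷ (9F , (choose 6F ((8F , miscounted) ∷ []))) ∷ []))) ∷ (8F , (choose 3F ((6F , (choose 7F ((9F , miscounted) ∷ []))) ∷ (7F , (choose 6F ((9F , (refuted (splitOn 0F (splitOn 2F (forcedEqual 0F 2F) (splitOn 3F (forcedEqual 0F 3F) (forcedEqual 2F 3F))) (splitOn 2F (splitOn 3F (forcedEqual 2F 3F) (forcedEqual 0F 3F)) (forcedEqual 0F 2F))))) ∷ []))) ∷ (9F , (choose 6F ((7F , (refuted (forcedEqual 0F 1F))) ∷ []))) ∷ []))) ∷ (9F , (choose 3F ((6F , (choose 7F ((8F , miscounted) ∷ []))) ∷ (7F , (choose 6F ((8F , miscounted) ∷ []))) ∷ (8F , (choose 6F ((7F , miscounted) ∷ []))) ∷ []))) ∷ [])))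
        ∷ (6F , (choose 2F ((3F , (choose 5F ((7F , (choose 8F ((9F , miscounted) ∷ []))) ∷ (8F , (choose 7F ((9F , miscounted) ∷ []))) ∷ (9F , (choose 7F ((8F , miscounted) ∷ []))) ∷ []))) ∷ (5F , (choose 3F ((7F , (choose 8F ((9F , miscounted) ∷ []))) ∷ (8F , (choose 7F ((9F , miscounted) ∷ []))) ∷ (9F , (choose 7F ((8F , miscounted) ∷ []))) ∷ []))) ∷ (7F , (choose 3F ((5F , (choose 8F ((9F , miscounted) ∷ []))) ∷ (8F , (choose 5F ((9F , miscounted) ∷ []))) ∷ (9F , (choose 5F ((8F , miscounted) ∷ []))) ∷ []))) ∷ (8F , (choose 3F ((5F , (choose 7F ((9F , (refuted (forcedEqual 0F 1F))) ∷ []))) ∷ (7F , (choose 5F ((9F , (refuted (splitOn 0F (splitOn 2F (forcedEqual 0F 2F) (splitOn 3F (forcedEqual 0F 3F) (forcedEqual 2F 3F))) (splitOn 2F (splitOn 3F (forcedEqual 2F 3F) (forcedEqual 0F 3F)) (forcedEqual 0F 2F))))) ∷ []))) ∷ (9F , (choose 5F ((7F , miscounted) ∷ []))) ∷ []))) ∷ (9F , (choose 3F ((5F , (choose 7F ((8F , miscounted) ∷ []))) ∷ (7F , (choose 5F ((8F , (refuted (forcedEqual 0F 1F))) ∷ []))) ∷ (8F , (choose 5F ((7F , miscounted) ∷ []))) ∷ []))) ∷ [])))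
        ∷ (7F , (choose 2F ((3F , (choose 5F ((6F , (choose 8F ((9F , miscounted) ∷ []))) ∷ (8F , (choose 6F ((9F , miscounted) ∷ []))) ∷ (9F , (choose 6F ((8F , miscounted) ∷ []))) ∷ []))) ∷ (5F , (choose 3F ((6F , (choose 8F ((9F , miscounted) ∷ []))) ∷ (8F , (choose 6F ((9F , miscounted) ∷ []))) ∷ (9F , (choose 6F ((8F , miscounted) ∷ []))) ∷ []))) ∷ (6F , (choose 3F ((5F , (choose 8F ((9F , miscounted) ∷ []))) ∷ (8F , (choose 5F ((9F , miscounted) ∷ []))) ∷ (9F , (choose 5F ((8F , miscounted) ∷ []))) ∷ []))) ∷ (8F , (choose 3F ((5F , (choose 6F ((9F , miscounted) ∷ []))) ∷ (6F , (choose 5F ((9F , miscounted) ∷ []))) ∷ (9F , (choose 5F ((6F , miscounted) ∷ []))) ∷ []))) ∷ (9F , (choose 3F ((5F , (choose 6F ((8F , miscounted) ∷ []))) ∷ (6F , (choose 5F ((8F , miscounted) ∷ []))) ∷ (8F , (choose 5F ((6F , miscounted) ∷ []))) ∷ []))) ∷ [])))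
        ∷ (8F , (choose 2F ((3F , (choose 5F ((6F , (choose 7F ((9F , miscounted) ∷ []))) ∷ (7F , (choose 6F ((9F , miscounted) ∷ []))) ∷ (9F , (choose 6F ((7F , miscounted) ∷ []))) ∷ []))) ∷ (5F , (choose 3F ((6F , (choose 7F ((9F , miscounted) ∷ []))) ∷ (7F , (choose 6F ((9F , miscounted) ∷ []))) ∷ (9F , (choose 6F ((7F , miscounted) ∷ []))) ∷ []))) ∷ (6F , (choose 3F ((5F , (choose 7F ((9F , miscounted) ∷ []))) ∷ (7F , (choose 5F ((9F , miscounted) ∷ []))) ∷ (9F , (choose 5F ((7F , miscounted) ∷ []))) ∷ []))) ∷ (7F , (choose 3F ((5F , (choose 6F ((9F , miscounted) ∷ []))) ∷ (6F , (choose 5F ((9F , miscounted) ∷ []))) ∷ (9F , (choose 5F ((6F , miscounted) ∷ []))) ∷ []))) ∷ (9F , (choose 3F ((5F , (choose 6F ((7F , miscounted) ∷ []))) ∷ (6F , (choose 5F ((7F , miscounted) ∷ []))) ∷ (7F , (choose 5F ((6F , miscounted) ∷ []))) ∷ []))) ∷ [])))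
        ∷ (9F , (choose 2F ((3F , (choose 5F ((6F , (choose 7F ((8F , miscounted) ∷ []))) ∷ (7F , (choose 6F ((8F , miscounted) ∷ []))) ∷ (8F , (choose 6F ((7F , (refuted (splitOn 2F (splitOn 5F (forcedEqual 2F 5F) (splitOn 6F (forcedEqual 2F 6F) (forcedEqual 5F 6F))) (splitOn 5F (splitOn 6F (forcedEqual 5F 6F) (forcedEqual 2F 6F)) (forcedEqual 2F 5F))))) ∷ []))) ∷ []))) ∷ (5F , (choose 3F ((6F , (choose 7F ((8F , miscounted) ∷ []))) ∷ (7F , (choose 6F ((8F , miscounted) ∷ []))) ∷ (8F , (choose 6F ((7F , miscounted) ∷ []))) ∷ []))) ∷ (6F , (choose 3F ((5F , (choose 7F ((8F , (refuted (splitOn 2F (splitOn 3F (forcedEqual 2F 3F) (splitOn 7F (forcedEqual 2F 7F) (forcedEqual 3F 7F))) (splitOn 3F (splitOn 7F (forcedEqual 3F 7F) (forcedEqual 2F 7F)) (forcedEqual 2F 3F))))) ∷ []))) ∷ (7F , (choose 5F ((8F , miscounted) ∷ []))) ∷ (8F , (choose 5F ((7F , miscounted) ∷ []))) ∷ []))) ∷ (7F , (choose 3F ((5F , (choose 6F ((8F , miscounted) ∷ []))) ∷ (6F , (choose 5F ((8F , miscounted) ∷ []))) ∷ (8F , (choose 5F ((6F , miscounted) ∷ []))) ∷ []))) ∷ (8F , (choose 3F ((5F , (choose 6F ((7F , miscounted) ∷ []))) ∷ (6F , (choose 5F ((7F , miscounted) ∷ []))) ∷ (7F , (choose 5F ((6F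 , (refuted (splitOn 1F (splitOn 2F (splitOn 3F (splitOn 7F (splitOn 8F (forcedEqual 2F 3F) (forcedEqual 1F 2F)) (splitOn 9F (forcedEqual 1F 3F) (forcedEqual 1F 2F))) (splitOn 7F (splitOn 9F (cyclic 2F 9F 3F true) (forcedEqual 1F 2F)) (splitOn 8F (cyclic 1F 8F 3F true) (forcedEqual 1F 2F)))) (splitOn 3F (splitOn 7F (cyclic 1F 7F 2F true) (splitOn 9F (forcedEqual 1F 3F) (cyclic 2F 9F 3F false))) (splitOn 7F (cyclic 1F 7F 2F true) (splitOn 8F (cyclic 1F 8F 3F true) (forcedEqual 2F 3F))))) (splitOn 2F (splitOn 3F (splitOn 7F (splitOn 8F (forcedEqual 2F 3F) (cyclic 1F 8F 3F false)) (cyclic 1F 7F 2F false)) (splitOn 7F (splitOn 9F (cyclic 2F 9F 3F true) (forcedEqual 1F 3F)) (cyclic 1F 7F 2F false))) (splitOn 3F (splitOn 7F (splitOn 8F (forcedEqual 1F 2F) (cyclic 1F 8F 3F false)) (splitOn 9F (forcedEqual 1F 2F) (cyclic 2F 9F 3F false))) (splitOn 7F (splitOn 9F (forcedEqual 1F 2F) (forcedEqual 1F 3F)) (splitOn 8F (forcedEqual 1F 2F) (forcedEqual 2F 3F)))))))) ∷ []))) ∷ []))) ∷ [])))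
        ∷ [])))
    ∷ (5F , (choose 1F
        ( (2F , (choose 3F ((4F , (choose 6F ((7F , (choose 8F ((9F , miscounted) ∷ []))) ∷ (8F , (choose 7F ((9F , miscounted) ∷ []))) ∷ (9F , (choose 7F ((8F , miscounted) ∷ []))) ∷ []))) ∷ (6F , (choose 4F ((7F , (choose 8F ((9F , miscounted) ∷ []))) ∷ (8F , (choose 7F ((9F , miscounted) ∷ []))) ∷ (9F , (choose 7F ((8F , miscounted) ∷ []))) ∷ []))) ∷ (7F , (choose 4F ((6F , (choose 8F ((9F , miscounted) ∷ []))) ∷ (8F , (choose 6F ((9F , miscounted) ∷ []))) ∷ (9F , (choose 6F ((8F , miscounted) ∷ []))) ∷ []))) ∷ (8F , (choose 4F ((6F , (choose 7F ((9F , miscounted) ∷ []))) ∷ (7F , (choose 6F ((9F , miscounted) ∷ []))) ∷ (9F , (choose 6F ((7F , miscounted) ∷ []))) ∷ []))) ∷ (9F , (choose 4F ((6F , (choose 7F ((8F , miscounted) ∷ []))) ∷ (7F , (choose 6F ((8F , miscounted) ∷ []))) ∷ (8F , (choose 6F ((7F , miscounted) ∷ []))) ∷ []))) ∷ [])))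
        ∷ (3F , (choose 2F ((4F , (choose 6F ((7F , (choose 8F ((9F , miscounted) ∷ []))) ∷ (8F , (choose 7F ((9F , miscounted) ∷ []))) ∷ (9F , (choose 7F ((8F , miscounted) ∷ []))) ∷ []))) ∷ (6F , (choose 4F ((7F , (choose 8F ((9F , miscounted) ∷ []))) ∷ (8F , (choose 7F ((9F , miscounted) ∷ []))) ∷ (9F , (choose 7F ((8F , miscounted) ∷ []))) ∷ []))) ∷ (7F , (choose 4F ((6F , (choose 8F ((9F , miscounted) ∷ []))) ∷ (8F , (choose 6F ((9F , miscounted) ∷ []))) ∷ (9F , (choose 6F ((8F , miscounted) ∷ []))) ∷ []))) ∷ (8F , (choose 4F ((6F , (choose 7F ((9F , miscounted) ∷ []))) ∷ (7F , (choose 6F ((9F , miscounted) ∷ []))) ∷ (9F , (choose 6F ((7F , (refuted (splitOn 1F (splitOn 4F (forcedEqual 1F 4F) (splitOn 6F (forcedEqual 1F 6F) (forcedEqual 4F 6F))) (splitOn 4F (splitOn 6F (forcedEqual 4F 6F) (forcedEqual 1F 6F)) (forcedEqual 1F 4F))))) ∷ []))) ∷ []))) ∷ (9F , (choose 4F ((6F , (choose 7F ((8F , miscounted) ∷ []))) ∷ (7F , (choose 6F ((8F , miscounted) ∷ []))) ∷ (8F , (choose 6F ((7F , miscounted) ∷ []))) ∷ []))) ∷ [])))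
        ∷ (4F , (choose 2F ((3F , (choose 6F ((7F , (choose 8F ((9F , miscounted) ∷ []))) ∷ (8F , (choose 7F ((9F , miscounted) ∷ []))) ∷ (9F , (choose 7F ((8F , miscounted) ∷ []))) ∷ []))) ∷ (6F , (choose 3F ((7F , (choose 8F ((9F , miscounted) ∷ []))) ∷ (8F , (choose 7F ((9F , miscounted) ∷ []))) ∷ (9F , (choose 7F ((8F , miscounted) ∷ []))) ∷ []))) ∷ (7F , (choose 3F ((6F , (choose 8F ((9F , miscounted) ∷ []))) ∷ (8F , (choose 6F ((9F , miscounted) ∷ []))) ∷ (9F , (choose 6F ((8F , miscounted) ∷ []))) ∷ []))) ∷ (8F , (choose 3F ((6F , (choose 7F ((9F , miscounted) ∷ []))) ∷ (7F , (choose 6F ((9F , miscounted) ∷ []))) ∷ (9F , (choose 6F ((7F , miscounted) ∷ []))) ∷ []))) ∷ (9F , (choose 3F ((6F , (choose 7F ((8F , miscounted) ∷ []))) ∷ (7F , (choose 6F ((8F , miscounted) ∷ []))) ∷ (8F , (choose 6F ((7F , miscounted) ∷ []))) ∷ []))) ∷ [])))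
        ∷ (6F , (choose 2F ((3F , (choose 4F ((7F , (choose 8F ((9F , miscounted) ∷ []))) ∷ (8F , (choose 7F ((9F , miscounted) ∷ []))) ∷ (9F , (choose 7F ((8F , miscounted) ∷ []))) ∷ []))) ∷ (4F , (choose 3F ((7F , (choose 8F ((9F , (refuted (forcedEqual 0F 1F))) ∷ []))) ∷ (8F , (choose 7F ((9F , miscounted) ∷ []))) ∷ (9F , (choose 7F ((8F , miscounted) ∷ []))) ∷ []))) ∷ (7F , (choose 3F ((4F , (choose 8F ((9F , miscounted) ∷ []))) ∷ (8F , (choose 4F ((9F , miscounted) ∷ []))) ∷ (9F , (choose 4F ((8F , miscounted) ∷ []))) ∷ []))) ∷ (8F , (choose 3F ((4F , (choose 7F ((9F , (refuted (splitOn 1F (splitOn 3F (forcedEqual 1F 3F) (splitOn 7F (forcedEqual 3F 7F) (forcedEqual 1F 7F))) (splitOn 3F (splitOn 7F (forcedEqual 1F 7F) (forcedEqual 3F 7F)) (forcedEqual 1F 3F))))) ∷ []))) ∷ (7F , (choose 4F ((9F , miscounted) ∷ []))) ∷ (9F , (choose 4F ((7F , miscounted) ∷ []))) ∷ []))) ∷ (9F , (choose 3F ((4F , (choose 7F ((8F , miscounted) ∷ []))) ∷ (7F , (choose 4F ((8F , miscounted) ∷ []))) ∷ (8F , (choose 4F ((7F , miscounted) ∷ []))) ∷ []))) ∷ [])))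
        ∷ (7F , (choose 2F ((3F , (choose 4F ((6F , (choose 8F ((9F , miscounted) ∷ []))) ∷ (8F , (choose 6F ((9F , miscounted) ∷ []))) ∷ (9F , (choose 6F ((8F , miscounted) ∷ []))) ∷ []))) ∷ (4F , (choose 3F ((6F , (choose 8F ((9F , miscounted) ∷ []))) ∷ (8F , (choose 6F ((9F , miscounted) ∷ []))) ∷ (9F , (choose 6F ((8F , miscounted) ∷ []))) ∷ []))) ∷ (6F , (choose 3F ((4F , (choose 8F ((9F , miscounted) ∷ []))) ∷ (8F , (choose 4F ((9F , miscounted) ∷ []))) ∷ (9F , (choose 4F ((8F , miscounted) ∷ []))) ∷ []))) ∷ (8F , (choose 3F ((4F , (choose 6F ((9F , miscounted) ∷ []))) ∷ (6F , (choose 4F ((9F , miscounted) ∷ []))) ∷ (9F , (choose 4F ((6F , miscounted) ∷ []))) ∷ []))) ∷ (9F , (choose 3F ((4F , (choose 6F ((8F , miscounted) ∷ []))) ∷ (6F , (choose 4F ((8F , miscounted) ∷ []))) ∷ (8F , (choose 4F ((6F , miscounted) ∷ []))) ∷ []))) ∷ [])))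
        ∷ (8F , (choose 2F ((3F , (choose 4F ((6F , (choose 7F ((9F , miscounted) ∷ []))) ∷ (7F , (choose 6F ((9F , miscounted) ∷ []))) ∷ (9F , (choose 6F ((7F , miscounted) ∷ []))) ∷ []))) ∷ (4F , (choose 3F ((6F , (choose 7F ((9F , miscounted) ∷ []))) ∷ (7F , (choose 6F ((9F , miscounted) ∷ []))) ∷ (9F , (choose 6F ((7F , miscounted) ∷ []))) ∷ []))) ∷ (6F , (choose 3F ((4F , (choose 7F ((9F , miscounted) ∷ []))) ∷ (7F , (choose 4F ((9F , (refuted (forcedEqual 0F 1F))) ∷ []))) ∷ (9F , (choose 4F ((7F , miscounted) ∷ []))) ∷ []))) ∷ (7F , (choose 3F ((4F , (choose 6F ((9F , miscounted) ∷ []))) ∷ (6F , (choose 4F ((9F , miscounted) ∷ []))) ∷ (9F , (choose 4F ((6F , miscounted) ∷ []))) ∷ []))) ∷ (9F , (choose 3F ((4F , (choose 6F ((7F , miscounted) ∷ []))) ∷ (6F , (choose 4F ((7F , miscounted) ∷ []))) ∷ (7F , (choose 4F ((6F , miscounted) ∷ []))) ∷ []))) ∷ [])))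
        ∷ (9F , (choose 2F ((3F , (choose 4F ((6F , (choose 7F ((8F , miscounted) ∷ []))) ∷ (7F , (choose 6F ((8F , miscounted) ∷ []))) ∷ (8F , (choose 6F ((7F , miscounted) ∷ []))) ∷ []))) ∷ (4F , (choose 3F ((6F , (choose 7F ((8F , miscounted) ∷ []))) ∷ (7F , (choose 6F ((8F , (refuted (splitOn 0F (splitOn 1F (forcedEqual 0F 1F) (splitOn 3F (forcedEqual 0F 3F) (forcedEqual 1F 3F))) (splitOn 1F (splitOn 3F (forcedEqual 1F 3F) (forcedEqual 0F 3F)) (forcedEqual 0F 1F))))) ∷ []))) ∷ (8F , (choose 6F ((7F , (refuted (forcedEqual 0F 1F))) ∷ []))) ∷ []))) ∷ (6F , (choose 3F ((4F , (choose 7F ((8F , (refuted (forcedEqual 0F 1F))) ∷ []))) ∷ (7F , (choose 4F ((8F , (refuted (splitOn 0F (splitOn 1F (forcedEqual 0F 1F) (splitOn 3F (forcedEqual 0F 3F) (forcedEqual 1F 3F))) (splitOn 1F (splitOn 3F (forcedEqual 1F 3F) (forcedEqual 0F 3F)) (forcedEqual 0F 1F))))) ∷ []))) ∷ (8F , (choose 4F ((7F , miscounted) ∷ []))) ∷ []))) ∷ (7F , (choose 3F ((4F , (choose 6F ((8F , miscounted) ∷ []))) ∷ (6F , (choose 4F ((8F , miscounted) ∷ []))) ∷ (8F , (choose 4F ((6F , miscounted) ∷ []))) ∷ []))) ∷ (8F , (choose 3F ((4F , (choose 6F ((7F , miscounted) ∷ []))) ∷ (6F , (choose 4F ((7F ,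 miscounted) ∷ []))) ∷ (7F , (choose 4F ((6F , (refuted (splitOn 1F (splitOn 2F (splitOn 3F (splitOn 7F (splitOn 8F (forcedEqual 2F 3F) (forcedEqual 1F 2F)) (splitOn 9F (forcedEqual 1F 3F) (forcedEqual 1F 2F))) (splitOn 7F (splitOn 9F (cyclic 2F 9F 3F true) (forcedEqual 1F 2F)) (splitOn 8F (cyclic 1F 8F 3F true) (forcedEqual 1F 2F)))) (splitOn 3F (splitOn 7F (cyclic 1F 7F 2F true) (splitOn 9F (forcedEqual 1F 3F) (cyclic 2F 9F 3F false))) (splitOn 7F (cyclic 1F 7F 2F true) (splitOn 8F (cyclic 1F 8F 3F true) (forcedEqual 2F 3F))))) (splitOn 2F (splitOn 3F (splitOn 7F (splitOn 8F (forcedEqual 2F 3F) (cyclic 1F 8F 3F false)) (cyclic 1F 7F 2F false)) (splitOn 7F (splitOn 9F (cyclic 2F 9F 3F true) (forcedEqual 1F 3F)) (cyclic 1F 7F 2F false))) (splitOn 3F (splitOn 7F (splitOn 8F (forcedEqual 1F 2F) (cyclic 1F 8F 3F false)) (splitOn 9F (forcedEqual 1F 2F) (cyclic 2F 9F 3F false))) (splitOn 7F (splitOn 9F (forcedEqual 1F 2F) (forcedEqual 1F 3F)) (splitOn 8F (forcedEqual 1F 2F) (forcedEqual 2F 3F)))))))) ∷ []))) ∷ []))) ∷ [])))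
        ∷ [])))
    ∷ (6F , (choose 1F
        ( (2F , (choose 3F ((4F , (choose 5F ((7F , (choose 8F ((9F , miscounted) ∷ []))) ∷ (8F , (choose 7F ((9F , miscounted) ∷ []))) ∷ (9F , (choose 7F ((8F , miscounted) ∷ []))) ∷ []))) ∷ (5F , (choose 4F ((7F , (choose 8F ((9F , miscounted) ∷ []))) ∷ (8F , (choose 7F ((9F , miscounted) ∷ []))) ∷ (9F , (choose 7F ((8F , miscounted) ∷ []))) ∷ []))) ∷ (7F , (choose 4F ((5F , (choose 8F ((9F , miscounted) ∷ []))) ∷ (8F , (choose 5F ((9F , miscounted) ∷ []))) ∷ (9F , (choose 5F ((8F , (refuted (splitOn 1F (splitOn 4F (forcedEqual 1F 4F) (splitOn 5F (forcedEqual 1F 5F) (forcedEqual 4F 5F))) (splitOn 4F (splitOn 5F (forcedEqual 4F 5F) (forcedEqual 1F 5F)) (forcedEqual 1F 4F))))) ∷ []))) ∷ []))) ∷ (8F , (choose 4F ((5F , (choose 7F ((9F , miscounted) ∷ []))) ∷ (7F , (choose 5F ((9F , miscounted) ∷ []))) ∷ (9F , (choose 5F ((7F , miscounted) ∷ []))) ∷ []))) ∷ (9F , (choose 4F ((5F , (choose 7F ((8F , miscounted) ∷ []))) ∷ (7F , (choose 5F ((8F , miscounted) ∷ []))) ∷ (8F , (choose 5F ((7F , miscounted) ∷ []))) ∷ []))) ∷ [])))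
        ∷ (3F , (choose 2F ((4F , (choose 5F ((7F , (choose 8F ((9F , miscounted) ∷ []))) ∷ (8F , (choose 7F ((9F , miscounted) ∷ []))) ∷ (9F , (choose 7F ((8F , miscounted) ∷ []))) ∷ []))) ∷ (5F , (choose 4F ((7F , (choose 8F ((9F , miscounted) ∷ []))) ∷ (8F , (choose 7F ((9F , miscounted) ∷ []))) ∷ (9F , (choose 7F ((8F , miscounted) ∷ []))) ∷ []))) ∷ (7F , (choose 4F ((5F , (choose 8F ((9F , miscounted) ∷ []))) ∷ (8F , (choose 5F ((9F , miscounted) ∷ []))) ∷ (9F , (choose 5F ((8F , miscounted) ∷ []))) ∷ []))) ∷ (8F , (choose 4F ((5F , (choose 7F ((9F , miscounted) ∷ []))) ∷ (7F , (choose 5F ((9F , miscounted) ∷ []))) ∷ (9F , (choose 5F ((7F , miscounted) ∷ []))) ∷ []))) ∷ (9F , (choose 4F ((5F , (choose 7F ((8F , miscounted) ∷ []))) ∷ (7F , (choose 5F ((8F , miscounted) ∷ []))) ∷ (8F , (choose 5F ((7F , miscounted) ∷ []))) ∷ []))) ∷ [])))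
        ∷ (4F , (choose 2F ((3F , (choose 5F ((7F , (choose 8F ((9F , miscounted) ∷ []))) ∷ (8F , (choose 7F ((9F , miscounted) ∷ []))) ∷ (9F , (choose 7F ((8F , miscounted) ∷ []))) ∷ []))) ∷ (5F , (choose 3F ((7F , (choose 8F ((9F , miscounted) ∷ []))) ∷ (8F , (choose 7F ((9F , miscounted) ∷ []))) ∷ (9F , (choose 7F ((8F , miscounted) ∷ []))) ∷ []))) ∷ (7F , (choose 3F ((5F , (choose 8F ((9F , miscounted) ∷ []))) ∷ (8F , (choose 5F ((9F , miscounted) ∷ []))) ∷ (9F , (choose 5F ((8F , miscounted) ∷ []))) ∷ []))) ∷ (8F , (choose 3F ((5F , (choose 7F ((9F , miscounted) ∷ []))) ∷ (7F , (choose 5F ((9F , miscounted) ∷ []))) ∷ (9F , (choose 5F ((7F , miscounted) ∷ []))) ∷ []))) ∷ (9F , (choose 3F ((5F , (choose 7F ((8F , miscounted) ∷ []))) ∷ (7F , (choose 5F ((8F , miscounted) ∷ []))) ∷ (8F , (choose 5F ((7F , miscounted) ∷ []))) ∷ []))) ∷ [])))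
        ∷ (5F , (choose 2F ((3F , (choose 4F ((7F , (choose 8F ((9F , miscounted) ∷ []))) ∷ (8F , (choose 7F ((9F , miscounted) ∷ []))) ∷ (9F , (choose 7F ((8F , miscounted) ∷ []))) ∷ []))) ∷ (4F , (choose 3F ((7F , (choose 8F ((9F , (refuted (splitOn 1F (splitOn 2F (forcedEqual 1F 2F) (splitOn 8F (forcedEqual 2F 8F) (forcedEqual 1F 8F))) (splitOn 2F (splitOn 8F (forcedEqual 1F 8F) (forcedEqual 2F 8F)) (forcedEqual 1F 2F))))) ∷ []))) ∷ (8F , (choose 7F ((9F , miscounted) ∷ []))) ∷ (9F , (choose 7F ((8F , miscounted) ∷ []))) ∷ []))) ∷ (7F , (choose 3F ((4F , (choose 8F ((9F , miscounted) ∷ []))) ∷ (8F , (choose 4F ((9F , miscounted) ∷ []))) ∷ (9F , (choose 4F ((8F , miscounted) ∷ []))) ∷ []))) ∷ (8F , (choose 3F ((4F , (choose 7F ((9F , (refuted (forcedEqual 0F 1F))) ∷ []))) ∷ (7F , (choose 4F ((9F , miscounted) ∷ []))) ∷ (9F , (choose 4F ((7F , miscounted) ∷ []))) ∷ []))) ∷ (9F , (choose 3F ((4F , (choose 7F ((8F , miscounted) ∷ []))) ∷ (7F , (choose 4F ((8F , miscounted) ∷ []))) ∷ (8F , (choose 4F ((7F , miscounted) ∷ []))) ∷ []))) ∷ [])))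
        ∷ (7F , (choose 2F ((3F , (choose 4F ((5F , (choose 8F ((9F , miscounted) ∷ []))) ∷ (8F , (choose 5F ((9F , miscounted) ∷ []))) ∷ (9F , (choose 5F ((8F , miscounted) ∷ []))) ∷ []))) ∷ (4F , (choose 3F ((5F , (choose 8F ((9F , miscounted) ∷ []))) ∷ (8F , (choose 5F ((9F , miscounted) ∷ []))) ∷ (9F , (choose 5F ((8F , miscounted) ∷ []))) ∷ []))) ∷ (5F , (choose 3F ((4F , (choose 8F ((9F , miscounted) ∷ []))) ∷ (8F , (choose 4F ((9F , miscounted) ∷ []))) ∷ (9F , (choose 4F ((8F , miscounted) ∷ []))) ∷ []))) ∷ (8F , (choose 3F ((4F , (choose 5F ((9F , miscounted) ∷ []))) ∷ (5F , (choose 4F ((9F , (refuted (forcedEqual 0F 1F))) ∷ []))) ∷ (9F , (choose 4F ((5F , miscounted) ∷ []))) ∷ []))) ∷ (9F , (choose 3F ((4F , (choose 5F ((8F , miscounted) ∷ []))) ∷ (5F , (choose 4F ((8F , miscounted) ∷ []))) ∷ (8F , (choose 4F ((5F , miscounted) ∷ []))) ∷ []))) ∷ [])))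
        ∷ (8F , (choose 2F ((3F , (choose 4F ((5F , (choose 7F ((9F , miscounted) ∷ []))) ∷ (7F , (choose 5F ((9F , miscounted) ∷ []))) ∷ (9F , (choose 5F ((7F , miscounted) ∷ []))) ∷ []))) ∷ (4F , (choose 3F ((5F , (choose 7F ((9F , miscounted) ∷ []))) ∷ (7F , (choose 5F ((9F , miscounted) ∷ []))) ∷ (9F , (choose 5F ((7F , miscounted) ∷ []))) ∷ []))) ∷ (5F , (choose 3F ((4F , (choose 7F ((9F , miscounted) ∷ []))) ∷ (7F , (choose 4F ((9F , miscounted) ∷ []))) ∷ (9F , (choose 4F ((7F , miscounted) ∷ []))) ∷ []))) ∷ (7F , (choose 3F ((4F , (choose 5F ((9F , miscounted) ∷ []))) ∷ (5F , (choose 4F ((9F , miscounted) ∷ []))) ∷ (9F , (choose 4F ((5F , miscounted) ∷ []))) ∷ []))) ∷ (9F , (choose 3F ((4F , (choose 5F ((7F , miscounted) ∷ []))) ∷ (5F , (choose 4F ((7F , miscounted) ∷ []))) ∷ (7F , (choose 4F ((5F , miscounted) ∷ []))) ∷ []))) ∷ [])))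
        ∷ (9F , (choose 2F ((3F , (choose 4F ((5F , (choose 7F ((8F , miscounted) ∷ []))) ∷ (7F , (choose 5F ((8F , miscounted) ∷ []))) ∷ (8F , (choose 5F ((7F , miscounted) ∷ []))) ∷ []))) ∷ (4F , (choose 3F ((5F , (choose 7F ((8F , (refuted (forcedEqual 0F 1F))) ∷ []))) ∷ (7F , (choose 5F ((8F , miscounted) ∷ []))) ∷ (8F , (choose 5F ((7F , miscounted) ∷ []))) ∷ []))) ∷ (5F , (choose 3F ((4F , (choose 7F ((8F , miscounted) ∷ []))) ∷ (7F , (choose 4F ((8F , miscounted) ∷ []))) ∷ (8F , (choose 4F ((7F , miscounted) ∷ []))) ∷ []))) ∷ (7F , (choose 3F ((4F , (choose 5F ((8F , (refuted (forcedEqual 0F 1F))) ∷ []))) ∷ (5F , (choose 4F ((8F , miscounted) ∷ []))) ∷ (8F , (choose 4F ((5F , miscounted) ∷ []))) ∷ []))) ∷ (8F , (choose 3F ((4F , (choose 5F ((7F , (refuted (splitOn 0F (splitOn 1F (forcedEqual 0F 1F) (splitOn 2F (forcedEqual 0F 2F) (forcedEqual 1F 2F))) (splitOn 1F (splitOn 2F (forcedEqual 1F 2F) (forcedEqual 0F 2F)) (forcedEqual 0F 1F))))) ∷ []))) ∷ (5F , (choose 4F ((7F , (refuted (splitOn 0F (splitOn 1F (forcedEqual 0F 1F) (splitOn 2F (forcedEqual 0F 2F) (forcedEqual 1F 2F))) (splitOn 1F (splitOn 2F (forcedEqual 1F 2F) (forcedEqual 0F 2F)) (forcedEqual 0F 1F)))))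 ∷ []))) ∷ (7F , (choose 4F ((5F , (refuted (splitOn 1F (splitOn 2F (splitOn 3F (splitOn 7F (splitOn 8F (forcedEqual 2F 3F) (forcedEqual 1F 2F)) (splitOn 9F (forcedEqual 1F 3F) (forcedEqual 1F 2F))) (splitOn 7F (splitOn 9F (cyclic 2F 9F 3F true) (forcedEqual 1F 2F)) (splitOn 8F (cyclic 1F 8F 3F true) (forcedEqual 1F 2F)))) (splitOn 3F (splitOn 7F (cyclic 1F 7F 2F true) (splitOn 9F (forcedEqual 1F 3F) (cyclic 2F 9F 3F false))) (splitOn 7F (cyclic 1F 7F 2F true) (splitOn 8F (cyclic 1F 8F 3F true) (forcedEqual 2F 3F))))) (splitOn 2F (splitOn 3F (splitOn 7F (splitOn 8F (forcedEqual 2F 3F) (cyclic 1F 8F 3F false)) (cyclic 1F 7F 2F false)) (splitOn 7F (splitOn 9F (cyclic 2F 9F 3F true) (forcedEqual 1F 3F)) (cyclic 1F 7F 2F false))) (splitOn 3F (splitOn 7F (splitOn 8F (forcedEqual 1F 2F) (cyclic 1F 8F 3F false)) (splitOn 9F (forcedEqual 1F 2F) (cyclic 2F 9F 3F false))) (splitOn 7F (splitOn 9F (forcedEqual 1F 2F) (forcedEqual 1F 3F)) (splitOn 8F (forcedEqual 1F 2F) (forcedEqual 2F 3F)))))))) ∷ []))) ∷ []))) ∷ [])))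
        ∷ [])))
    ∷ (7F , (choose 1F
        ( (2F , (choose 3F ((4F , (choose 5F ((6F , (choose 8F ((9F , miscounted) ∷ []))) ∷ (8F , (choose 6F ((9F , (refuted (forcedEqual 0F 1F))) ∷ []))) ∷ (9F , (choose 6F ((8F , miscounted) ∷ []))) ∷ []))) ∷ (5F , (choose 4F ((6F , (choose 8F ((9F , miscounted) ∷ []))) ∷ (8F , (choose 6F ((9F , miscounted) ∷ []))) ∷ (9F , (choose 6F ((8F , (refuted (forcedEqual 0F 1F))) ∷ []))) ∷ []))) ∷ (6F , (choose 4F ((5F , (choose 8F ((9F , miscounted) ∷ []))) ∷ (8F , (choose 5F ((9F , miscounted) ∷ []))) ∷ (9F , (choose 5F ((8F , (refuted (splitOn 1F (splitOn 4F (forcedEqual 1F 4F) (splitOn 5F (forcedEqual 1F 5F) (forcedEqual 4F 5F))) (splitOn 4F (splitOn 5F (forcedEqual 4F 5F) (forcedEqual 1F 5F)) (forcedEqual 1F 4F))))) ∷ []))) ∷ []))) ∷ (8F , (choose 4F ((5F , (choose 6F ((9F , miscounted) ∷ []))) ∷ (6F , (choose 5F ((9F , miscounted) ∷ []))) ∷ (9F , (choose 5F ((6F , miscounted) ∷ []))) ∷ []))) ∷ (9F , (choose 4F ((5F , (choose 6F ((8F , miscounted) ∷ []))) ∷ (6F , (choose 5F ((8F , miscounted) ∷ []))) ∷ (8F , (choose 5F ((6F , miscounted) ∷ []))) ∷ []))) ∷ [])))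
        ∷ (3F , (choose 2F ((4F , (choose 5F ((6F , (choose 8F ((9F , miscounted) ∷ []))) ∷ (8F , (choose 6F ((9F , (refuted (splitOn 0F (splitOn 2F (forcedEqual 0F 2F) (splitOn 6F (forcedEqual 2F 6F) (forcedEqual 0F 6F))) (splitOn 2F (splitOn 6F (forcedEqual 0F 6F) (forcedEqual 2F 6F)) (forcedEqual 0F 2F))))) ∷ []))) ∷ (9F , (choose 6F ((8F , miscounted) ∷ []))) ∷ []))) ∷ (5F , (choose 4F ((6F , (choose 8F ((9F , miscounted) ∷ []))) ∷ (8F , (choose 6F ((9F , miscounted) ∷ []))) ∷ (9F , (choose 6F ((8F , miscounted) ∷ []))) ∷ []))) ∷ (6F , (choose 4F ((5F , (choose 8F ((9F , miscounted) ∷ []))) ∷ (8F , (choose 5F ((9F , miscounted) ∷ []))) ∷ (9F , (choose 5F ((8F , miscounted) ∷ []))) ∷ []))) ∷ (8F , (choose 4F ((5F , (choose 6F ((9F , miscounted) ∷ []))) ∷ (6F , (choose 5F ((9F , miscounted) ∷ []))) ∷ (9F , (choose 5F ((6F , (refuted (forcedEqual 0F 1F))) ∷ []))) ∷ []))) ∷ (9F , (choose 4F ((5F , (choose 6F ((8F , miscounted) ∷ []))) ∷ (6F , (choose 5F ((8F , miscounted) ∷ []))) ∷ (8F , (choose 5F ((6F , miscounted) ∷ []))) ∷ []))) ∷ [])))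
        ∷ (4F , (choose 2F ((3F , (choose 5F ((6F , (choose 8F ((9F , miscounted) ∷ []))) ∷ (8F , (choose 6F ((9F , miscounted) ∷ []))) ∷ (9F , (choose 6F ((8F , miscounted) ∷ []))) ∷ []))) ∷ (5F , (choose 3F ((6F , (choose 8F ((9F , miscounted) ∷ []))) ∷ (8F , (choose 6F ((9F , miscounted) ∷ []))) ∷ (9F , (choose 6F ((8F , miscounted) ∷ []))) ∷ []))) ∷ (6F , (choose 3F ((5F , (choose 8F ((9F , (refuted (splitOn 1F (splitOn 2F (forcedEqual 1F 2F) (splitOn 3F (forcedEqual 1F 3F) (forcedEqual 2F 3F))) (splitOn 2F (splitOn 3F (forcedEqual 2F 3F) (forcedEqual 1F 3F)) (forcedEqual 1F 2F))))) ∷ []))) ∷ (8F , (choose 5F ((9F , miscounted) ∷ []))) ∷ (9F , (choose 5F ((8F , (refuted (forcedEqual 0F 1F))) ∷ []))) ∷ []))) ∷ (8F , (choose 3F ((5F , (choose 6F ((9F , (refuted (forcedEqual 0F 1F))) ∷ []))) ∷ (6F , (choose 5F ((9F , miscounted) ∷ []))) ∷ (9F , (choose 5F ((6F , miscounted) ∷ []))) ∷ []))) ∷ (9F , (choose 3F ((5F , (choose 6F ((8F , miscounted) ∷ []))) ∷ (6F , (choose 5F ((8F , miscounted) ∷ []))) ∷ (8F , (choose 5F ((6F , miscounted) ∷ []))) ∷ []))) ∷ [])))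
        ∷ (5F , (choose 2F ((3F , (choose 4F ((6F , (choose 8F ((9F , miscounted) ∷ []))) ∷ (8F , (choose 6F ((9F , miscounted) ∷ []))) ∷ (9F , (choose 6F ((8F , (refuted (splitOn 0F (splitOn 1F (forcedEqual 0F 1F) (splitOn 6F (forcedEqual 1F 6F) (forcedEqual 0F 6F))) (splitOn 1F (splitOn 6F (forcedEqual 0F 6F) (forcedEqual 1F 6F)) (forcedEqual 0F 1F))))) ∷ []))) ∷ []))) ∷ (4F , (choose 3F ((6F , (choose 8F ((9F , (refuted (splitOn 0F (splitOn 1F (splitOn 2F (splitOn 4F (splitOn 5F (forcedEqual 1F 2F) (forcedEqual 0F 1F)) (splitOn 7F (forcedEqual 0F 2F) (forcedEqual 0F 1F))) (splitOn 4F (splitOn 7F (cyclic 1F 7F 2F true) (forcedEqual 0F 1F)) (splitOn 5F (cyclic 0F 5F 2F true) (forcedEqual 0F 1F)))) (splitOn 2F (splitOn 4F (cyclic 0F 4F 1F true) (splitOn 7F (forcedEqual 0F 2F) (cyclic 1F 7F 2F false))) (splitOn 4F (cyclic 0F 4F 1F true) (splitOn 5F (cyclic 0F 5F 2F true) (forcedEqual 1F 2F))))) (splitOn 1F (splitOn 2F (splitOn 4F (splitOn 5F (forcedEqual 1F 2F) (cyclic 0F 5F 2F false)) (cyclic 0F 4F 1F false)) (splitOn 4F (splitOn 7F (cyclic 1F 7F 2F true) (forcedEqual 0F 2F)) (cyclic 0F 4F 1F false))) (splitOn 2F (splitOn 4F (splitOn 5F (forcedEqual 0F 1F) (cyclic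 0F 5F 2F false)) (splitOn 7F (forcedEqual 0F 1F) (cyclic 1F 7F 2F false))) (splitOn 4F (splitOn 7F (forcedEqual 0F 1F) (forcedEqual 0F 2F)) (splitOn 5F (forcedEqual 0F 1F) (forcedEqual 1F 2F)))))))) ∷ []))) ∷ (8F , (choose 6F ((9F , (refuted (splitOn 0F (splitOn 1F (splitOn 2F (splitOn 4F (splitOn 5F (forcedEqual 1F 2F) (forcedEqual 0F 1F)) (splitOn 7F (forcedEqual 0F 2F) (forcedEqual 0F 1F))) (splitOn 4F (splitOn 7F (cyclic 1F 7F 2F true) (forcedEqual 0F 1F)) (splitOn 5F (cyclic 0F 5F 2F true) (forcedEqual 0F 1F)))) (splitOn 2F (splitOn 4F (cyclic 0F 4F 1F true) (splitOn 7F (forcedEqual 0F 2F) (cyclic 1F 7F 2F false))) (splitOn 4F (cyclic 0F 4F 1F true) (splitOn 5F (cyclic 0F 5F 2F true) (forcedEqual 1F 2F))))) (splitOn 1F (splitOn 2F (splitOn 4F (splitOn 5F (forcedEqual 1F 2F) (cyclic 0F 5F 2F false)) (cyclic 0F 4F 1F false)) (splitOn 4F (splitOn 7F (cyclic 1F 7F 2F true) (forcedEqual 0F 2F)) (cyclic 0F 4F 1F false))) (splitOn 2F (splitOn 4F (splitOn 5F (forcedEqual 0F 1F) (cyclic 0F 5F 2F false)) (splitOn 7F (forcedEqual 0F 1F) (cyclic 1F 7F 2F false))) (splitOn 4F (splitOn 7F (forcedEqual 0F 1F) (forcedEqual 0F 2F)) (splitOn 5F (forcedEqual 0F 1F) (forcedEqual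 1F 2F)))))))) ∷ []))) ∷ (9F , (choose 6F ((8F , (refuted (splitOn 0F (splitOn 1F (splitOn 2F (splitOn 4F (splitOn 5F (forcedEqual 1F 2F) (forcedEqual 0F 1F)) (splitOn 7F (forcedEqual 0F 2F) (forcedEqual 0F 1F))) (splitOn 4F (splitOn 7F (cyclic 1F 7F 2F true) (forcedEqual 0F 1F)) (splitOn 5F (cyclic 0F 5F 2F true) (forcedEqual 0F 1F)))) (splitOn 2F (splitOn 4F (cyclic 0F 4F 1F true) (splitOn 7F (forcedEqual 0F 2F) (cyclic 1F 7F 2F false))) (splitOn 4F (cyclic 0F 4F 1F true) (splitOn 5F (cyclic 0F 5F 2F true) (forcedEqual 1F 2F))))) (splitOn 1F (splitOn 2F (splitOn 4F (splitOn 5F (forcedEqual 1F 2F) (cyclic 0F 5F 2F false)) (cyclic 0F 4F 1F false)) (splitOn 4F (splitOn 7F (cyclic 1F 7F 2F true) (forcedEqual 0F 2F)) (cyclic 0F 4F 1F false))) (splitOn 2F (splitOn 4F (splitOn 5F (forcedEqual 0F 1F) (cyclic 0F 5F 2F false)) (splitOn 7F (forcedEqual 0F 1F) (cyclic 1F 7F 2F false))) (splitOn 4F (splitOn 7F (forcedEqual 0F 1F) (forcedEqual 0F 2F)) (splitOn 5F (forcedEqual 0F 1F) (forcedEqual 1F 2F)))))))) ∷ []))) ∷ []))) ∷ (6F , (choose 3F ((4F , (choose 8F ((9F , miscounted) ∷ []))) ∷ (8F , (choose 4F ((9F , miscounted) ∷ []))) ∷ (9F , (choose 4F ((8F , (refuted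 (splitOn 0F (splitOn 1F (forcedEqual 0F 1F) (splitOn 3F (forcedEqual 0F 3F) (forcedEqual 1F 3F))) (splitOn 1F (splitOn 3F (forcedEqual 1F 3F) (forcedEqual 0F 3F)) (forcedEqual 0F 1F))))) ∷ []))) ∷ []))) ∷ (8F , (choose 3F ((4F , (choose 6F ((9F , miscounted) ∷ []))) ∷ (6F , (choose 4F ((9F , miscounted) ∷ []))) ∷ (9F , (choose 4F ((6F , (refuted (splitOn 0F (splitOn 1F (forcedEqual 0F 1F) (splitOn 3F (forcedEqual 0F 3F) (forcedEqual 1F 3F))) (splitOn 1F (splitOn 3F (forcedEqual 1F 3F) (forcedEqual 0F 3F)) (forcedEqual 0F 1F))))) ∷ []))) ∷ []))) ∷ (9F , (choose 3F ((4F , (choose 6F ((8F , (refuted (splitOn 0F (splitOn 1F (forcedEqual 0F 1F) (splitOn 6F (forcedEqual 1F 6F) (forcedEqual 0F 6F))) (splitOn 1F (splitOn 6F (forcedEqual 0F 6F) (forcedEqual 1F 6F)) (forcedEqual 0F 1F))))) ∷ []))) ∷ (6F , (choose 4F ((8F , miscounted) ∷ []))) ∷ (8F , (choose 4F ((6F , miscounted) ∷ []))) ∷ []))) ∷ [])))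
        ∷ (6F , (choose 2F ((3F , (choose 4F ((5F , (choose 8F ((9F , miscounted) ∷ []))) ∷ (8F , (choose 5F ((9F , miscounted) ∷ []))) ∷ (9F , (choose 5F ((8F , miscounted) ∷ []))) ∷ []))) ∷ (4F , (choose 3F ((5F , (choose 8F ((9F , miscounted) ∷ []))) ∷ (8F , (choose 5F ((9F , (refuted (splitOn 0F (splitOn 2F (forcedEqual 0F 2F) (splitOn 3F (forcedEqual 0F 3F) (forcedEqual 2F 3F))) (splitOn 2F (splitOn 3F (forcedEqual 2F 3F) (forcedEqual 0F 3F)) (forcedEqual 0F 2F))))) ∷ []))) ∷ (9F , (choose 5F ((8F , miscounted) ∷ []))) ∷ []))) ∷ (5F , (choose 3F ((4F , (choose 8F ((9F , (refuted (splitOn 1F (splitOn 2F (forcedEqual 1F 2F) (splitOn 3F (forcedEqual 1F 3F) (forcedEqual 2F 3F))) (splitOn 2F (splitOn 3F (forcedEqual 2F 3F) (forcedEqual 1F 3F)) (forcedEqual 1F 2F))))) ∷ []))) ∷ (8F , (choose 4F ((9F , (refuted (forcedEqual 0F 1F))) ∷ []))) ∷ (9F , (choose 4F ((8F , miscounted) ∷ []))) ∷ []))) ∷ (8F , (choose 3F ((4F , (choose 5F ((9F , miscounted) ∷ []))) ∷ (5F , (choose 4F ((9F , miscounted) ∷ []))) ∷ (9F , (choose 4F ((5F , (refuted (forcedEqual 0F 1F))) ∷ []))) ∷ []))) ∷ (9F , (choose 3F ((4F , (choose 5F ((8F , miscounted) ∷ []))) ∷ (5F , (choose 4F ((8F ,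 (refuted (forcedEqual 0F 1F))) ∷ []))) ∷ (8F , (choose 4F ((5F , miscounted) ∷ []))) ∷ []))) ∷ [])))
        ∷ (8F , (choose 2F ((3F , (choose 4F ((5F , (choose 6F ((9F , miscounted) ∷ []))) ∷ (6F , (choose 5F ((9F , miscounted) ∷ []))) ∷ (9F , (choose 5F ((6F , miscounted) ∷ []))) ∷ []))) ∷ (4F , (choose 3F ((5F , (choose 6F ((9F , (refuted (splitOn 0F (splitOn 2F (forcedEqual 0F 2F) (splitOn 6F (forcedEqual 2F 6F) (forcedEqual 0F 6F))) (splitOn 2F (splitOn 6F (forcedEqual 0F 6F) (forcedEqual 2F 6F)) (forcedEqual 0F 2F))))) ∷ []))) ∷ (6F , (choose 5F ((9F , miscounted) ∷ []))) ∷ (9F , (choose 5F ((6F , miscounted) ∷ []))) ∷ []))) ∷ (5F , (choose 3F ((4F , (choose 6F ((9F , miscounted) ∷ []))) ∷ (6F , (choose 4F ((9F , miscounted) ∷ []))) ∷ (9F , (choose 4F ((6F , miscounted) ∷ []))) ∷ []))) ∷ (6F , (choose 3F ((4F , (choose 5F ((9F , (refuted (forcedEqual 0F 1F))) ∷ []))) ∷ (5F , (choose 4F ((9F , miscounted) ∷ []))) ∷ (9F , (choose 4F ((5F , miscounted) ∷ []))) ∷ []))) ∷ (9F , (choose 3F ((4F , (choose 5F ((6F , miscounted) ∷ []))) ∷ (5F , (choose 4F ((6F , miscounted) ∷ []))) ∷ (6F , (choose 4F ((5F , miscounted) ∷ []))) ∷ []))) ∷ [])))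
        ∷ (9F , (choose 2F ((3F , (choose 4F ((5F , (choose 6F ((8F , miscounted) ∷ []))) ∷ (6F , (choose 5F ((8F , (refuted (forcedEqual 0F 1F))) ∷ []))) ∷ (8F , (choose 5F ((6F , miscounted) ∷ []))) ∷ []))) ∷ (4F , (choose 3F ((5F , (choose 6F ((8F , miscounted) ∷ []))) ∷ (6F , (choose 5F ((8F , miscounted) ∷ []))) ∷ (8F , (choose 5F ((6F , (refuted (splitOn 0F (splitOn 2F (forcedEqual 0F 2F) (splitOn 3F (forcedEqual 0F 3F) (forcedEqual 2F 3F))) (splitOn 2F (splitOn 3F (forcedEqual 2F 3F) (forcedEqual 0F 3F)) (forcedEqual 0F 2F))))) ∷ []))) ∷ []))) ∷ (5F , (choose 3F ((4F , (choose 6F ((8F , (refuted (forcedEqual 0F 1F))) ∷ []))) ∷ (6F , (choose 4F ((8F , miscounted) ∷ []))) ∷ (8F , (choose 4F ((6F , miscounted) ∷ []))) ∷ []))) ∷ (6F , (choose 3F ((4F , (choose 5F ((8F , miscounted) ∷ []))) ∷ (5F , (choose 4F ((8F , miscounted) ∷ []))) ∷ (8F , (choose 4F ((5F , (refuted (forcedEqual 0F 1F))) ∷ []))) ∷ []))) ∷ (8F , (choose 3F ((4F , (choose 5F ((6F , miscounted) ∷ []))) ∷ (5F , (choose 4F ((6F , miscounted) ∷ []))) ∷ (6F , (choose 4F ((5F , (refuted (splitOn 1F (splitOn 2F (forcedEqual 1F 2F) (splitOn 4F (forcedEqual 1F 4F) (forcedEqual 2F 4F))) (splitOn 2F (splitOn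 4F (forcedEqual 2F 4F) (forcedEqual 1F 4F)) (forcedEqual 1F 2F))))) ∷ []))) ∷ []))) ∷ [])))
        ∷ [])))
    ∷ (8F , (choose 1F
        ( (2F , (choose 3F ((4F , (choose 5F ((6F , (choose 7F ((9F , miscounted) ∷ []))) ∷ (7F , (choose 6F ((9F , miscounted) ∷ []))) ∷ (9F , (choose 6F ((7F , (refuted (splitOn 0F (splitOn 3F (forcedEqual 0F 3F) (splitOn 5F (forcedEqual 3F 5F) (forcedEqual 0F 5F))) (splitOn 3F (splitOn 5F (forcedEqual 0F 5F) (forcedEqual 3F 5F)) (forcedEqual 0F 3F))))) ∷ []))) ∷ []))) ∷ (5F , (choose 4F ((6F , (choose 7F ((9F , miscounted) ∷ []))) ∷ (7F , (choose 6F ((9F , miscounted) ∷ []))) ∷ (9F , (choose 6F ((7F , miscounted) ∷ []))) ∷ []))) ∷ (6F , (choose 4F ((5F , (choose 7F ((9F , miscounted) ∷ []))) ∷ (7F , (choose 5F ((9F , miscounted) ∷ []))) ∷ (9F , (choose 5F ((7F , miscounted) ∷ []))) ∷ []))) ∷ (7F , (choose 4F ((5F , (choose 6F ((9F , miscounted) ∷ []))) ∷ (6F , (choose 5F ((9F , miscounted) ∷ []))) ∷ (9F , (choose 5F ((6F , (refuted (forcedEqual 0F 1F))) ∷ []))) ∷ []))) ∷ (9F , (choose 4F ((5F , (choose 6F ((7F , miscounted) ∷ []))) ∷ (6F , (choose 5F ((7F , miscounted) ∷ []))) ∷ (7F , (choose 5F ((6F , miscounted) ∷ []))) ∷ [])))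 ∷ [])))
        ∷ (3F , (choose 2F ((4F , (choose 5F ((6F , (choose 7F ((9F , miscounted) ∷ []))) ∷ (7F , (choose 6F ((9F , miscounted) ∷ []))) ∷ (9F , (choose 6F ((7F , (refuted (forcedEqual 0F 1F))) ∷ []))) ∷ []))) ∷ (5F , (choose 4F ((6F , (choose 7F ((9F , miscounted) ∷ []))) ∷ (7F , (choose 6F ((9F , miscounted) ∷ []))) ∷ (9F , (choose 6F ((7F , (refuted (splitOn 1F (splitOn 4F (forcedEqual 1F 4F) (splitOn 6F (forcedEqual 1F 6F) (forcedEqual 4F 6F))) (splitOn 4F (splitOn 6F (forcedEqual 4F 6F) (forcedEqual 1F 6F)) (forcedEqual 1F 4F))))) ∷ []))) ∷ []))) ∷ (6F , (choose 4F ((5F , (choose 7F ((9F , miscounted) ∷ []))) ∷ (7F , (choose 5F ((9F , miscounted) ∷ []))) ∷ (9F , (choose 5F ((7F , (refuted (forcedEqual 0F 1F))) ∷ []))) ∷ []))) ∷ (7F , (choose 4F ((5F , (choose 6F ((9F , miscounted) ∷ []))) ∷ (6F , (choose 5F ((9F , miscounted) ∷ []))) ∷ (9F , (choose 5F ((6F , miscounted) ∷ []))) ∷ []))) ∷ (9F , (choose 4F ((5F , (choose 6F ((7F , miscounted) ∷ []))) ∷ (6F , (choose 5F ((7F , miscounted) ∷ []))) ∷ (7F , (choose 5F ((6F , miscounted) ∷ []))) ∷ []))) ∷ [])))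
        ∷ (4F , (choose 2F ((3F , (choose 5F ((6F , (choose 7F ((9F , miscounted) ∷ []))) ∷ (7F , (choose 6F ((9F , miscounted) ∷ []))) ∷ (9F , (choose 6F ((7F , miscounted) ∷ []))) ∷ []))) ∷ (5F , (choose 3F ((6F , (choose 7F ((9F , miscounted) ∷ []))) ∷ (7F , (choose 6F ((9F , miscounted) ∷ []))) ∷ (9F , (choose 6F ((7F , miscounted) ∷ []))) ∷ []))) ∷ (6F , (choose 3F ((5F , (choose 7F ((9F , (refuted (splitOn 1F (splitOn 2F (forcedEqual 1F 2F) (splitOn 3F (forcedEqual 1F 3F) (forcedEqual 2F 3F))) (splitOn 2F (splitOn 3F (forcedEqual 2F 3F) (forcedEqual 1F 3F)) (forcedEqual 1F 2F))))) ∷ []))) ∷ (7F , (choose 5F ((9F , (refuted (forcedEqual 0F 1F))) ∷ []))) ∷ (9F , (choose 5F ((7F , miscounted) ∷ []))) ∷ []))) ∷ (7F , (choose 3F ((5F , (choose 6F ((9F , miscounted) ∷ []))) ∷ (6F , (choose 5F ((9F , miscounted) ∷ []))) ∷ (9F , (choose 5F ((6F , miscounted) ∷ []))) ∷ []))) ∷ (9F , (choose 3F ((5F , (choose 6F ((7F , (refuted (forcedEqual 0F 1F))) ∷ []))) ∷ (6F , (choose 5F ((7F , miscounted) ∷ []))) ∷ (7F , (choose 5F ((6F , miscounted) ∷ []))) ∷ []))) ∷ [])))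
        ∷ (5F , (choose 2F ((3F , (choose 4F ((6F , (choose 7F ((9F , miscounted) ∷ []))) ∷ (7F , (choose 6F ((9F , miscounted) ∷ []))) ∷ (9F , (choose 6F ((7F , miscounted) ∷ []))) ∷ []))) ∷ (4F , (choose 3F ((6F , (choose 7F ((9F , (refuted (splitOn 1F (splitOn 2F (forcedEqual 1F 2F) (splitOn 3F (forcedEqual 1F 3F) (forcedEqual 2F 3F))) (splitOn 2F (splitOn 3F (forcedEqual 2F 3F) (forcedEqual 1F 3F)) (forcedEqual 1F 2F))))) ∷ []))) ∷ (7F , (choose 6F ((9F , miscounted) ∷ []))) ∷ (9F , (choose 6F ((7F , miscounted) ∷ []))) ∷ []))) ∷ (6F , (choose 3F ((4F , (choose 7F ((9F , miscounted) ∷ []))) ∷ (7F , (choose 4F ((9F , miscounted) ∷ []))) ∷ (9F , (choose 4F ((7F , (refuted (forcedEqual 0F 1F))) ∷ []))) ∷ []))) ∷ (7F , (choose 3F ((4F , (choose 6F ((9F , (refuted (splitOn 0F (splitOn 2F (forcedEqual 0F 2F) (splitOn 3F (forcedEqual 0F 3F) (forcedEqual 2F 3F))) (splitOn 2F (splitOn 3F (forcedEqual 2F 3F) (forcedEqual 0F 3F)) (forcedEqual 0F 2F))))) ∷ []))) ∷ (6F , (choose 4F ((9F , (refuted (forcedEqual 0F 1F))) ∷ []))) ∷ (9F , (choose 4F ((6F , miscounted) ∷ []))) ∷ []))) ∷ (9F , (choose 3F ((4F , (choose 6F ((7F , miscounted) ∷ []))) ∷ (6F , (choose 4F ((7F ,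 miscounted) ∷ []))) ∷ (7F , (choose 4F ((6F , (refuted (forcedEqual 0F 1F))) ∷ []))) ∷ []))) ∷ [])))
        ∷ (6F , (choose 2F ((3F , (choose 4F ((5F , (choose 7F ((9F , miscounted) ∷ []))) ∷ (7F , (choose 5F ((9F , miscounted) ∷ []))) ∷ (9F , (choose 5F ((7F , (refuted (splitOn 0F (splitOn 1F (forcedEqual 0F 1F) (splitOn 5F (forcedEqual 1F 5F) (forcedEqual 0F 5F))) (splitOn 1F (splitOn 5F (forcedEqual 0F 5F) (forcedEqual 1F 5F)) (forcedEqual 0F 1F))))) ∷ []))) ∷ []))) ∷ (4F , (choose 3F ((5F , (choose 7F ((9F , miscounted) ∷ []))) ∷ (7F , (choose 5F ((9F , miscounted) ∷ []))) ∷ (9F , (choose 5F ((7F , (refuted (splitOn 0F (splitOn 1F (forcedEqual 0F 1F) (splitOn 5F (forcedEqual 1F 5F) (forcedEqual 0F 5F))) (splitOn 1F (splitOn 5F (forcedEqual 0F 5F) (forcedEqual 1F 5F)) (forcedEqual 0F 1F))))) ∷ []))) ∷ []))) ∷ (5F , (choose 3F ((4F , (choose 7F ((9F , (refuted (splitOn 0F (splitOn 1F (splitOn 3F (splitOn 4F (splitOn 6F (forcedEqual 1F 3F) (forcedEqual 0F 1F)) (splitOn 8F (forcedEqual 0F 3F) (forcedEqual 0F 1F))) (splitOn 4F (splitOn 8F (cyclic 1F 8F 3F true) (forcedEqual 0F 1F)) (splitOn 6F (cyclic 0F 6F 3F true) (forcedEqual 0F 1F)))) (splitOn 3F (splitOn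 4F (cyclic 0F 4F 1F true) (splitOn 8F (forcedEqual 0F 3F) (cyclic 1F 8F 3F false))) (splitOn 4F (cyclic 0F 4F 1F true) (splitOn 6F (cyclic 0F 6F 3F true) (forcedEqual 1F 3F))))) (splitOn 1F (splitOn 3F (splitOn 4F (splitOn 6F (forcedEqual 1F 3F) (cyclic 0F 6F 3F false)) (cyclic 0F 4F 1F false)) (splitOn 4F (splitOn 8F (cyclic 1F 8F 3F true) (forcedEqual 0F 3F)) (cyclic 0F 4F 1F false))) (splitOn 3F (splitOn 4F (splitOn 6F (forcedEqual 0F 1F) (cyclic 0F 6F 3F false)) (splitOn 8F (forcedEqual 0F 1F) (cyclic 1F 8F 3F false))) (splitOn 4F (splitOn 8F (forcedEqual 0F 1F) (forcedEqual 0F 3F)) (splitOn 6F (forcedEqual 0F 1F) (forcedEqual 1F 3F)))))))) ∷ []))) ∷ (7F , (choose 4F ((9F , miscounted) ∷ []))) ∷ (9F , (choose 4F ((7F , miscounted) ∷ []))) ∷ []))) ∷ (7F , (choose 3F ((4F , (choose 5F ((9F , (refuted (splitOn 0F (splitOn 1F (splitOn 3F (splitOn 4F (splitOn 6F (forcedEqual 1F 3F) (forcedEqual 0F 1F)) (splitOn 8F (forcedEqual 0F 3F) (forcedEqual 0F 1F))) (splitOn 4F (splitOn 8F (cyclic 1F 8F 3F true) (forcedEqual 0F 1F)) (splitOn 6F (cyclic 0F 6F 3F true) (forcedEqual 0F 1F)))) (splitOn 3F (splitOn 4F (cyclic 0F 4F 1F true) (splitOn 8F (forcedEqual 0F 3F)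 (cyclic 1F 8F 3F false))) (splitOn 4F (cyclic 0F 4F 1F true) (splitOn 6F (cyclic 0F 6F 3F true) (forcedEqual 1F 3F))))) (splitOn 1F (splitOn 3F (splitOn 4F (splitOn 6F (forcedEqual 1F 3F) (cyclic 0F 6F 3F false)) (cyclic 0F 4F 1F false)) (splitOn 4F (splitOn 8F (cyclic 1F 8F 3F true) (forcedEqual 0F 3F)) (cyclic 0F 4F 1F false))) (splitOn 3F (splitOn 4F (splitOn 6F (forcedEqual 0F 1F) (cyclic 0F 6F 3F false)) (splitOn 8F (forcedEqual 0F 1F) (cyclic 1F 8F 3F false))) (splitOn 4F (splitOn 8F (forcedEqual 0F 1F) (forcedEqual 0F 3F)) (splitOn 6F (forcedEqual 0F 1F) (forcedEqual 1F 3F)))))))) ∷ []))) ∷ (5F , (choose 4F ((9F , miscounted) ∷ []))) ∷ (9F , (choose 4F ((5F , miscounted) ∷ []))) ∷ []))) ∷ (9F , (choose 3F ((4F , (choose 5F ((7F , (refuted (splitOn 0F (splitOn 1F (splitOn 3F (splitOn 4F (splitOn 6F (forcedEqual 1F 3F) (forcedEqual 0F 1F)) (splitOn 8F (forcedEqual 0F 3F) (forcedEqual 0F 1F))) (splitOn 4F (splitOn 8F (cyclic 1F 8F 3F true) (forcedEqual 0F 1F)) (splitOn 6F (cyclic 0F 6F 3F true) (forcedEqual 0F 1F)))) (splitOn 3F (splitOn 4F (cyclic 0F 4F 1F true) (splitOn 8F (forcedEqual 0F 3F) (cyclic 1F 8F 3F false))) (splitOn 4F (cyclic 0F 4F 1F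 true) (splitOn 6F (cyclic 0F 6F 3F true) (forcedEqual 1F 3F))))) (splitOn 1F (splitOn 3F (splitOn 4F (splitOn 6F (forcedEqual 1F 3F) (cyclic 0F 6F 3F false)) (cyclic 0F 4F 1F false)) (splitOn 4F (splitOn 8F (cyclic 1F 8F 3F true) (forcedEqual 0F 3F)) (cyclic 0F 4F 1F false))) (splitOn 3F (splitOn 4F (splitOn 6F (forcedEqual 0F 1F) (cyclic 0F 6F 3F false)) (splitOn 8F (forcedEqual 0F 1F) (cyclic 1F 8F 3F false))) (splitOn 4F (splitOn 8F (forcedEqual 0F 1F) (forcedEqual 0F 3F)) (splitOn 6F (forcedEqual 0F 1F) (forcedEqual 1F 3F)))))))) ∷ []))) ∷ (5F , (choose 4F ((7F , (refuted (splitOn 0F (splitOn 1F (forcedEqual 0F 1F) (splitOn 2F (forcedEqual 0F 2F) (forcedEqual 1F 2F))) (splitOn 1F (splitOn 2F (forcedEqual 1F 2F) (forcedEqual 0F 2F)) (forcedEqual 0F 1F))))) ∷ []))) ∷ (7F , (choose 4F ((5F , (refuted (splitOn 0F (splitOn 1F (forcedEqual 0F 1F) (splitOn 2F (forcedEqual 0F 2F) (forcedEqual 1F 2F))) (splitOn 1F (splitOn 2F (forcedEqual 1F 2F) (forcedEqual 0F 2F)) (forcedEqual 0F 1F))))) ∷ []))) ∷ []))) ∷ [])))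
        ∷ (7F , (choose 2F ((3F , (choose 4F ((5F , (choose 6F ((9F , miscounted) ∷ []))) ∷ (6F , (choose 5F ((9F , miscounted) ∷ []))) ∷ (9F , (choose 5F ((6F , miscounted) ∷ []))) ∷ []))) ∷ (4F , (choose 3F ((5F , (choose 6F ((9F , (refuted (forcedEqual 0F 1F))) ∷ []))) ∷ (6F , (choose 5F ((9F , miscounted) ∷ []))) ∷ (9F , (choose 5F ((6F , miscounted) ∷ []))) ∷ []))) ∷ (5F , (choose 3F ((4F , (choose 6F ((9F , miscounted) ∷ []))) ∷ (6F , (choose 4F ((9F , miscounted) ∷ []))) ∷ (9F , (choose 4F ((6F , miscounted) ∷ []))) ∷ []))) ∷ (6F , (choose 3F ((4F , (choose 5F ((9F , (refuted (splitOn 0F (splitOn 3F (forcedEqual 0F 3F) (splitOn 5F (forcedEqual 3F 5F) (forcedEqual 0F 5F))) (splitOn 3F (splitOn 5F (forcedEqual 0F 5F) (forcedEqual 3F 5F)) (forcedEqual 0F 3F))))) ∷ []))) ∷ (5F , (choose 4F ((9F , miscounted) ∷ []))) ∷ (9F , (choose 4F ((5F , miscounted) ∷ []))) ∷ []))) ∷ (9F , (choose 3F ((4F , (choose 5F ((6F , miscounted) ∷ []))) ∷ (5F , (choose 4F ((6F , miscounted) ∷ []))) ∷ (6F , (choose 4F ((5F , miscounted) ∷ []))) ∷ []))) ∷ [])))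
        ∷ (9F , (choose 2F ((3F , (choose 4F ((5F , (choose 6F ((7F , (refuted (forcedEqual 0F 1F))) ∷ []))) ∷ (6F , (choose 5F ((7F , miscounted) ∷ []))) ∷ (7F , (choose 5F ((6F , miscounted) ∷ []))) ∷ []))) ∷ (4F , (choose 3F ((5F , (choose 6F ((7F , miscounted) ∷ []))) ∷ (6F , (choose 5F ((7F , (refuted (forcedEqual 0F 1F))) ∷ []))) ∷ (7F , (choose 5F ((6F , miscounted) ∷ []))) ∷ []))) ∷ (5F , (choose 3F ((4F , (choose 6F ((7F , miscounted) ∷ []))) ∷ (6F , (choose 4F ((7F , miscounted) ∷ []))) ∷ (7F , (choose 4F ((6F , (refuted (splitOn 1F (splitOn 3F (forcedEqual 1F 3F) (splitOn 4F (forcedEqual 1F 4F) (forcedEqual 3F 4F))) (splitOn 3F (splitOn 4F (forcedEqual 3F 4F) (forcedEqual 1F 4F)) (forcedEqual 1F 3F))))) ∷ []))) ∷ []))) ∷ (6F , (choose 3F ((4F , (choose 5F ((7F , miscounted) ∷ []))) ∷ (5F , (choose 4F ((7F , miscounted) ∷ []))) ∷ (7F , (choose 4F ((5F , miscounted) ∷ []))) ∷ []))) ∷ (7F , (choose 3F ((4F , (choose 5F ((6F , (refuted (splitOn 0F (splitOn 2F (forcedEqual 0F 2F) (splitOn 3F (forcedEqual 0F 3F) (forcedEqual 2F 3F))) (splitOn 2F (splitOn 3F (forcedEqual 2F 3F) (forcedEqual 0F 3F)) (forcedEqual 0F 2F))))) ∷ []))) ∷ (5F , (choose 4F ((6F ,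 (refuted (forcedEqual 0F 1F))) ∷ []))) ∷ (6F , (choose 4F ((5F , miscounted) ∷ []))) ∷ []))) ∷ [])))
        ∷ [])))
    ∷ (9F , (choose 1F
        ( (2F , (choose 3F ((4F , (choose 5F ((6F , (choose 7F ((8F , miscounted) ∷ []))) ∷ (7F , (choose 6F ((8F , miscounted) ∷ []))) ∷ (8F , (choose 6F ((7F , miscounted) ∷ []))) ∷ []))) ∷ (5F , (choose 4F ((6F , (choose 7F ((8F , miscounted) ∷ []))) ∷ (7F , (choose 6F ((8F , miscounted) ∷ []))) ∷ (8F , (choose 6F ((7F , (refuted (splitOn 0F (splitOn 3F (forcedEqual 0F 3F) (splitOn 4F (forcedEqual 3F 4F) (forcedEqual 0F 4F))) (splitOn 3F (splitOn 4F (forcedEqual 0F 4F) (forcedEqual 3F 4F)) (forcedEqual 0F 3F))))) ∷ []))) ∷ []))) ∷ (6F , (choose 4F ((5F , (choose 7F ((8F , miscounted) ∷ []))) ∷ (7F , (choose 5F ((8F , miscounted) ∷ []))) ∷ (8F , (choose 5F ((7F , miscounted) ∷ []))) ∷ []))) ∷ (7F , (choose 4F ((5F , (choose 6F ((8F , miscounted) ∷ []))) ∷ (6F , (choose 5F ((8F , (refuted (forcedEqual 0F 1F))) ∷ []))) ∷ (8F , (choose 5F ((6F , miscounted) ∷ []))) ∷ []))) ∷ (8F , (choose 4F ((5F , (choose 6F ((7F , miscounted) ∷ []))) ∷ (6F , (choose 5F ((7F , miscounted) ∷ []))) ∷ (7F , (choose 5F ((6F , miscounted) ∷ []))) ∷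 []))) ∷ [])))
        ∷ (3F , (choose 2F ((4F , (choose 5F ((6F , (choose 7F ((8F , miscounted) ∷ []))) ∷ (7F , (choose 6F ((8F , miscounted) ∷ []))) ∷ (8F , (choose 6F ((7F , miscounted) ∷ []))) ∷ []))) ∷ (5F , (choose 4F ((6F , (choose 7F ((8F , miscounted) ∷ []))) ∷ (7F , (choose 6F ((8F , miscounted) ∷ []))) ∷ (8F , (choose 6F ((7F , miscounted) ∷ []))) ∷ []))) ∷ (6F , (choose 4F ((5F , (choose 7F ((8F , miscounted) ∷ []))) ∷ (7F , (choose 5F ((8F , (refuted (splitOn 0F (splitOn 2F (forcedEqual 0F 2F) (splitOn 4F (forcedEqual 2F 4F) (forcedEqual 0F 4F))) (splitOn 2F (splitOn 4F (forcedEqual 0F 4F) (forcedEqual 2F 4F)) (forcedEqual 0F 2F))))) ∷ []))) ∷ (8F , (choose 5F ((7F , miscounted) ∷ []))) ∷ []))) ∷ (7F , (choose 4F ((5F , (choose 6F ((8F , miscounted) ∷ []))) ∷ (6F , (choose 5F ((8F , miscounted) ∷ []))) ∷ (8F , (choose 5F ((6F , miscounted) ∷ []))) ∷ []))) ∷ (8F , (choose 4F ((5F , (choose 6F ((7F , (refuted (forcedEqual 0F 1F))) ∷ []))) ∷ (6F , (choose 5F ((7F , miscounted) ∷ []))) ∷ (7F , (choose 5F ((6F , miscounted) ∷ []))) ∷ []))) ∷ [])))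
        ∷ (4F , (choose 2F ((3F , (choose 5F ((6F , (choose 7F ((8F , miscounted) ∷ []))) ∷ (7F , (choose 6F ((8F , miscounted) ∷ []))) ∷ (8F , (choose 6F ((7F , (refuted (splitOn 2F (splitOn 5F (forcedEqual 2F 5F) (splitOn 6F (forcedEqual 2F 6F) (forcedEqual 5F 6F))) (splitOn 5F (splitOn 6F (forcedEqual 5F 6F) (forcedEqual 2F 6F)) (forcedEqual 2F 5F))))) ∷ []))) ∷ []))) ∷ (5F , (choose 3F ((6F , (choose 7F ((8F , miscounted) ∷ []))) ∷ (7F , (choose 6F ((8F , miscounted) ∷ []))) ∷ (8F , (choose 6F ((7F , miscounted) ∷ []))) ∷ []))) ∷ (6F , (choose 3F ((5F , (choose 7F ((8F , (refuted (splitOn 0F (splitOn 2F (splitOn 3F (splitOn 5F (splitOn 6F (forcedEqual 2F 3F) (forcedEqual 0F 2F)) (splitOn 9F (forcedEqual 0F 3F) (forcedEqual 0F 2F))) (splitOn 5F (splitOn 9F (cyclic 2F 9F 3F true) (forcedEqual 0F 2F)) (splitOn 6F (cyclic 0F 6F 3F true) (forcedEqual 0F 2F)))) (splitOn 3F (splitOn 5F (cyclic 0F 5F 2F true) (splitOn 9F (forcedEqual 0F 3F) (cyclic 2F 9F 3F false))) (splitOn 5F (cyclic 0F 5F 2F true) (splitOn 6F (cyclic 0F 6F 3F true) (forcedEqual 2F 3F))))) (splitOn 2F (splitOn 3F (splitOn 5F (splitOn 6F (forcedEqual 2F 3F) (cyclic 0F 6F 3F false)) (cyclic 0F 5F 2F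 false)) (splitOn 5F (splitOn 9F (cyclic 2F 9F 3F true) (forcedEqual 0F 3F)) (cyclic 0F 5F 2F false))) (splitOn 3F (splitOn 5F (splitOn 6F (forcedEqual 0F 2F) (cyclic 0F 6F 3F false)) (splitOn 9F (forcedEqual 0F 2F) (cyclic 2F 9F 3F false))) (splitOn 5F (splitOn 9F (forcedEqual 0F 2F) (forcedEqual 0F 3F)) (splitOn 6F (forcedEqual 0F 2F) (forcedEqual 2F 3F)))))))) ∷ []))) ∷ (7F , (choose 5F ((8F , miscounted) ∷ []))) ∷ (8F , (choose 5F ((7F , miscounted) ∷ []))) ∷ []))) ∷ (7F , (choose 3F ((5F , (choose 6F ((8F , miscounted) ∷ []))) ∷ (6F , (choose 5F ((8F , miscounted) ∷ []))) ∷ (8F , (choose 5F ((6F , miscounted) ∷ []))) ∷ []))) ∷ (8F , (choose 3F ((5F , (choose 6F ((7F , miscounted) ∷ []))) ∷ (6F , (choose 5F ((7F , miscounted) ∷ []))) ∷ (7F , (choose 5F ((6F , (refuted (splitOn 2F (splitOn 3F (forcedEqual 2F 3F) (splitOn 5F (forcedEqual 2F 5F) (forcedEqual 3F 5F))) (splitOn 3F (splitOn 5F (forcedEqual 3F 5F) (forcedEqual 2F 5F)) (forcedEqual 2F 3F))))) ∷ []))) ∷ []))) ∷ [])))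
        ∷ (5F , (choose 2F ((3F , (choose 4F ((6F , (choose 7F ((8F , miscounted) ∷ []))) ∷ (7F , (choose 6F ((8F , miscounted) ∷ []))) ∷ (8F , (choose 6F ((7F , (refuted (forcedEqual 0F 1F))) ∷ []))) ∷ []))) ∷ (4F , (choose 3F ((6F , (choose 7F ((8F , (refuted (splitOn 1F (splitOn 2F (forcedEqual 1F 2F) (splitOn 3F (forcedEqual 1F 3F) (forcedEqual 2F 3F))) (splitOn 2F (splitOn 3F (forcedEqual 2F 3F) (forcedEqual 1F 3F)) (forcedEqual 1F 2F))))) ∷ []))) ∷ (7F , (choose 6F ((8F , miscounted) ∷ []))) ∷ (8F , (choose 6F ((7F , miscounted) ∷ []))) ∷ []))) ∷ (6F , (choose 3F ((4F , (choose 7F ((8F , miscounted) ∷ []))) ∷ (7F , (choose 4F ((8F , miscounted) ∷ []))) ∷ (8F , (choose 4F ((7F , (refuted (splitOn 0F (splitOn 2F (forcedEqual 0F 2F) (splitOn 4F (forcedEqual 2F 4F) (forcedEqual 0F 4F))) (splitOn 2F (splitOn 4F (forcedEqual 0F 4F) (forcedEqual 2F 4F)) (forcedEqual 0F 2F))))) ∷ []))) ∷ []))) ∷ (7F , (choose 3F ((4F , (choose 6F ((8F , (refuted (forcedEqual 0F 1F))) ∷ []))) ∷ (6F , (choose 4F ((8F , miscounted) ∷ []))) ∷ (8F , (choose 4F ((6F , miscounted) ∷ []))) ∷ []))) ∷ (8F , (choose 3F ((4F , (choose 6F ((7F , miscounted) ∷ []))) ∷ (6F , (choose 4F ((7F ,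 (refuted (forcedEqual 0F 1F))) ∷ []))) ∷ (7F , (choose 4F ((6F , miscounted) ∷ []))) ∷ []))) ∷ [])))
        ∷ (6F , (choose 2F ((3F , (choose 4F ((5F , (choose 7F ((8F , miscounted) ∷ []))) ∷ (7F , (choose 5F ((8F , (refuted (forcedEqual 0F 1F))) ∷ []))) ∷ (8F , (choose 5F ((7F , miscounted) ∷ []))) ∷ []))) ∷ (4F , (choose 3F ((5F , (choose 7F ((8F , miscounted) ∷ []))) ∷ (7F , (choose 5F ((8F , miscounted) ∷ []))) ∷ (8F , (choose 5F ((7F , (refuted (forcedEqual 0F 1F))) ∷ []))) ∷ []))) ∷ (5F , (choose 3F ((4F , (choose 7F ((8F , (refuted (splitOn 1F (splitOn 2F (forcedEqual 1F 2F) (splitOn 3F (forcedEqual 1F 3F) (forcedEqual 2F 3F))) (splitOn 2F (splitOn 3F (forcedEqual 2F 3F) (forcedEqual 1F 3F)) (forcedEqual 1F 2F))))) ∷ []))) ∷ (7F , (choose 4F ((8F , (refuted (forcedEqual 0F 1F))) ∷ []))) ∷ (8F , (choose 4F ((7F , miscounted) ∷ []))) ∷ []))) ∷ (7F , (choose 3F ((4F , (choose 5F ((8F , miscounted) ∷ []))) ∷ (5F , (choose 4F ((8F , (refuted (splitOn 0F (splitOn 3F (forcedEqual 0F 3F) (splitOn 4F (forcedEqual 3F 4F) (forcedEqual 0F 4F))) (splitOn 3F (splitOn 4F (forcedEqual 0F 4F) (forcedEqual 3F 4F)) (forcedEqual 0F 3F))))) ∷ []))) ∷ (8F , (choose 4F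 ((5F , miscounted) ∷ []))) ∷ []))) ∷ (8F , (choose 3F ((4F , (choose 5F ((7F , miscounted) ∷ []))) ∷ (5F , (choose 4F ((7F , miscounted) ∷ []))) ∷ (7F , (choose 4F ((5F , miscounted) ∷ []))) ∷ []))) ∷ [])))
        ∷ (7F , (choose 2F ((3F , (choose 4F ((5F , (choose 6F ((8F , miscounted) ∷ []))) ∷ (6F , (choose 5F ((8F , miscounted) ∷ []))) ∷ (8F , (choose 5F ((6F , miscounted) ∷ []))) ∷ []))) ∷ (4F , (choose 3F ((5F , (choose 6F ((8F , (refuted (splitOn 0F (splitOn 1F (forcedEqual 0F 1F) (splitOn 3F (forcedEqual 0F 3F) (forcedEqual 1F 3F))) (splitOn 1F (splitOn 3F (forcedEqual 1F 3F) (forcedEqual 0F 3F)) (forcedEqual 0F 1F))))) ∷ []))) ∷ (6F , (choose 5F ((8F , (refuted (forcedEqual 0F 1F))) ∷ []))) ∷ (8F , (choose 5F ((6F , miscounted) ∷ []))) ∷ []))) ∷ (5F , (choose 3F ((4F , (choose 6F ((8F , miscounted) ∷ []))) ∷ (6F , (choose 4F ((8F , miscounted) ∷ []))) ∷ (8F , (choose 4F ((6F , miscounted) ∷ []))) ∷ []))) ∷ (6F , (choose 3F ((4F , (choose 5F ((8F , miscounted) ∷ []))) ∷ (5F , (choose 4F ((8F , (refuted (splitOn 0F (splitOn 2F (splitOn 3F (splitOn 5F (splitOn 6F (forcedEqual 2F 3F) (forcedEqual 0F 2F)) (splitOn 9F (forcedEqual 0F 3F) (forcedEqual 0F 2F)))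 (splitOn 5F (splitOn 9F (cyclic 2F 9F 3F true) (forcedEqual 0F 2F)) (splitOn 6F (cyclic 0F 6F 3F true) (forcedEqual 0F 2F)))) (splitOn 3F (splitOn 5F (cyclic 0F 5F 2F true) (splitOn 9F (forcedEqual 0F 3F) (cyclic 2F 9F 3F false))) (splitOn 5F (cyclic 0F 5F 2F true) (splitOn 6F (cyclic 0F 6F 3F true) (forcedEqual 2F 3F))))) (splitOn 2F (splitOn 3F (splitOn 5F (splitOn 6F (forcedEqual 2F 3F) (cyclic 0F 6F 3F false)) (cyclic 0F 5F 2F false)) (splitOn 5F (splitOn 9F (cyclic 2F 9F 3F true) (forcedEqual 0F 3F)) (cyclic 0F 5F 2F false))) (splitOn 3F (splitOn 5F (splitOn 6F (forcedEqual 0F 2F) (cyclic 0F 6F 3F false)) (splitOn 9F (forcedEqual 0F 2F) (cyclic 2F 9F 3F false))) (splitOn 5F (splitOn 9F (forcedEqual 0F 2F) (forcedEqual 0F 3F)) (splitOn 6F (forcedEqual 0F 2F) (forcedEqual 2F 3F)))))))) ∷ []))) ∷ (8F , (choose 4F ((5F , miscounted) ∷ []))) ∷ []))) ∷ (8F , (choose 3F ((4F , (choose 5F ((6F , (refuted (forcedEqual 0F 1F))) ∷ []))) ∷ (5F , (choose 4F ((6F , (refuted (splitOn 0F (splitOn 1F (forcedEqual 0F 1F) (splitOn 3F (forcedEqual 0F 3F) (forcedEqual 1F 3F))) (splitOn 1F (splitOn 3F (forcedEqual 1F 3F) (forcedEqual 0F 3F)) (forcedEqual 0F 1F))))) ∷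 []))) ∷ (6F , (choose 4F ((5F , miscounted) ∷ []))) ∷ []))) ∷ [])))
        ∷ (8F , (choose 2F ((3F , (choose 4F ((5F , (choose 6F ((7F , miscounted) ∷ []))) ∷ (6F , (choose 5F ((7F , miscounted) ∷ []))) ∷ (7F , (choose 5F ((6F , miscounted) ∷ []))) ∷ []))) ∷ (4F , (choose 3F ((5F , (choose 6F ((7F , miscounted) ∷ []))) ∷ (6F , (choose 5F ((7F , miscounted) ∷ []))) ∷ (7F , (choose 5F ((6F , (refuted (forcedEqual 0F 1F))) ∷ []))) ∷ []))) ∷ (5F , (choose 3F ((4F , (choose 6F ((7F , (refuted (forcedEqual 0F 1F))) ∷ []))) ∷ (6F , (choose 4F ((7F , miscounted) ∷ []))) ∷ (7F , (choose 4F ((6F , miscounted) ∷ []))) ∷ []))) ∷ (6F , (choose 3F ((4F , (choose 5F ((7F , (refuted (splitOn 0F (splitOn 1F (forcedEqual 0F 1F) (splitOn 2F (forcedEqual 0F 2F) (forcedEqual 1F 2F))) (splitOn 1F (splitOn 2F (forcedEqual 1F 2F) (forcedEqual 0F 2F)) (forcedEqual 0F 1F))))) ∷ []))) ∷ (5F , (choose 4F ((7F , (refuted (splitOn 0F (splitOn 2F (splitOn 3F (splitOn 5F (splitOn 6F (forcedEqual 2F 3F) (forcedEqual 0F 2F)) (splitOn 9F (forcedEqual 0F 3F) (forcedEqual 0F 2F))) (splitOn 5F (splitOn 9F (cyclic 2F 9F 3F true) (forcedEqual 0F 2F)) (splitOn 6F (cyclic 0F 6F 3F true) (forcedEqual 0F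 2F)))) (splitOn 3F (splitOn 5F (cyclic 0F 5F 2F true) (splitOn 9F (forcedEqual 0F 3F) (cyclic 2F 9F 3F false))) (splitOn 5F (cyclic 0F 5F 2F true) (splitOn 6F (cyclic 0F 6F 3F true) (forcedEqual 2F 3F))))) (splitOn 2F (splitOn 3F (splitOn 5F (splitOn 6F (forcedEqual 2F 3F) (cyclic 0F 6F 3F false)) (cyclic 0F 5F 2F false)) (splitOn 5F (splitOn 9F (cyclic 2F 9F 3F true) (forcedEqual 0F 3F)) (cyclic 0F 5F 2F false))) (splitOn 3F (splitOn 5F (splitOn 6F (forcedEqual 0F 2F) (cyclic 0F 6F 3F false)) (splitOn 9F (forcedEqual 0F 2F) (cyclic 2F 9F 3F false))) (splitOn 5F (splitOn 9F (forcedEqual 0F 2F) (forcedEqual 0F 3F)) (splitOn 6F (forcedEqual 0F 2F) (forcedEqual 2F 3F)))))))) ∷ []))) ∷ (7F , (choose 4F ((5F , (refuted (splitOn 0F (splitOn 1F (forcedEqual 0F 1F) (splitOn 2F (forcedEqual 0F 2F) (forcedEqual 1F 2F))) (splitOn 1F (splitOn 2F (forcedEqual 1F 2F) (forcedEqual 0F 2F)) (forcedEqual 0F 1F))))) ∷ []))) ∷ []))) ∷ (7F , (choose 3F ((4F , (choose 5F ((6F , miscounted) ∷ []))) ∷ (5F , (choose 4F ((6F , miscounted) ∷ []))) ∷ (6F , (choose 4F ((5F , miscounted) ∷ []))) ∷ []))) ∷ [])))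
        ∷ [])))
    ∷ []))

certificate-excludes : excludes [] certificate ≡ true
certificate-excludes = refl

lemma16 : (m : ℕ) → 1 ≤ m → (f : Fin 5 → Vertex m) → Injective _≡_ _≡_ f →
          ¬ Is22222-3M2P (copyColoring f)
lemma16 m _ f f-injective R = Refutation.certified-impossible f f-injective R certificate certificate-excludes
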